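{- Let $K=\mathbb{Q}(\sqrt{ -3},\sqrt{5})$ with ring of integers $R$, let $\phi=(1+\sqrt{5})/2$, and let $\psi_1,\psi_2$ be two distinct embeddings of $K$ into $\mathbb{C}$ that are not complex conjugates of one another. For every $x\in K$ there is a $y\in R$ such that $\mathrm{N}_{K/\mathbb{Q}}(x-y)\le 5/9$ and $\|\psi_i(x-y)\|\le\phi^4/3$ for $i=1,2$.
   Context: For a complex number $z$, $\|z\|=|z|^2=z\bar z$. -}

module Defs where

open import Data.Bool using (Bool; true; false; not; if_then_else_)
open import Data.Integer using (ℤ; +_; -[1+_])
open import Data.List using (List; []; _∷_)
open import Data.Product using (_×_; _,_; Σ; ∃)
open import Data.Sum using (_⊎_)
open import Relation.Binary.PropositionalEquality using (_≡_; _≢_)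
open import Data.Rational as Q using (ℚ; 0ℚ; 1ℚ; _/_)

-- The field K = ℚ(√-3, √5), as a 4-dimensional ℚ-vector space with basis
-- 1, s = √-3, t = √5, st = √-15 (s² = -3, t² = 5).
record K : Set where
  constructor mkK
  field
    c1 cs ct cst : ℚ
open K public

q : ℤ → ℚ
q n = n / 1

fromℚ : ℚ → K
fromℚ a = mkK a 0ℚ 0ℚ 0ℚ

0K 1K : K
0K = fromℚ 0ℚ
1K = fromℚ 1ℚ

_+K_ : K → K → K
mkK a b c d +K mkK a' b' c' d' = mkK (a Q.+ a') (b Q.+ b') (c Q.+ c') (d Q.+ d')

-K_ : K → K
-K mkK a b c d = mkK (Q.- a) (Q.- b) (Q.- c) (Q.- d)

_-K_ : K → K → K
x -K y = x +K (-K y)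

_*K_ : K → K → K
mkK a b c d *K mkK a' b' c' d' = mkK
  (a Q.* a' Q.- q (+ 3) Q.* (b Q.* b') Q.+ q (+ 5) Q.* (c Q.* c') Q.- q (+ 15) Q.* (d Q.* d'))
  (a Q.* b' Q.+ b Q.* a' Q.+ q (+ 5) Q.* (c Q.* d' Q.+ d Q.* c'))
  (a Q.* c' Q.+ c Q.* a' Q.- q (+ 3) Q.* (b Q.* d' Q.+ d Q.* b'))
  (a Q.* d' Q.+ d Q.* a' Q.+ b Q.* c' Q.+ c Q.* b')

σ τ : K → K
σ (mkK a b c d) = mkK a (Q.- b) c (Q.- d)
τ (mkK a b c d) = mkK a b (Q.- c) (Q.- d)

-- Norm N_{K/ℚ}(z) = product of the four Galois conjugates of z (a rational number,
-- i.e. the 1-coordinate of that product; the other coordinates vanish).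
normK : K → ℚ
normK z = c1 ((z *K σ z) *K (τ z *K σ (τ z)))

-- A list (c_{n-1} ∷ … ∷ c_0) encodes
-- X^n + c_{n-1} X^{n-1} + … + c_0, evaluated by Horner's rule.
hornerMonic : K → K → List ℤ → K
hornerMonic z acc [] = acc
hornerMonic z acc (c ∷ cs) = hornerMonic z ((acc *K z) +K fromℚ (q c)) cs

IsAlgInt : K → Set
IsAlgInt z = ∃ λ (cs : List ℤ) → hornerMonic z 1K cs ≡ 0K

-- Real numbers of the form p + r√5 (p, r ∈ ℚ), with the real order.
record R5 : Set where
  constructor _+√5·_
  field
    re rt : ℚ

_*R_ : R5 → R5 → R5
(p +√5· r) *R (p' +√5· r') = (p Q.* p' Q.+ q (+ 5) Q.* (r Q.* r')) +√5· (p Q.* r' Q.+ r Q.* p')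

NonNeg : R5 → Set
NonNeg (p +√5· r) =
  (0ℚ Q.≤ p × 0ℚ Q.≤ r)
  ⊎ (0ℚ Q.≤ p × q (+ 5) Q.* (r Q.* r) Q.≤ p Q.* p)
  ⊎ (0ℚ Q.≤ r × p Q.* p Q.≤ q (+ 5) Q.* (r Q.* r))

_≤R_ : R5 → R5 → Set
(p +√5· r) ≤R (p' +√5· r') = NonNeg ((p' Q.- p) +√5· (r' Q.- r))

φ : R5
φ = (+ 1 / 2) +√5· (+ 1 / 2)

φ⁴/3 : R5
φ⁴/3 = ((+ 1 / 3) +√5· 0ℚ) *R (((φ *R φ) *R φ) *R φ)

-- Embeddings K → ℂ: determined by the images of √-3 (↦ ±i√3) and √5 (↦ ±√5).
-- (b₁ , b₂) : b₁ = true means √-3 ↦ i√3, b₂ = true means √5 ↦ +√5 (positive real root).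
Emb : Set
Emb = Bool × Bool

conjEmb : Emb → Emb
conjEmb (b₁ , b₂) = (not b₁ , b₂)

-- ‖ψ(z)‖ = |ψ(z)|² = ψ(z)·conj(ψ(z)) = ψ(z · σ z); z·σ z lies in ℚ(√5), so this
-- is the real number a + (±c)√5 where a + c√5 = z · σ z.
sqAbs : Emb → K → R5
sqAbs (b₁ , b₂) z = c1 w +√5· (if b₂ then ct w else Q.- ct w)
  where w = z *K σ z

-- In the basis 1, √-3, √5, √-15 of K, ‖ψ(z)‖ = A(z) ± √5 C(z) and N(z) = A(z)² - 5 C(z)² for two
-- rational quadratic forms A and C. Since 38/17 < √5 < 161/72, both bounds follow from five
-- polynomial inequalities for z = x - y in which √5 is replaced by these two approximations.
-- R contains the lattice W(ℤ⁴)/4 for an explicit linear map W, so choosing y means choosing an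
-- integer translate of a point in the unit cube. A certificate tree cuts the cube into dyadic
-- boxes and names a translate for each box; exact evaluation of the forms at the box centre plus
-- a Taylor bound for the deviation proves the five inequalities on the whole box.

module Submission where

module RationalFacts where
  open import Data.Rational.Unnormalised
  open import Data.Rational.Unnormalised.Properties
  open import Data.Rational.Unnormalised.Solver
  open +-*-Solver using (solve; _:+_; _:*_; _:-_; :-_; _:=_)
  open import Data.Integer as ℤ using (ℤ; +_; -[1+_])
  import Data.Integer.Properties as ℤ
  import Data.Integer.DivMod as ℤ
  open import Data.Integer.Tactic.RingSolver using (solve-∀)
  open import Data.Nat using (suc)
  open import Relation.Nullary using (yes; no)
  open import Relation.Binary.PropositionalEquality using (_≡_; cong; sym; trans; subst)

  fromℤ : ℤ → ℚᵘ
  fromℤ z = z / 1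

  fromℤ-+ : ∀ a b → fromℤ (a ℤ.+ b) ≃ fromℤ a + fromℤ b
  fromℤ-+ a b = *≡* (identity a b)
    where
    identity : ∀ a b → (a ℤ.+ b) ℤ.* + 1 ≡ (a ℤ.* + 1 ℤ.+ b ℤ.* + 1) ℤ.* + 1
    identity = solve-∀

  floor-≤ : ∀ p → fromℤ (floor p) ≤ p
  floor-≤ (mkℚᵘ n d) = *≤* (subst (ℤ._≤_ (m ℤ.* + suc d)) (trans (sym division) (sym (ℤ.*-identityʳ n)))
      (ℤ.i≤j+i (m ℤ.* + suc d) (+ r)))
    where
    m = n ℤ./ + suc d
    r = n ℤ.% + suc d
    division : n ≡ + r ℤ.+ m ℤ.* + suc d
    division = ℤ.a≡a%n+[a/n]*n n (+ suc d)

  ≤-floor+1 : ∀ p → p ≤ fromℤ (floor p ℤ.+ + 1)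
  ≤-floor+1 (mkℚᵘ n d) = *≤* (subst (ℤ._≤ (m ℤ.+ + 1) ℤ.* + suc d) (trans (sym division) (sym (ℤ.*-identityʳ n)))
      (subst (ℤ._≤_ (+ r ℤ.+ m ℤ.* + suc d)) (sym (distrib m (+ suc d)))
        (ℤ.+-monoˡ-≤ (m ℤ.* + suc d) (ℤ.<⇒≤ (ℤ.+<+ (ℤ.n%d<d n (+ suc d)))))))
    where
    m = n ℤ./ + suc d
    r = n ℤ.% + suc d
    division : n ≡ + r ℤ.+ m ℤ.* + suc d
    division = ℤ.a≡a%n+[a/n]*n n (+ suc d)
    distrib : ∀ m D → (m ℤ.+ + 1) ℤ.* D ≡ D ℤ.+ m ℤ.* D
    distrib = solve-∀

  0≤p-⌊p⌋ : ∀ p → 0ℚᵘ ≤ p - fromℤ (floor p)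
  0≤p-⌊p⌋ p = p≤q⇒0≤q-p (floor-≤ p)

  p-⌊p⌋≤1 : ∀ p → p - fromℤ (floor p) ≤ 1ℚᵘ
  p-⌊p⌋≤1 p = ≤-trans (+-monoˡ-≤ (- fromℤ (floor p)) (≤-floor+1 p))
    (≤-reflexive (≃-trans (+-congˡ (- fromℤ (floor p)) (fromℤ-+ (floor p) (+ 1)))
      (solve 2 (λ m o → (m :+ o) :- m := o) ≃-refl (fromℤ (floor p)) 1ℚᵘ)))

  p≤∣p∣ : ∀ p → p ≤ ∣ p ∣
  p≤∣p∣ (mkℚᵘ (+ n) d) = ≤-refl
  p≤∣p∣ (mkℚᵘ -[1+ n ] d) = *≤* ℤ.-≤+

  -∣p∣≤p : ∀ p → - ∣ p ∣ ≤ p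
  -∣p∣≤p p = ≤-trans (≤-reflexive-≡ (cong -_ (sym (∣-p∣≡∣p∣ p))))
    (≤-trans (neg-mono-≤ (p≤∣p∣ (- p))) (≤-reflexive (neg-involutive p)))

  -r≤p≤r⇒∣p∣≤r : ∀ {p r} → - r ≤ p → p ≤ r → ∣ p ∣ ≤ r
  -r≤p≤r⇒∣p∣≤r {mkℚᵘ (+ n) d} _ p≤r = p≤r
  -r≤p≤r⇒∣p∣≤r {mkℚᵘ -[1+ n ] d} {r} -r≤p _ = ≤-trans (neg-mono-≤ -r≤p) (≤-reflexive (neg-involutive r))

  ∣p*q∣≤∣p∣*r : ∀ p {q r} → ∣ q ∣ ≤ r → ∣ p * q ∣ ≤ ∣ p ∣ * r
  ∣p*q∣≤∣p∣*r p {q} ∣q∣≤r = ≤-trans (≤-reflexive (∣p*q∣≃∣p∣*∣q∣ p q)) (*-monoʳ-≤-nonNeg ∣ p ∣ {{∣-∣-nonNeg p}} ∣q∣≤r)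

  ∣p*q*s∣≤∣p∣*r*t : ∀ p {q s r t} → ∣ q ∣ ≤ r → ∣ s ∣ ≤ t → ∣ p * (q * s) ∣ ≤ ∣ p ∣ * (r * t)
  ∣p*q*s∣≤∣p∣*r*t p {q} {s} ∣q∣≤r ∣s∣≤t = ≤-trans (≤-reflexive (∣p*q∣≃∣p∣*∣q∣ p (q * s)))
    (*-monoʳ-≤-nonNeg ∣ p ∣ {{∣-∣-nonNeg p}}
      (≤-trans (≤-reflexive (∣p*q∣≃∣p∣*∣q∣ q s)) (*-mono-≤-nonNeg {{∣-∣-nonNeg q}} {{∣-∣-nonNeg s}} ∣q∣≤r ∣s∣≤t)))

  ∣p+q∣≤r+s : ∀ {p q r s} → ∣ p ∣ ≤ r → ∣ q ∣ ≤ s → ∣ p + q ∣ ≤ r + s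
  ∣p+q∣≤r+s {p} {q} ∣p∣≤r ∣q∣≤s = ≤-trans (∣p+q∣≤∣p∣+∣q∣ p q) (+-mono-≤ ∣p∣≤r ∣q∣≤s)

  0≤p*p : ∀ p → 0ℚᵘ ≤ p * p
  0≤p*p p with 0ℚᵘ ≤? p
  ... | yes 0≤p = nonNegative⁻¹ (p * p) {{nonNeg*nonNeg⇒nonNeg p {{nonNegative 0≤p}} p {{nonNegative 0≤p}}}}
  ... | no p<0 = ≤-trans (nonNegative⁻¹ (- p * - p) {{nonNeg*nonNeg⇒nonNeg (- p) {{0≤-p}} (- p) {{0≤-p}}}})
      (≤-reflexive (solve 1 (λ p → :- p :* :- p := p :* p) ≃-refl p))
    where
    0≤-p = nonNegative (neg-mono-≤ (≰⇒≥ p<0))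

  corner-bound : ∀ {x y a b c d M} → a ≤ x → x ≤ b → c ≤ y → y ≤ d →
    a * c ≤ M → a * d ≤ M → b * c ≤ M → b * d ≤ M → x * y ≤ M
  corner-bound {x} {y} {a} {b} ax xb cy yd ac ad bc bd with 0ℚᵘ ≤? y
  ... | yes 0≤y = ≤-trans (*-monoˡ-≤-nonNeg y {{nonNegative 0≤y}} xb) by≤M
    where
    by≤M : b * y ≤ _
    by≤M with 0ℚᵘ ≤? b
    ... | yes 0≤b = ≤-trans (*-monoʳ-≤-nonNeg b {{nonNegative 0≤b}} yd) bd
    ... | no b<0 = ≤-trans (*-monoʳ-≤-nonPos b {{nonPositive (≰⇒≥ b<0)}} cy) bc
  ... | no y<0 = ≤-trans (*-monoˡ-≤-nonPos y {{nonPositive (≰⇒≥ y<0)}} ax) ay≤M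
    where
    ay≤M : a * y ≤ _
    ay≤M with 0ℚᵘ ≤? a
    ... | yes 0≤a = ≤-trans (*-monoʳ-≤-nonNeg a {{nonNegative 0≤a}} yd) ad
    ... | no a<0 = ≤-trans (*-monoʳ-≤-nonPos a {{nonPositive (≰⇒≥ a<0)}} cy) ac


module Sqrt5 where
  open import Data.Rational.Unnormalised
  open import Data.Rational.Unnormalised.Properties
  open import Data.Rational.Unnormalised.Solver
  open +-*-Solver using (solve; _:+_; _:*_; _:-_; :-_; _:=_)
  open import Data.Integer using (+_)
  open import Data.Product using (_×_; _,_)
  open import Data.Sum using (_⊎_; inj₁; inj₂)
  open import Relation.Nullary using (yes; no)
  open RationalFacts

  NonNeg√5 : ℚᵘ → ℚᵘ → Set
  NonNeg√5 p r = (0ℚᵘ ≤ p × 0ℚᵘ ≤ r)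
    ⊎ (0ℚᵘ ≤ p × + 5 / 1 * (r * r) ≤ p * p)
    ⊎ (0ℚᵘ ≤ r × p * p ≤ + 5 / 1 * (r * r))

  0≤p+q⇒-p≤q : ∀ p q → 0ℚᵘ ≤ p + q → - p ≤ q
  0≤p+q⇒-p≤q p q 0≤p+q = ≤-trans (≤-reflexive (≃-sym (+-identityʳ (- p))))
    (≤-trans (+-monoʳ-≤ (- p) 0≤p+q) (≤-reflexive (solve 2 (λ p q → :- p :+ (p :+ q) := q) ≃-refl p q)))

  -- The squares encode ρ ≤ √5 ≤ ρ'; since p + ρ r is monotone in ρ, it is ≥ 0 at ρ = √5.
  bracket⇒NonNeg√5 : ∀ {p r ρ ρ'} → ρ * ρ ≤ + 5 / 1 → + 5 / 1 ≤ ρ' * ρ' → 0ℚᵘ ≤ ρ' →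
    0ℚᵘ ≤ p + ρ * r → 0ℚᵘ ≤ p + ρ' * r → NonNeg√5 p r
  bracket⇒NonNeg√5 {p} {r} {ρ} {ρ'} ρ²≤5 5≤ρ'² 0≤ρ' low high with 0ℚᵘ ≤? r | 0ℚᵘ ≤? p
  ... | yes 0≤r | yes 0≤p = inj₁ (0≤p , 0≤r)
  ... | yes 0≤r | no p<0 = inj₂ (inj₂ (0≤r , p²≤5r²))
    where
    0≤-p : 0ℚᵘ ≤ - p
    0≤-p = neg-mono-≤ (≰⇒≥ p<0)
    -p≤ρr : - p ≤ ρ * r
    -p≤ρr = 0≤p+q⇒-p≤q p (ρ * r) low
    p²≤5r² : p * p ≤ + 5 / 1 * (r * r)
    p²≤5r² = ≤-trans (≤-reflexive (solve 1 (λ p → p :* p := :- p :* :- p) ≃-refl p))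
      (≤-trans (*-mono-≤-nonNeg {{nonNegative 0≤-p}} {{nonNegative 0≤-p}} -p≤ρr -p≤ρr)
      (≤-trans (≤-reflexive (solve 2 (λ ρ r → (ρ :* r) :* (ρ :* r) := (ρ :* ρ) :* (r :* r)) ≃-refl ρ r))
        (*-monoˡ-≤-nonNeg (r * r) {{nonNegative (0≤p*p r)}} ρ²≤5)))
  ... | no r<0 | _ = inj₂ (inj₁ (0≤p , 5r²≤p²))
    where
    0≤-r : 0ℚᵘ ≤ - r
    0≤-r = neg-mono-≤ (≰⇒≥ r<0)
    ρ'∣r∣≤p : ρ' * (- r) ≤ p
    ρ'∣r∣≤p = ≤-trans (≤-reflexive (solve 2 (λ ρ' r → ρ' :* (:- r) := :- (ρ' :* r)) ≃-refl ρ' r))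
      (0≤p+q⇒-p≤q (ρ' * r) p (≤-trans high (≤-reflexive (+-comm p (ρ' * r)))))
    0≤ρ'∣r∣ : 0ℚᵘ ≤ ρ' * (- r)
    0≤ρ'∣r∣ = nonNegative⁻¹ (ρ' * (- r)) {{nonNeg*nonNeg⇒nonNeg ρ' {{nonNegative 0≤ρ'}} (- r) {{nonNegative 0≤-r}}}}
    0≤p : 0ℚᵘ ≤ p
    0≤p = ≤-trans 0≤ρ'∣r∣ ρ'∣r∣≤p
    5r²≤p² : + 5 / 1 * (r * r) ≤ p * p
    5r²≤p² = ≤-trans (*-monoˡ-≤-nonNeg (r * r) {{nonNegative (0≤p*p r)}} 5≤ρ'²)
      (≤-trans (≤-reflexive (solve 2 (λ ρ' r → (ρ' :* ρ') :* (r :* r) := (ρ' :* (:- r)) :* (ρ' :* (:- r))) ≃-refl ρ' r))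
        (*-mono-≤-nonNeg {{nonNegative 0≤ρ'∣r∣}} {{nonNegative 0≤ρ'∣r∣}} ρ'∣r∣≤p ρ'∣r∣≤p))


module QuadraticForm where
  open import Data.Rational.Unnormalised
  open import Data.Rational.Unnormalised.Properties
  open import Data.Rational.Unnormalised.Solver
  open +-*-Solver using (solve; Polynomial; _:+_; _:*_; _:-_; _:=_; con)
  open import Data.Integer using (+_)
  open import Data.Fin.Patterns using (0F; 1F; 2F; 3F)
  open import Data.Vec using (Vec; []; _∷_; lookup; zipWith)
  open RationalFacts

  ℚᵘ⁴ : Set
  ℚᵘ⁴ = Vec ℚᵘ 4

  infixl 6 _⊖_
  _⊖_ : ∀ {n} → Vec ℚᵘ n → Vec ℚᵘ n → Vec ℚᵘ n
  _⊖_ = zipWith _-_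

  AbsBounded : ∀ {n} → Vec ℚᵘ n → Vec ℚᵘ n → Set
  AbsBounded e r = ∀ i → ∣ lookup e i ∣ ≤ lookup r i

  record QuadForm : Set where
    constructor form
    field q00 q01 q02 q03 q11 q12 q13 q22 q23 q33 : ℚᵘ
  open QuadForm public

  eval : QuadForm → ℚᵘ⁴ → ℚᵘ
  eval (form q00 q01 q02 q03 q11 q12 q13 q22 q23 q33) (s0 ∷ s1 ∷ s2 ∷ s3 ∷ []) =
    q00 * (s0 * s0) + q01 * (s0 * s1) + q02 * (s0 * s2) + q03 * (s0 * s3)
    + q11 * (s1 * s1) + q12 * (s1 * s2) + q13 * (s1 * s3)
    + q22 * (s2 * s2) + q23 * (s2 * s3) + q33 * (s3 * s3)

  gradient : QuadForm → ℚᵘ⁴ → ℚᵘ⁴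
  gradient (form q00 q01 q02 q03 q11 q12 q13 q22 q23 q33) (c0 ∷ c1 ∷ c2 ∷ c3 ∷ []) =
    (+ 2 / 1 * q00 * c0 + q01 * c1 + q02 * c2 + q03 * c3) ∷
    (q01 * c0 + + 2 / 1 * q11 * c1 + q12 * c2 + q13 * c3) ∷
    (q02 * c0 + q12 * c1 + + 2 / 1 * q22 * c2 + q23 * c3) ∷
    (q03 * c0 + q13 * c1 + q23 * c2 + + 2 / 1 * q33 * c3) ∷ []

  dot : ℚᵘ⁴ → ℚᵘ⁴ → ℚᵘ
  dot (a0 ∷ a1 ∷ a2 ∷ a3 ∷ []) (b0 ∷ b1 ∷ b2 ∷ b3 ∷ []) = a0 * b0 + a1 * b1 + a2 * b2 + a3 * b3

  evalᴾ : ∀ {n} → Vec (Polynomial n) 10 → Vec (Polynomial n) 4 → Polynomial n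
  evalᴾ (q00 ∷ q01 ∷ q02 ∷ q03 ∷ q11 ∷ q12 ∷ q13 ∷ q22 ∷ q23 ∷ q33 ∷ []) (s0 ∷ s1 ∷ s2 ∷ s3 ∷ []) =
    q00 :* (s0 :* s0) :+ q01 :* (s0 :* s1) :+ q02 :* (s0 :* s2) :+ q03 :* (s0 :* s3)
    :+ q11 :* (s1 :* s1) :+ q12 :* (s1 :* s2) :+ q13 :* (s1 :* s3)
    :+ q22 :* (s2 :* s2) :+ q23 :* (s2 :* s3) :+ q33 :* (s3 :* s3)

  taylor : ∀ F c s → eval F s ≃ eval F c + (dot (gradient F c) (s ⊖ c) + eval F (s ⊖ c))
  taylor (form q00 q01 q02 q03 q11 q12 q13 q22 q23 q33) (c0 ∷ c1 ∷ c2 ∷ c3 ∷ []) (s0 ∷ s1 ∷ s2 ∷ s3 ∷ []) =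
    solve 18 (λ q00 q01 q02 q03 q11 q12 q13 q22 q23 q33 c0 c1 c2 c3 s0 s1 s2 s3 →
      let Q = q00 ∷ q01 ∷ q02 ∷ q03 ∷ q11 ∷ q12 ∷ q13 ∷ q22 ∷ q23 ∷ q33 ∷ []
          two = con (+ 2 / 1)
          e0 = s0 :- c0
          e1 = s1 :- c1
          e2 = s2 :- c2
          e3 = s3 :- c3
      in evalᴾ Q (s0 ∷ s1 ∷ s2 ∷ s3 ∷ []) :=
         evalᴾ Q (c0 ∷ c1 ∷ c2 ∷ c3 ∷ []) :+ (((two :* q00 :* c0 :+ q01 :* c1 :+ q02 :* c2 :+ q03 :* c3) :* e0
           :+ (q01 :* c0 :+ two :* q11 :* c1 :+ q12 :* c2 :+ q13 :* c3) :* e1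
           :+ (q02 :* c0 :+ q12 :* c1 :+ two :* q22 :* c2 :+ q23 :* c3) :* e2
           :+ (q03 :* c0 :+ q13 :* c1 :+ q23 :* c2 :+ two :* q33 :* c3) :* e3)
         :+ evalᴾ Q (e0 ∷ e1 ∷ e2 ∷ e3 ∷ [])))
      ≃-refl q00 q01 q02 q03 q11 q12 q13 q22 q23 q33 c0 c1 c2 c3 s0 s1 s2 s3

  deviation : QuadForm → ℚᵘ⁴ → ℚᵘ⁴ → ℚᵘ
  deviation F c r = gradientTerm (gradient F c) r + quadraticTerm F r
    where
    gradientTerm : ℚᵘ⁴ → ℚᵘ⁴ → ℚᵘ
    gradientTerm (g0 ∷ g1 ∷ g2 ∷ g3 ∷ []) (r0 ∷ r1 ∷ r2 ∷ r3 ∷ []) =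
      ∣ g0 ∣ * r0 + ∣ g1 ∣ * r1 + ∣ g2 ∣ * r2 + ∣ g3 ∣ * r3
    quadraticTerm : QuadForm → ℚᵘ⁴ → ℚᵘ
    quadraticTerm F (r0 ∷ r1 ∷ r2 ∷ r3 ∷ []) =
      ∣ q00 F ∣ * (r0 * r0) + ∣ q01 F ∣ * (r0 * r1) + ∣ q02 F ∣ * (r0 * r2) + ∣ q03 F ∣ * (r0 * r3)
      + ∣ q11 F ∣ * (r1 * r1) + ∣ q12 F ∣ * (r1 * r2) + ∣ q13 F ∣ * (r1 * r3)
      + ∣ q22 F ∣ * (r2 * r2) + ∣ q23 F ∣ * (r2 * r3) + ∣ q33 F ∣ * (r3 * r3)

  taylor-remainder-bound : ∀ F c e r → AbsBounded e r → ∣ dot (gradient F c) e + eval F e ∣ ≤ deviation F c r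
  taylor-remainder-bound F@(form q00 q01 q02 q03 q11 q12 q13 q22 q23 q33) c@(_ ∷ _ ∷ _ ∷ _ ∷ [])
    (e0 ∷ e1 ∷ e2 ∷ e3 ∷ []) (r0 ∷ r1 ∷ r2 ∷ r3 ∷ []) e≤r =
    ∣p+q∣≤r+s (∣p+q∣≤r+s (∣p+q∣≤r+s (∣p+q∣≤r+s (∣p*q∣≤∣p∣*r g0 h0) (∣p*q∣≤∣p∣*r g1 h1)) (∣p*q∣≤∣p∣*r g2 h2)) (∣p*q∣≤∣p∣*r g3 h3))
      (∣p+q∣≤r+s (∣p+q∣≤r+s (∣p+q∣≤r+s (∣p+q∣≤r+s (∣p+q∣≤r+s (∣p+q∣≤r+s (∣p+q∣≤r+s (∣p+q∣≤r+s (∣p+q∣≤r+s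
        (∣p*q*s∣≤∣p∣*r*t q00 h0 h0) (∣p*q*s∣≤∣p∣*r*t q01 h0 h1)) (∣p*q*s∣≤∣p∣*r*t q02 h0 h2)) (∣p*q*s∣≤∣p∣*r*t q03 h0 h3))
        (∣p*q*s∣≤∣p∣*r*t q11 h1 h1)) (∣p*q*s∣≤∣p∣*r*t q12 h1 h2)) (∣p*q*s∣≤∣p∣*r*t q13 h1 h3))
        (∣p*q*s∣≤∣p∣*r*t q22 h2 h2)) (∣p*q*s∣≤∣p∣*r*t q23 h2 h3)) (∣p*q*s∣≤∣p∣*r*t q33 h3 h3))
    where
    g0 = lookup (gradient F c) 0F
    g1 = lookup (gradient F c) 1F
    g2 = lookup (gradient F c) 2F
    g3 = lookup (gradient F c) 3F
    h0 = e≤r 0F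
    h1 = e≤r 1F
    h2 = e≤r 2F
    h3 = e≤r 3F

  eval≤centre+deviation : ∀ F c s r → AbsBounded (s ⊖ c) r → eval F s ≤ eval F c + deviation F c r
  eval≤centre+deviation F c s r close = ≤-trans (≤-reflexive (taylor F c s))
    (+-monoʳ-≤ (eval F c) (≤-trans (p≤∣p∣ _) (taylor-remainder-bound F c (s ⊖ c) r close)))

  centre-deviation≤eval : ∀ F c s r → AbsBounded (s ⊖ c) r → eval F c - deviation F c r ≤ eval F s
  centre-deviation≤eval F c s r close = ≤-trans
    (+-monoʳ-≤ (eval F c) (≤-trans (neg-mono-≤ (taylor-remainder-bound F c (s ⊖ c) r close)) (-∣p∣≤p _)))
    (≤-reflexive (≃-sym (taylor F c s)))

  coefficients : QuadForm → Vec ℚᵘ 10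
  coefficients (form q00 q01 q02 q03 q11 q12 q13 q22 q23 q33) = q00 ∷ q01 ∷ q02 ∷ q03 ∷ q11 ∷ q12 ∷ q13 ∷ q22 ∷ q23 ∷ q33 ∷ []


module BoxCover where
  open import Data.Rational.Unnormalised
  open import Data.Rational.Unnormalised.Properties
  open import Data.Rational.Unnormalised.Solver
  open +-*-Solver using (solve; _:+_; _:*_; _:-_; :-_; _:=_; con)
  open import Data.Integer using (ℤ; +_)
  open import Data.Fin using (Fin; zero; suc) renaming (_≟_ to _≟ᶠ_)
  open import Data.Nat using (ℕ)
  open import Data.Vec using (Vec; _∷_; lookup; map; zipWith; _[_]≔_)
  open import Data.Vec.Properties using (lookup∘update; lookup∘update′)
  open import Data.Bool using (Bool; T; _∧_)
  open import Data.Bool.Properties using (T-∧)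
  open import Data.Product using (Σ; _×_; _,_; proj₁; proj₂)
  open import Function using (_∘_; Equivalence)
  open import Relation.Nullary using (yes; no)
  open import Relation.Binary.PropositionalEquality using (refl; sym; subst)
  open RationalFacts
  open QuadraticForm using (_⊖_; AbsBounded)

  -- Box corners are integers in units of 1/256.
  ½mesh : ℚᵘ
  ½mesh = + 1 / 512

  gridPoint : ℤ → ℚᵘ
  gridPoint z = fromℤ z * (+ 2 / 1 * ½mesh)

  InBox : ∀ {n} → Vec ℤ n → Vec ℤ n → Vec ℚᵘ n → Set
  InBox L H f = ∀ i → gridPoint (lookup L i) ≤ lookup f i × lookup f i ≤ gridPoint (lookup H i)

  centre : ∀ {n} → Vec ℤ n → Vec ℤ n → Vec ℤ n → Vec ℚᵘ n
  centre L H N = zipWith (λ l h → (fromℤ l + fromℤ h) * ½mesh) L H ⊖ map fromℤ N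

  radius : ∀ {n} → Vec ℤ n → Vec ℤ n → Vec ℚᵘ n
  radius = zipWith (λ l h → (fromℤ h - fromℤ l) * ½mesh)

  centre-close-coordinate : ∀ l h m x → gridPoint l ≤ x → x ≤ gridPoint h →
    ∣ (x - fromℤ m) - ((fromℤ l + fromℤ h) * ½mesh - fromℤ m) ∣ ≤ (fromℤ h - fromℤ l) * ½mesh
  centre-close-coordinate l h m x l≤x x≤h = -r≤p≤r⇒∣p∣≤r lower upper
    where
    r = (fromℤ h - fromℤ l) * ½mesh
    u = (x - fromℤ m) - ((fromℤ l + fromℤ h) * ½mesh - fromℤ m)
    u≃above : u ≃ (x - gridPoint l) + (- r)
    u≃above = solve 5 (λ x l h m k → (x :- m) :- ((l :+ h) :* k :- m) := (x :- l :* (con (+ 2 / 1) :* k)) :+ (:- ((h :- l) :* k)))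
      ≃-refl x (fromℤ l) (fromℤ h) (fromℤ m) ½mesh
    u≃below : u ≃ r + (- (gridPoint h - x))
    u≃below = solve 5 (λ x l h m k → (x :- m) :- ((l :+ h) :* k :- m) := ((h :- l) :* k) :+ (:- (h :* (con (+ 2 / 1) :* k) :- x)))
      ≃-refl x (fromℤ l) (fromℤ h) (fromℤ m) ½mesh
    lower : - r ≤ u
    lower = ≤-trans (≤-reflexive (≃-sym (+-identityˡ (- r))))
      (≤-trans (+-monoˡ-≤ (- r) (p≤q⇒0≤q-p l≤x)) (≤-reflexive (≃-sym u≃above)))
    upper : u ≤ r
    upper = ≤-trans (≤-reflexive u≃below) (≤-trans (+-monoʳ-≤ r (neg-mono-≤ (p≤q⇒0≤q-p x≤h))) (≤-reflexive (+-identityʳ r)))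

  centre-close : ∀ {n} (L H N : Vec ℤ n) f → InBox L H f →
    AbsBounded ((f ⊖ map fromℤ N) ⊖ centre L H N) (radius L H)
  centre-close (l ∷ L) (h ∷ H) (m ∷ N) (x ∷ f) box zero = centre-close-coordinate l h m x (proj₁ (box zero)) (proj₂ (box zero))
  centre-close (l ∷ L) (h ∷ H) (m ∷ N) (x ∷ f) box (suc i) = centre-close L H N f (box ∘ suc) i

  shrink-upper : ∀ {n} (L H : Vec ℤ n) f i M → InBox L H f → lookup f i ≤ gridPoint M → InBox L (H [ i ]≔ M) f
  shrink-upper L H f i M box f≤M j with i ≟ᶠ j
  ... | yes refl = proj₁ (box i) , subst (λ h → lookup f i ≤ gridPoint h) (sym (lookup∘update i H M)) f≤M
  ... | no i≢j = proj₁ (box j) , subst (λ h → lookup f j ≤ gridPoint h) (sym (lookup∘update′ (i≢j ∘ sym) H M)) (proj₂ (box j))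

  shrink-lower : ∀ {n} (L H : Vec ℤ n) f i M → InBox L H f → gridPoint M ≤ lookup f i → InBox (L [ i ]≔ M) H f
  shrink-lower L H f i M box M≤f j with i ≟ᶠ j
  ... | yes refl = subst (λ l → gridPoint l ≤ lookup f i) (sym (lookup∘update i L M)) M≤f , proj₂ (box i)
  ... | no i≢j = subst (λ l → gridPoint l ≤ lookup f j) (sym (lookup∘update′ (i≢j ∘ sym) L M)) (proj₁ (box j)) , proj₂ (box j)

  -- A node splits its box along coordinate i at grid value M; a leaf names the integer
  -- translate that works on its box.
  data Tree (n : ℕ) : Set where
    leaf : Vec ℤ n → Tree n
    node : Fin n → ℤ → Tree n → Tree n → Tree n

  module Certified {n : ℕ} (P : Vec ℚᵘ n → Set) (test : Vec ℚᵘ n → Vec ℚᵘ n → Bool)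
    (test-sound : ∀ c r s → T (test c r) → AbsBounded (s ⊖ c) r → P s) where

    valid : Vec ℤ n → Vec ℤ n → Tree n → Bool
    valid L H (leaf N) = test (centre L H N) (radius L H)
    valid L H (node i M l r) = valid L (H [ i ]≔ M) l ∧ valid (L [ i ]≔ M) H r

    cover : ∀ t L H → T (valid L H t) → ∀ f → InBox L H f → Σ (Vec ℤ n) (λ N → P (f ⊖ map fromℤ N))
    cover (leaf N) L H ok f box = N , test-sound (centre L H N) (radius L H) (f ⊖ map fromℤ N) ok (centre-close L H N f box)
    cover (node i M l r) L H ok f box with lookup f i ≤? gridPoint M | Equivalence.to T-∧ ok
    ... | yes f≤M | okₗ , _ = cover l L (H [ i ]≔ M) okₗ f (shrink-upper L H f i M box f≤M)
    ... | no f≰M | _ , okᵣ = cover r (L [ i ]≔ M) H okᵣ f (shrink-lower L H f i M box (≰⇒≥ f≰M))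


module Expr where
  open import Data.Integer as ℤ using (ℤ; +_)
  open import Data.Integer.GCD using (gcd)
  open import Data.Integer.Tactic.RingSolver using (solve-∀)
  open import Data.Rational as ℚ using (ℚ; ↥_; ↧_; toℚᵘ)
  import Data.Rational.Properties as ℚ
  open import Data.Rational.Unnormalised as ℚᵘ using (ℚᵘ; _≃_; *≡*)
  import Data.Rational.Unnormalised.Properties as ℚᵘ
  open import Data.Fin using (Fin)
  open import Data.Vec using (Vec; lookup; map)
  open import Data.Vec.Properties using (lookup-map)
  open import Data.Vec.Relation.Binary.Pointwise.Inductive as Pointwise using (Pointwise)
  open import Relation.Binary.PropositionalEquality
  open ≡-Reasoning
  open import Defs using (q)
  open RationalFacts using (fromℤ; fromℤ-+)

  toℚᵘ-q : ∀ k → toℚᵘ (q k) ≃ fromℤ k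
  toℚᵘ-q k = *≡* (begin
      ℚᵘ.↥ toℚᵘ (q k) ℤ.* + 1       ≡⟨ cong (ℤ._* + 1) (ℚ.↥ᵘ-toℚᵘ (q k)) ⟩
      ↥ q k ℤ.* + 1                 ≡⟨ cong (↥ q k ℤ.*_) (sym (ℚ.↧-/ k 1)) ⟩
      ↥ q k ℤ.* (↧ q k ℤ.* g)       ≡⟨ rearrange (↥ q k) (↧ q k) g ⟩
      (↥ q k ℤ.* g) ℤ.* ↧ q k       ≡⟨ cong (ℤ._* ↧ q k) (ℚ.↥-/ k 1) ⟩
      k ℤ.* ↧ q k                   ≡⟨ cong (k ℤ.*_) (sym (ℚ.↧ᵘ-toℚᵘ (q k))) ⟩
      k ℤ.* ℚᵘ.↧ toℚᵘ (q k)         ∎)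
    where
    g = gcd k (+ 1)
    rearrange : ∀ a b c → a ℤ.* (b ℤ.* c) ≡ (a ℤ.* c) ℤ.* b
    rearrange = solve-∀

  q-+ : ∀ a b → q (a ℤ.+ b) ≡ q a ℚ.+ q b
  q-+ a b = ℚ.toℚᵘ-injective (ℚᵘ.≃-trans (toℚᵘ-q (a ℤ.+ b)) (ℚᵘ.≃-trans (fromℤ-+ a b)
    (ℚᵘ.≃-trans (ℚᵘ.+-cong (ℚᵘ.≃-sym (toℚᵘ-q a)) (ℚᵘ.≃-sym (toℚᵘ-q b))) (ℚᵘ.≃-sym (ℚ.toℚᵘ-homo-+ (q a) (q b))))))

  q-* : ∀ a b → q (a ℤ.* b) ≡ q a ℚ.* q b
  q-* a b = ℚ.toℚᵘ-injective (ℚᵘ.≃-trans (toℚᵘ-q (a ℤ.* b))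
    (ℚᵘ.≃-trans (ℚᵘ.*-cong (ℚᵘ.≃-sym (toℚᵘ-q a)) (ℚᵘ.≃-sym (toℚᵘ-q b))) (ℚᵘ.≃-sym (ℚ.toℚᵘ-homo-* (q a) (q b)))))

  q-neg : ∀ a → q (ℤ.- a) ≡ ℚ.- q a
  q-neg a = ℚ.toℚᵘ-injective (ℚᵘ.≃-trans (toℚᵘ-q (ℤ.- a))
    (ℚᵘ.≃-trans (ℚᵘ.-‿cong (ℚᵘ.≃-sym (toℚᵘ-q a))) (ℚᵘ.≃-sym (ℚ.toℚᵘ-homo‿- (q a)))))

  -- One syntax for integer polynomials in four variables, evaluated in ℤ, ℚ, ℚᵘ and solver
  -- polynomials, so that identities proved over ℚ apply to the integer data of the lattice.
  data Expr : Set where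
    var : Fin 4 → Expr
    lit : ℤ → Expr
    _⊕_ _⊗_ : Expr → Expr → Expr
    ⊝_ : Expr → Expr

  infixl 6 _⊕_
  infixl 7 _⊗_
  infix 8 ⊝_

  record ExprAlgebra (A : Set) : Set where
    field
      _+_ _*_ : A → A → A
      -_ : A → A
      constant : ℤ → A

  ⟦_⟧ : ∀ {A} → Expr → ExprAlgebra A → Vec A 4 → A
  ⟦ var i ⟧ 𝔸 ρ = lookup ρ i
  ⟦ lit z ⟧ 𝔸 ρ = ExprAlgebra.constant 𝔸 z
  ⟦ e ⊕ e′ ⟧ 𝔸 ρ = ExprAlgebra._+_ 𝔸 (⟦ e ⟧ 𝔸 ρ) (⟦ e′ ⟧ 𝔸 ρ)
  ⟦ e ⊗ e′ ⟧ 𝔸 ρ = ExprAlgebra._*_ 𝔸 (⟦ e ⟧ 𝔸 ρ) (⟦ e′ ⟧ 𝔸 ρ)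
  ⟦ ⊝ e ⟧ 𝔸 ρ = ExprAlgebra.-_ 𝔸 (⟦ e ⟧ 𝔸 ρ)

  ℤ-algebra : ExprAlgebra ℤ
  ℤ-algebra = record { _+_ = ℤ._+_ ; _*_ = ℤ._*_ ; -_ = ℤ.-_ ; constant = λ z → z }

  ℚ-algebra : ExprAlgebra ℚ
  ℚ-algebra = record { _+_ = ℚ._+_ ; _*_ = ℚ._*_ ; -_ = ℚ.-_ ; constant = q }

  ℚᵘ-algebra : ExprAlgebra ℚᵘ
  ℚᵘ-algebra = record { _+_ = ℚᵘ._+_ ; _*_ = ℚᵘ._*_ ; -_ = ℚᵘ.-_ ; constant = fromℤ }

  ⟦_⟧ℤ : Expr → Vec ℤ 4 → ℤ
  ⟦ e ⟧ℤ = ⟦ e ⟧ ℤ-algebra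

  ⟦_⟧ℚ : Expr → Vec ℚ 4 → ℚ
  ⟦ e ⟧ℚ = ⟦ e ⟧ ℚ-algebra

  ⟦_⟧ᵘ : Expr → Vec ℚᵘ 4 → ℚᵘ
  ⟦ e ⟧ᵘ = ⟦ e ⟧ ℚᵘ-algebra

  q-⟦⟧ : ∀ e ρ → q (⟦ e ⟧ℤ ρ) ≡ ⟦ e ⟧ℚ (map q ρ)
  q-⟦⟧ (var i) ρ = sym (lookup-map i q ρ)
  q-⟦⟧ (lit z) ρ = refl
  q-⟦⟧ (e ⊕ e′) ρ = trans (q-+ (⟦ e ⟧ℤ ρ) (⟦ e′ ⟧ℤ ρ)) (cong₂ ℚ._+_ (q-⟦⟧ e ρ) (q-⟦⟧ e′ ρ))
  q-⟦⟧ (e ⊗ e′) ρ = trans (q-* (⟦ e ⟧ℤ ρ) (⟦ e′ ⟧ℤ ρ)) (cong₂ ℚ._*_ (q-⟦⟧ e ρ) (q-⟦⟧ e′ ρ))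
  q-⟦⟧ (⊝ e) ρ = trans (q-neg (⟦ e ⟧ℤ ρ)) (cong ℚ.-_ (q-⟦⟧ e ρ))

  fromℤ-⟦⟧ : ∀ e ρ → fromℤ (⟦ e ⟧ℤ ρ) ≃ ⟦ e ⟧ᵘ (map fromℤ ρ)
  fromℤ-⟦⟧ (var i) ρ = ℚᵘ.≃-reflexive (sym (lookup-map i fromℤ ρ))
  fromℤ-⟦⟧ (lit z) ρ = ℚᵘ.≃-refl
  fromℤ-⟦⟧ (e ⊕ e′) ρ = ℚᵘ.≃-trans (fromℤ-+ (⟦ e ⟧ℤ ρ) (⟦ e′ ⟧ℤ ρ)) (ℚᵘ.+-cong (fromℤ-⟦⟧ e ρ) (fromℤ-⟦⟧ e′ ρ))
  fromℤ-⟦⟧ (e ⊗ e′) ρ = ℚᵘ.*-cong (fromℤ-⟦⟧ e ρ) (fromℤ-⟦⟧ e′ ρ)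
  fromℤ-⟦⟧ (⊝ e) ρ = ℚᵘ.-‿cong (fromℤ-⟦⟧ e ρ)

  toℚᵘ-⟦⟧ : ∀ e ρ → toℚᵘ (⟦ e ⟧ℚ ρ) ≃ ⟦ e ⟧ᵘ (map toℚᵘ ρ)
  toℚᵘ-⟦⟧ (var i) ρ = ℚᵘ.≃-reflexive (sym (lookup-map i toℚᵘ ρ))
  toℚᵘ-⟦⟧ (lit z) ρ = toℚᵘ-q z
  toℚᵘ-⟦⟧ (e ⊕ e′) ρ = ℚᵘ.≃-trans (ℚ.toℚᵘ-homo-+ (⟦ e ⟧ℚ ρ) (⟦ e′ ⟧ℚ ρ)) (ℚᵘ.+-cong (toℚᵘ-⟦⟧ e ρ) (toℚᵘ-⟦⟧ e′ ρ))
  toℚᵘ-⟦⟧ (e ⊗ e′) ρ = ℚᵘ.≃-trans (ℚ.toℚᵘ-homo-* (⟦ e ⟧ℚ ρ) (⟦ e′ ⟧ℚ ρ)) (ℚᵘ.*-cong (toℚᵘ-⟦⟧ e ρ) (toℚᵘ-⟦⟧ e′ ρ))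
  toℚᵘ-⟦⟧ (⊝ e) ρ = ℚᵘ.≃-trans (ℚ.toℚᵘ-homo‿- (⟦ e ⟧ℚ ρ)) (ℚᵘ.-‿cong (toℚᵘ-⟦⟧ e ρ))

  ⟦⟧ᵘ-cong : ∀ e {ρ ρ′} → Pointwise _≃_ ρ ρ′ → ⟦ e ⟧ᵘ ρ ≃ ⟦ e ⟧ᵘ ρ′
  ⟦⟧ᵘ-cong (var i) ρ≈ρ′ = Pointwise.lookup ρ≈ρ′ i
  ⟦⟧ᵘ-cong (lit z) ρ≈ρ′ = ℚᵘ.≃-refl
  ⟦⟧ᵘ-cong (e ⊕ e′) ρ≈ρ′ = ℚᵘ.+-cong (⟦⟧ᵘ-cong e ρ≈ρ′) (⟦⟧ᵘ-cong e′ ρ≈ρ′)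
  ⟦⟧ᵘ-cong (e ⊗ e′) ρ≈ρ′ = ℚᵘ.*-cong (⟦⟧ᵘ-cong e ρ≈ρ′) (⟦⟧ᵘ-cong e′ ρ≈ρ′)
  ⟦⟧ᵘ-cong (⊝ e) ρ≈ρ′ = ℚᵘ.-‿cong (⟦⟧ᵘ-cong e ρ≈ρ′)


module Integrality where
  open import Data.Integer using (ℤ; +_)
  open import Data.Rational as ℚ using (ℚ; 0ℚ; 1ℚ; _/_)
  open import Data.Rational.Solver using (module +-*-Solver)
  open +-*-Solver using (solve; Polynomial; _:+_; _:*_; _:-_; :-_; _:=_; con)
  open import Data.Nat using (ℕ)
  open import Data.Fin.Patterns using (0F; 1F; 2F; 3F)
  open import Data.Product using (_×_; _,_; proj₁; proj₂)
  open import Data.List using (List; []; _∷_; map)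
  open import Data.List.Properties using (map-∘; map-cong)
  open import Data.Vec as Vec using (Vec; []; _∷_)
  open import Relation.Binary.PropositionalEquality
  open import Defs
  open Expr

  cong₄ : ∀ {A B : Set} (f : A → A → A → A → B) {x₀ x₁ x₂ x₃ y₀ y₁ y₂ y₃} →
    x₀ ≡ y₀ → x₁ ≡ y₁ → x₂ ≡ y₂ → x₃ ≡ y₃ → f x₀ x₁ x₂ x₃ ≡ f y₀ y₁ y₂ y₃
  cong₄ f refl refl refl refl = refl

  -- Elements of K with solver-polynomial coordinates; the operations mirror Defs, so the ring
  -- solver can normalise identities in K coordinatewise.
  Kᴾ : ℕ → Set
  Kᴾ n = Polynomial n × Polynomial n × Polynomial n × Polynomial n

  module _ {n : ℕ} where
    _*ᴾ_ : Kᴾ n → Kᴾ n → Kᴾ n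
    (a , b , c , d) *ᴾ (a′ , b′ , c′ , d′) =
      (a :* a′ :- con (q (+ 3)) :* (b :* b′) :+ con (q (+ 5)) :* (c :* c′) :- con (q (+ 15)) :* (d :* d′)) ,
      (a :* b′ :+ b :* a′ :+ con (q (+ 5)) :* (c :* d′ :+ d :* c′)) ,
      (a :* c′ :+ c :* a′ :- con (q (+ 3)) :* (b :* d′ :+ d :* b′)) ,
      (a :* d′ :+ d :* a′ :+ b :* c′ :+ c :* b′)

    _+ᴾ_ : Kᴾ n → Kᴾ n → Kᴾ n
    (a , b , c , d) +ᴾ (a′ , b′ , c′ , d′) = (a :+ a′) , (b :+ b′) , (c :+ c′) , (d :+ d′)

    σᴾ τᴾ : Kᴾ n → Kᴾ n
    σᴾ (a , b , c , d) = a , :- b , c , :- d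
    τᴾ (a , b , c , d) = a , b , :- c , :- d

    fromℚᴾ : Polynomial n → Kᴾ n
    fromℚᴾ a = a , con 0ℚ , con 0ℚ , con 0ℚ

    polynomial-algebra : ExprAlgebra (Polynomial n)
    polynomial-algebra = record { _+_ = _:+_ ; _*_ = _:*_ ; -_ = :-_ ; constant = λ z → con (q z) }

    ⟦_⟧ᴾ : Expr → Vec (Polynomial n) 4 → Polynomial n
    ⟦ e ⟧ᴾ = ⟦ e ⟧ polynomial-algebra

  a b c d : Expr
  a = var 0F
  b = var 1F
  c = var 2F
  d = var 3F

  -- 4 × the coordinates of a + bω + cφ + dωφ ∈ R (ω = (-1 + √-3)/2) in the basis 1, √-3, √5, √-15
  x₀ x₁ x₂ x₃ : Expr
  x₀ = lit (+ 4) ⊗ a ⊕ lit (+ 2) ⊗ ⊝ b ⊕ lit (+ 2) ⊗ c ⊕ ⊝ d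
  x₁ = lit (+ 2) ⊗ b ⊕ d
  x₂ = lit (+ 2) ⊗ c ⊕ ⊝ d
  x₃ = d

  -- y is a root of X² - BX + E with B = y + σ y = b₀ + b₁φ and E = y σ y = e₀ + e₁φ in ℚ(√5);
  -- minimalPolynomial is X² - BX + E times its conjugate under √5 ↦ -√5.
  b₀ b₁ e₀ e₁ : Expr
  b₀ = lit (+ 2) ⊗ a ⊕ ⊝ b
  b₁ = lit (+ 2) ⊗ c ⊕ ⊝ d
  e₀ = a ⊗ a ⊕ ⊝ (a ⊗ b) ⊕ b ⊗ b ⊕ c ⊗ c ⊕ ⊝ (c ⊗ d) ⊕ d ⊗ d
  e₁ = lit (+ 2) ⊗ a ⊗ c ⊕ c ⊗ c ⊕ ⊝ (a ⊗ d) ⊕ ⊝ (b ⊗ c) ⊕ ⊝ (c ⊗ d) ⊕ lit (+ 2) ⊗ b ⊗ d ⊕ d ⊗ d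

  minimalPolynomial : List Expr
  minimalPolynomial =
    ⊝ (lit (+ 2) ⊗ b₀ ⊕ b₁) ∷
    lit (+ 2) ⊗ e₀ ⊕ e₁ ⊕ b₀ ⊗ b₀ ⊕ b₀ ⊗ b₁ ⊕ ⊝ (b₁ ⊗ b₁) ∷
    ⊝ (lit (+ 2) ⊗ b₀ ⊗ e₀ ⊕ b₀ ⊗ e₁ ⊕ b₁ ⊗ e₀ ⊕ ⊝ (lit (+ 2) ⊗ b₁ ⊗ e₁)) ∷
    e₀ ⊗ e₀ ⊕ e₀ ⊗ e₁ ⊕ ⊝ (e₁ ⊗ e₁) ∷ []

  ¼ : ℚ
  ¼ = + 1 / 4

  latticePoint : Vec ℤ 4 → K
  latticePoint Y = mkK (q (⟦ x₀ ⟧ℤ Y) ℚ.* ¼) (q (⟦ x₁ ⟧ℤ Y) ℚ.* ¼) (q (⟦ x₂ ⟧ℤ Y) ℚ.* ¼) (q (⟦ x₃ ⟧ℤ Y) ℚ.* ¼)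

  pointℚ : Vec ℚ 4 → K
  pointℚ ρ = mkK (⟦ x₀ ⟧ℚ ρ ℚ.* ¼) (⟦ x₁ ⟧ℚ ρ ℚ.* ¼) (⟦ x₂ ⟧ℚ ρ ℚ.* ¼) (⟦ x₃ ⟧ℚ ρ ℚ.* ¼)

  hornerℚ : K → K → List ℚ → K
  hornerℚ z acc [] = acc
  hornerℚ z acc (k ∷ ks) = hornerℚ z ((acc *K z) +K fromℚ k) ks

  hornerMonic≡hornerℚ : ∀ z acc ks → hornerMonic z acc ks ≡ hornerℚ z acc (map q ks)
  hornerMonic≡hornerℚ z acc [] = refl
  hornerMonic≡hornerℚ z acc (k ∷ ks) = hornerMonic≡hornerℚ z ((acc *K z) +K fromℚ (q k)) ks

  module _ {n : ℕ} (ρ : Vec (Polynomial n) 4) where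
    pointᴾ : Kᴾ n
    pointᴾ = (⟦ x₀ ⟧ᴾ ρ :* con ¼) , (⟦ x₁ ⟧ᴾ ρ :* con ¼) , (⟦ x₂ ⟧ᴾ ρ :* con ¼) , (⟦ x₃ ⟧ᴾ ρ :* con ¼)

    hornerᴾ : Kᴾ n → List Expr → Kᴾ n
    hornerᴾ acc [] = acc
    hornerᴾ acc (k ∷ ks) = hornerᴾ ((acc *ᴾ pointᴾ) +ᴾ fromℚᴾ (⟦ k ⟧ᴾ ρ)) ks

    minimalPolynomialᴾ : Kᴾ n
    minimalPolynomialᴾ = hornerᴾ (fromℚᴾ (con 1ℚ)) minimalPolynomial

  minimalPolynomial-root : ∀ ρ → hornerℚ (pointℚ ρ) 1K (map (λ k → ⟦ k ⟧ℚ ρ) minimalPolynomial) ≡ 0K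
  minimalPolynomial-root (a ∷ b ∷ c ∷ d ∷ []) = cong₄ mkK
    (solve 4 (λ a b c d → proj₁ (minimalPolynomialᴾ (a ∷ b ∷ c ∷ d ∷ [])) := con 0ℚ) refl a b c d)
    (solve 4 (λ a b c d → proj₁ (proj₂ (minimalPolynomialᴾ (a ∷ b ∷ c ∷ d ∷ []))) := con 0ℚ) refl a b c d)
    (solve 4 (λ a b c d → proj₁ (proj₂ (proj₂ (minimalPolynomialᴾ (a ∷ b ∷ c ∷ d ∷ [])))) := con 0ℚ) refl a b c d)
    (solve 4 (λ a b c d → proj₂ (proj₂ (proj₂ (minimalPolynomialᴾ (a ∷ b ∷ c ∷ d ∷ [])))) := con 0ℚ) refl a b c d)

  latticePoint≡pointℚ : ∀ Y → latticePoint Y ≡ pointℚ (Vec.map q Y)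
  latticePoint≡pointℚ Y = cong₄ mkK (cong (ℚ._* ¼) (q-⟦⟧ x₀ Y)) (cong (ℚ._* ¼) (q-⟦⟧ x₁ Y))
    (cong (ℚ._* ¼) (q-⟦⟧ x₂ Y)) (cong (ℚ._* ¼) (q-⟦⟧ x₃ Y))

  latticePoint-isAlgInt : ∀ Y → IsAlgInt (latticePoint Y)
  latticePoint-isAlgInt Y = map (λ k → ⟦ k ⟧ℤ Y) minimalPolynomial , (begin
    hornerMonic (latticePoint Y) 1K (map (λ k → ⟦ k ⟧ℤ Y) minimalPolynomial)
      ≡⟨ hornerMonic≡hornerℚ (latticePoint Y) 1K (map (λ k → ⟦ k ⟧ℤ Y) minimalPolynomial) ⟩
    hornerℚ (latticePoint Y) 1K (map q (map (λ k → ⟦ k ⟧ℤ Y) minimalPolynomial))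
      ≡⟨ cong₂ (λ y ks → hornerℚ y 1K ks) (latticePoint≡pointℚ Y)
           (trans (sym (map-∘ {g = q} {f = λ k → ⟦ k ⟧ℤ Y} minimalPolynomial)) (map-cong (λ k → q-⟦⟧ k Y) minimalPolynomial)) ⟩
    hornerℚ (pointℚ (Vec.map q Y)) 1K (map (λ k → ⟦ k ⟧ℚ (Vec.map q Y)) minimalPolynomial)
      ≡⟨ minimalPolynomial-root (Vec.map q Y) ⟩
    0K ∎)
    where open ≡-Reasoning


module NormFormulas where
  open import Data.Rational using (ℚ)
  open import Data.Rational.Solver using (module +-*-Solver)
  open +-*-Solver using (solve; _:=_)
  open import Data.Integer using (+_)
  open import Data.Vec using (Vec; []; _∷_)
  open import Data.Product using (_,_; proj₁; proj₂)
  open import Relation.Binary.PropositionalEquality using (_≡_; refl)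
  open import Defs
  open Expr
  open Integrality using (a; b; c; d; _*ᴾ_; σᴾ; τᴾ; ⟦_⟧ᴾ)

  coordinates : K → Vec ℚ 4
  coordinates z = c1 z ∷ cs z ∷ ct z ∷ cst z ∷ []

  -- ‖ψ(z)‖ = A z ± √5 C z, in the coordinates of z in the basis 1, √-3, √5, √-15.
  Aₑ Cₑ : Expr
  Aₑ = a ⊗ a ⊕ lit (+ 3) ⊗ (b ⊗ b) ⊕ lit (+ 5) ⊗ (c ⊗ c) ⊕ lit (+ 15) ⊗ (d ⊗ d)
  Cₑ = lit (+ 2) ⊗ (a ⊗ c) ⊕ lit (+ 6) ⊗ (b ⊗ d)

  Nₑ : Expr
  Nₑ = Aₑ ⊗ Aₑ ⊕ ⊝ (lit (+ 5) ⊗ (Cₑ ⊗ Cₑ))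

  c1-zσz : ∀ z → c1 (z *K σ z) ≡ ⟦ Aₑ ⟧ℚ (coordinates z)
  c1-zσz z = solve 4 (λ a b c d → proj₁ ((a , b , c , d) *ᴾ σᴾ (a , b , c , d)) := ⟦ Aₑ ⟧ᴾ (a ∷ b ∷ c ∷ d ∷ [])) refl
    (c1 z) (cs z) (ct z) (cst z)

  ct-zσz : ∀ z → ct (z *K σ z) ≡ ⟦ Cₑ ⟧ℚ (coordinates z)
  ct-zσz z = solve 4 (λ a b c d → proj₁ (proj₂ (proj₂ ((a , b , c , d) *ᴾ σᴾ (a , b , c , d)))) := ⟦ Cₑ ⟧ᴾ (a ∷ b ∷ c ∷ d ∷ [])) refl
    (c1 z) (cs z) (ct z) (cst z)

  normK≡A²-5C² : ∀ z → normK z ≡ ⟦ Nₑ ⟧ℚ (coordinates z)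
  normK≡A²-5C² z = solve 4 (λ a b c d → let w = (a , b , c , d) in
      proj₁ ((w *ᴾ σᴾ w) *ᴾ (τᴾ w *ᴾ σᴾ (τᴾ w))) := ⟦ Nₑ ⟧ᴾ (a ∷ b ∷ c ∷ d ∷ [])) refl
    (c1 z) (cs z) (ct z) (cst z)


module Targets where
  open import Data.Rational.Unnormalised
  open import Data.Rational.Unnormalised.Properties using (≤ᵇ⇒≤; ≤-trans)
  open import Data.Integer as ℤ using (+_)
  open import Data.Bool using (Bool; T; _∧_)
  open import Data.Bool.Properties using (T-∧)
  open import Data.Product using (_,_)
  open import Function using (Equivalence)
  open RationalFacts
  open QuadraticForm

  A∘W C∘W : QuadForm
  A∘W = form (fromℤ (+ 16)) (fromℤ (ℤ.- + 16)) (fromℤ (+ 16)) (fromℤ (ℤ.- + 8)) (fromℤ (+ 16))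
             (fromℤ (ℤ.- + 8)) (fromℤ (+ 16)) (fromℤ (+ 24)) (fromℤ (ℤ.- + 24)) (fromℤ (+ 24))
  C∘W = form (fromℤ (+ 0)) (fromℤ (+ 0)) (fromℤ (+ 16)) (fromℤ (ℤ.- + 8)) (fromℤ (+ 0))
             (fromℤ (ℤ.- + 8)) (fromℤ (+ 16)) (fromℤ (+ 8)) (fromℤ (ℤ.- + 8)) (fromℤ (+ 8))

  _+ᶠ_·_ : QuadForm → ℚᵘ → QuadForm → QuadForm
  form a00 a01 a02 a03 a11 a12 a13 a22 a23 a33 +ᶠ κ · form c00 c01 c02 c03 c11 c12 c13 c22 c23 c33 =
    form (a00 + κ * c00) (a01 + κ * c01) (a02 + κ * c02) (a03 + κ * c03) (a11 + κ * c11)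
         (a12 + κ * c12) (a13 + κ * c13) (a22 + κ * c22) (a23 + κ * c23) (a33 + κ * c33)

  κ₁ κ₃ : ℚᵘ
  κ₁ = + 38 / 17
  κ₃ = + 161 / 72

  -- β = 16 (7/6 + κ/2): the bound A + κ C ≤ 7/6 + κ/2 for z, in grid coordinates of 4 z.
  β₁ β₃ : ℚᵘ
  β₁ = + 3728 / 102
  β₃ = + 5264 / 144

  F₁ F₂ F₃ F₄ : QuadForm
  F₁ = A∘W +ᶠ κ₁ · C∘W
  F₂ = A∘W +ᶠ (- κ₁) · C∘W
  F₃ = A∘W +ᶠ κ₃ · C∘W
  F₄ = A∘W +ᶠ (- κ₃) · C∘W

  -- 256 · 5/9, the norm bound for a product of two forms scaled by 16
  normBound : ℚᵘ
  normBound = + 1280 / 9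

  record WithinTargets (s : ℚᵘ⁴) : Set where
    field
      F₁≤β₁ : eval F₁ s ≤ β₁
      F₂≤β₁ : eval F₂ s ≤ β₁
      F₃≤β₃ : eval F₃ s ≤ β₃
      F₄≤β₃ : eval F₄ s ≤ β₃
      F₁F₂≤normBound : eval F₁ s * eval F₂ s ≤ normBound

  -- Opaque so that only the certificate check evaluates these tests.
  opaque
    boundedAbove : QuadForm → ℚᵘ → ℚᵘ⁴ → ℚᵘ⁴ → Bool
    boundedAbove F β c r = (eval F c + deviation F c r) ≤ᵇ β

    cornersBounded : ℚᵘ → ℚᵘ → ℚᵘ → ℚᵘ → Bool
    cornersBounded a b c d = (a * c ≤ᵇ normBound) ∧ ((a * d ≤ᵇ normBound) ∧ ((b * c ≤ᵇ normBound) ∧ (b * d ≤ᵇ normBound)))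

  opaque
    unfolding boundedAbove
    boundedAbove-sound : ∀ F β c r s → T (boundedAbove F β c r) → AbsBounded (s ⊖ c) r → eval F s ≤ β
    boundedAbove-sound F β c r s ok close = ≤-trans (eval≤centre+deviation F c s r close) (≤ᵇ⇒≤ ok)

  opaque
    unfolding cornersBounded
    cornersBounded-sound : ∀ {x y a b c d} → a ≤ x → x ≤ b → c ≤ y → y ≤ d → T (cornersBounded a b c d) → x * y ≤ normBound
    cornersBounded-sound a≤x x≤b c≤y y≤d ok with Equivalence.to T-∧ ok
    ... | ac , rest with Equivalence.to T-∧ rest
    ... | ad , rest′ with Equivalence.to T-∧ rest′
    ... | bc , bd = corner-bound a≤x x≤b c≤y y≤d (≤ᵇ⇒≤ ac) (≤ᵇ⇒≤ ad) (≤ᵇ⇒≤ bc) (≤ᵇ⇒≤ bd)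

  targetTest : ℚᵘ⁴ → ℚᵘ⁴ → Bool
  targetTest c r = boundedAbove F₁ β₁ c r ∧ (boundedAbove F₂ β₁ c r ∧ (boundedAbove F₃ β₃ c r ∧ (boundedAbove F₄ β₃ c r ∧
    cornersBounded (eval F₁ c - deviation F₁ c r) (eval F₁ c + deviation F₁ c r)
                   (eval F₂ c - deviation F₂ c r) (eval F₂ c + deviation F₂ c r))))

  targetTest-sound : ∀ c r s → T (targetTest c r) → AbsBounded (s ⊖ c) r → WithinTargets s
  targetTest-sound c r s ok close with Equivalence.to T-∧ ok
  ... | ok₁ , ok′ with Equivalence.to T-∧ ok′
  ... | ok₂ , ok″ with Equivalence.to T-∧ ok″
  ... | ok₃ , ok‴ with Equivalence.to T-∧ ok‴
  ... | ok₄ , ok₅ = record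
    { F₁≤β₁ = boundedAbove-sound F₁ β₁ c r s ok₁ close
    ; F₂≤β₁ = boundedAbove-sound F₂ β₁ c r s ok₂ close
    ; F₃≤β₃ = boundedAbove-sound F₃ β₃ c r s ok₃ close
    ; F₄≤β₃ = boundedAbove-sound F₄ β₃ c r s ok₄ close
    ; F₁F₂≤normBound = cornersBounded-sound
        (centre-deviation≤eval F₁ c s r close) (eval≤centre+deviation F₁ c s r close)
        (centre-deviation≤eval F₂ c s r close) (eval≤centre+deviation F₂ c s r close) ok₅ }


module Certificate where
  open import Data.Integer using (ℤ; +_; -[1+_])
  open import Data.Vec using (Vec; []; _∷_)
  open import Data.Fin.Patterns using (0F; 1F; 2F; 3F)
  open import Data.Bool using (T)
  open Targets
  open BoxCover
  open Certified WithinTargets targetTest targetTest-sound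

  cubeLower cubeUpper : Vec ℤ 4
  cubeLower = + 0 ∷ + 0 ∷ + 0 ∷ + 0 ∷ []
  cubeUpper = + 256 ∷ + 256 ∷ + 256 ∷ + 256 ∷ []

  -- Computed offline; only its validity is used.
  cubeCertificate : Tree 4
  cubeCertificate =
    (node 0F (+ 128) (node 1F (+ 128) (node 2F (+ 128) (node 3F (+ 128) (node 0F (+ 64) (node 1F (+ 64) (leaf (+ 0 ∷ + 0 ∷ + 0 ∷ + 0 ∷ [])) (node 2F (+ 64) (node 3F (+ 64) (leaf (+ 0 ∷ + 0 ∷ + 0 ∷ + 0 ∷ [])) (leaf (+ 0 ∷ + 0 ∷ + 0 ∷ + 0 ∷ []))) (node 3F (+ 64) (node 0F (+ 32) (leaf (+ 0 ∷ + 0 ∷ + 0 ∷ + 0 ∷ [])) (leaf (+ 0 ∷ + 0 ∷ + 0 ∷ + 0 ∷ []))) (leaf (+ 0 ∷ + 0 ∷ + 0 ∷ + 0 ∷ []))))) (node 1F (+ 64) (node 2F (+ 64) (node 3F (+ 64) (leaf (+ 0 ∷ + 0 ∷ + 0 ∷ + 0 ∷ [])) (node 0F (+ 96) (leaf (+ 0 ∷ + 0 ∷ + 0 ∷ + 0 ∷ [])) (node 1F (+ 32) (leaf (+ 0 ∷ + 0 ∷ + 0 ∷ + 0 ∷ [])) (leaf (+ 0 ∷ + 0 ∷ + 0 ∷ + 0 ∷ []))))) (node 3F (+ 64) (leaf (+ 0 ∷ + 0 ∷ + 0 ∷ + 0 ∷ [])) (leaf (+ 0 ∷ + 0 ∷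 + 0 ∷ + 0 ∷ [])))) (node 2F (+ 64) (node 3F (+ 64) (leaf (+ 0 ∷ + 0 ∷ + 0 ∷ + 0 ∷ [])) (leaf (+ 0 ∷ + 0 ∷ + 0 ∷ + 0 ∷ []))) (node 3F (+ 64) (leaf (+ 0 ∷ + 0 ∷ + 0 ∷ + 0 ∷ [])) (leaf (+ 1 ∷ + 1 ∷ + 0 ∷ + 0 ∷ [])))))) (node 0F (+ 64) (node 1F (+ 64) (node 2F (+ 64) (node 3F (+ 192) (node 0F (+ 32) (node 1F (+ 32) (leaf (+ 0 ∷ + 0 ∷ + 0 ∷ + 1 ∷ [])) (leaf (+ 0 ∷ + 0 ∷ + 0 ∷ + 1 ∷ []))) (leaf (+ 0 ∷ + 0 ∷ + 0 ∷ + 1 ∷ []))) (leaf (+ 0 ∷ + 0 ∷ + 0 ∷ + 1 ∷ []))) (node 3F (+ 192) (leaf (+ 0 ∷ + 0 ∷ + 0 ∷ + 0 ∷ [])) (node 0F (+ 32) (leaf (+ 0 ∷ + 0 ∷ + 0 ∷ + 1 ∷ [])) (leaf (+ 0 ∷ + 0 ∷ + 0 ∷ + 1 ∷ []))))) (node 2F (+ 64) (node 3F (+ 192) (node 0F (+ 32) (node 1F (+ 96) (leaf (+ 0 ∷ + 0 ∷ + 0 ∷ + 1 ∷ [])) (node 2F (+ 32) (leaf (+ 0 ∷ + 0 ∷ + 0 ∷ + 1 ∷ [])) (node 3F (+ 160) (leaf (+ 0 ∷ + 1 ∷ + 0 ∷ + 0 ∷ [])) (leaf (+ 0 ∷ +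 0 ∷ + 0 ∷ + 1 ∷ []))))) (node 1F (+ 96) (leaf (+ 0 ∷ + 0 ∷ + 0 ∷ + 1 ∷ [])) (node 2F (+ 32) (leaf (+ 0 ∷ + 0 ∷ + 0 ∷ + 1 ∷ [])) (node 3F (+ 160) (leaf (+ 0 ∷ + 1 ∷ + 0 ∷ + 0 ∷ [])) (leaf (+ 0 ∷ + 0 ∷ + 0 ∷ + 1 ∷ [])))))) (leaf (+ 0 ∷ + 0 ∷ + 0 ∷ + 1 ∷ []))) (node 3F (+ 192) (node 0F (+ 32) (node 1F (+ 96) (leaf (+ 0 ∷ + 0 ∷ + 0 ∷ + 0 ∷ [])) (node 2F (+ 96) (leaf (-[1+ 0 ] ∷ + 0 ∷ + 1 ∷ + 1 ∷ [])) (node 3F (+ 160) (leaf (+ 0 ∷ + 0 ∷ + 1 ∷ + 1 ∷ [])) (leaf (+ 0 ∷ + 0 ∷ + 1 ∷ + 1 ∷ []))))) (node 1F (+ 96) (leaf (+ 0 ∷ + 0 ∷ + 0 ∷ + 0 ∷ [])) (node 2F (+ 96) (node 3F (+ 160) (leaf (+ 0 ∷ + 0 ∷ + 0 ∷ + 0 ∷ [])) (node 0F (+ 48) (leaf (+ 0 ∷ + 0 ∷ + 0 ∷ + 1 ∷ [])) (leaf (+ 0 ∷ + 0 ∷ + 0 ∷ + 0 ∷ [])))) (leaf (+ 0 ∷ + 0 ∷ + 1 ∷ + 1 ∷ []))))) (node 0F (+ 32) (node 1F (+ 96) (node 2F (+ 96) (leaf (+ 0 ∷ + 0 ∷ + 0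 ∷ + 1 ∷ [])) (leaf (+ 0 ∷ + 0 ∷ + 1 ∷ + 1 ∷ []))) (node 2F (+ 96) (leaf (+ 0 ∷ + 0 ∷ + 0 ∷ + 1 ∷ [])) (leaf (-[1+ 0 ] ∷ + 0 ∷ + 1 ∷ + 1 ∷ [])))) (node 1F (+ 96) (leaf (+ 0 ∷ + 0 ∷ + 0 ∷ + 1 ∷ [])) (node 2F (+ 96) (leaf (+ 0 ∷ + 0 ∷ + 0 ∷ + 1 ∷ [])) (node 3F (+ 224) (leaf (+ 0 ∷ + 0 ∷ + 1 ∷ + 1 ∷ [])) (leaf (+ 0 ∷ + 0 ∷ + 0 ∷ + 1 ∷ []))))))))) (node 1F (+ 64) (node 2F (+ 64) (node 3F (+ 192) (node 0F (+ 96) (node 1F (+ 32) (leaf (+ 0 ∷ + 0 ∷ + 0 ∷ + 1 ∷ [])) (leaf (+ 0 ∷ + 0 ∷ + 0 ∷ + 1 ∷ []))) (node 1F (+ 32) (node 2F (+ 32) (leaf (+ 0 ∷ + 0 ∷ + 0 ∷ + 1 ∷ [])) (leaf (+ 0 ∷ + 0 ∷ + 0 ∷ + 1 ∷ []))) (node 2F (+ 32) (leaf (+ 0 ∷ + 0 ∷ + 0 ∷ + 1 ∷ [])) (leaf (+ 0 ∷ + 0 ∷ + 0 ∷ + 1 ∷ []))))) (leaf (+ 0 ∷ + 0 ∷ + 0 ∷ + 1 ∷ []))) (node 3F (+ 192) (node 0F (+ 96) (node 1F (+ 32) (node 2F (+ 96) (leaf (+ 0 ∷ + 0 ∷ + 1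 ∷ + 1 ∷ [])) (leaf (+ 0 ∷ + 0 ∷ + 1 ∷ + 1 ∷ []))) (leaf (+ 0 ∷ + 0 ∷ + 1 ∷ + 1 ∷ []))) (node 1F (+ 32) (leaf (+ 1 ∷ + 1 ∷ + 0 ∷ + 0 ∷ [])) (leaf (+ 0 ∷ + 0 ∷ + 1 ∷ + 1 ∷ [])))) (node 0F (+ 96) (leaf (+ 0 ∷ + 0 ∷ + 0 ∷ + 1 ∷ [])) (leaf (+ 1 ∷ + 0 ∷ + 0 ∷ + 1 ∷ []))))) (node 2F (+ 64) (node 3F (+ 192) (node 0F (+ 96) (node 1F (+ 96) (node 2F (+ 32) (leaf (+ 0 ∷ + 0 ∷ + 0 ∷ + 1 ∷ [])) (leaf (+ 0 ∷ + 0 ∷ + 0 ∷ + 0 ∷ []))) (node 2F (+ 32) (leaf (+ 0 ∷ + 0 ∷ + 0 ∷ + 1 ∷ [])) (node 3F (+ 160) (leaf (+ 0 ∷ + 0 ∷ + 0 ∷ + 0 ∷ [])) (leaf (+ 0 ∷ + 0 ∷ + 0 ∷ + 1 ∷ []))))) (node 1F (+ 96) (node 2F (+ 32) (leaf (+ 0 ∷ + 0 ∷ + 0 ∷ + 1 ∷ [])) (leaf (+ 1 ∷ + 0 ∷ + 0 ∷ + 1 ∷ []))) (node 2F (+ 32) (leaf (+ 0 ∷ + 0 ∷ + 0 ∷ + 1 ∷ [])) (leaf (+ 1 ∷ + 0 ∷ + 0 ∷ + 1 ∷ []))))) (leaf (+ 0 ∷ + 0 ∷ + 0 ∷ + 1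 ∷ []))) (node 3F (+ 192) (node 0F (+ 96) (node 1F (+ 96) (leaf (+ 0 ∷ + 0 ∷ + 0 ∷ + 0 ∷ [])) (node 2F (+ 96) (node 3F (+ 160) (leaf (+ 0 ∷ + 0 ∷ + 0 ∷ + 0 ∷ [])) (leaf (+ 1 ∷ + 0 ∷ + 0 ∷ + 1 ∷ []))) (leaf (+ 0 ∷ + 0 ∷ + 1 ∷ + 1 ∷ [])))) (node 1F (+ 96) (leaf (+ 0 ∷ + 0 ∷ + 1 ∷ + 1 ∷ [])) (node 2F (+ 96) (leaf (+ 1 ∷ + 0 ∷ + 0 ∷ + 1 ∷ [])) (leaf (+ 0 ∷ + 0 ∷ + 1 ∷ + 1 ∷ []))))) (node 0F (+ 96) (node 1F (+ 96) (leaf (+ 0 ∷ + 0 ∷ + 0 ∷ + 1 ∷ [])) (node 2F (+ 96) (leaf (+ 0 ∷ + 0 ∷ + 0 ∷ + 1 ∷ [])) (node 3F (+ 224) (leaf (+ 0 ∷ + 0 ∷ + 1 ∷ + 1 ∷ [])) (leaf (+ 0 ∷ + 0 ∷ + 0 ∷ + 1 ∷ []))))) (node 1F (+ 96) (leaf (+ 0 ∷ + 0 ∷ + 0 ∷ + 1 ∷ [])) (node 2F (+ 96) (leaf (+ 0 ∷ + 0 ∷ + 0 ∷ + 1 ∷ [])) (leaf (+ 1 ∷ + 0 ∷ + 0 ∷ + 1 ∷ [])))))))))) (node 3F (+ 128) (node 0F (+ 64) (node 1F (+ 64) (node 2F (+ 192) (node 3F (+ 64) (node 0F (+ 32) (leaf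 (+ 0 ∷ + 0 ∷ + 1 ∷ + 0 ∷ [])) (node 1F (+ 32) (leaf (+ 0 ∷ + 0 ∷ + 1 ∷ + 0 ∷ [])) (leaf (+ 0 ∷ + 0 ∷ + 1 ∷ + 0 ∷ [])))) (leaf (+ 0 ∷ + 0 ∷ + 0 ∷ + 0 ∷ []))) (node 3F (+ 64) (leaf (+ 0 ∷ + 0 ∷ + 1 ∷ + 0 ∷ [])) (node 0F (+ 32) (leaf (+ 0 ∷ + 0 ∷ + 1 ∷ + 0 ∷ [])) (node 1F (+ 32) (leaf (+ 0 ∷ + 0 ∷ + 1 ∷ + 0 ∷ [])) (leaf (+ 0 ∷ + 0 ∷ + 1 ∷ + 0 ∷ [])))))) (node 2F (+ 192) (node 3F (+ 64) (node 0F (+ 32) (node 1F (+ 96) (leaf (+ 0 ∷ + 0 ∷ + 1 ∷ + 0 ∷ [])) (node 2F (+ 160) (leaf (+ 0 ∷ + 0 ∷ + 1 ∷ + 0 ∷ [])) (leaf (+ 0 ∷ + 1 ∷ + 1 ∷ + 0 ∷ [])))) (node 1F (+ 96) (leaf (+ 0 ∷ + 0 ∷ + 1 ∷ + 0 ∷ [])) (node 2F (+ 160) (node 3F (+ 32) (leaf (+ 0 ∷ + 0 ∷ + 1 ∷ + 0 ∷ [])) (leaf (+ 0 ∷ + 0 ∷ + 0 ∷ + 0 ∷ []))) (leaf (+ 0 ∷ + 0 ∷ + 1 ∷ + 0 ∷ []))))) (node 0F (+ 32) (node 1F (+ 96) (node 2F (+ 160) (leaf (+ 0 ∷ + 0 ∷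 + 1 ∷ + 1 ∷ [])) (leaf (+ 0 ∷ + 0 ∷ + 1 ∷ + 1 ∷ []))) (leaf (+ 1 ∷ + 1 ∷ + 0 ∷ + 0 ∷ []))) (node 1F (+ 96) (leaf (+ 0 ∷ + 0 ∷ + 1 ∷ + 1 ∷ [])) (leaf (+ 0 ∷ + 0 ∷ + 1 ∷ + 1 ∷ []))))) (node 3F (+ 64) (leaf (+ 0 ∷ + 0 ∷ + 1 ∷ + 0 ∷ [])) (node 0F (+ 32) (node 1F (+ 96) (leaf (+ 0 ∷ + 1 ∷ + 1 ∷ + 0 ∷ [])) (leaf (+ 0 ∷ + 1 ∷ + 1 ∷ + 0 ∷ []))) (leaf (+ 0 ∷ + 0 ∷ + 1 ∷ + 0 ∷ [])))))) (node 1F (+ 64) (node 2F (+ 192) (node 3F (+ 64) (node 0F (+ 96) (node 1F (+ 32) (leaf (+ 0 ∷ + 0 ∷ + 1 ∷ + 0 ∷ [])) (leaf (+ 0 ∷ + 0 ∷ + 1 ∷ + 0 ∷ []))) (node 1F (+ 32) (node 2F (+ 160) (leaf (+ 1 ∷ + 0 ∷ + 0 ∷ + 0 ∷ [])) (leaf (+ 0 ∷ + 0 ∷ + 1 ∷ + 0 ∷ []))) (node 2F (+ 160) (leaf (+ 0 ∷ + 0 ∷ + 0 ∷ + 0 ∷ [])) (leaf (+ 0 ∷ + 0 ∷ + 1 ∷ + 0 ∷ []))))) (node 0F (+ 96) (leaf (+ 0 ∷ + 0 ∷ + 0 ∷ + 0 ∷ [])) (node 1F (+ 32) (node 2F (+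 160) (leaf (+ 0 ∷ + 0 ∷ + 0 ∷ + 0 ∷ [])) (leaf (+ 0 ∷ -[1+ 0 ] ∷ + 1 ∷ + 1 ∷ []))) (node 2F (+ 160) (leaf (+ 0 ∷ + 0 ∷ + 0 ∷ + 0 ∷ [])) (node 3F (+ 96) (node 0F (+ 112) (leaf (+ 0 ∷ + 0 ∷ + 1 ∷ + 0 ∷ [])) (leaf (+ 0 ∷ -[1+ 0 ] ∷ + 1 ∷ + 1 ∷ []))) (leaf (+ 0 ∷ + 0 ∷ + 1 ∷ + 1 ∷ []))))))) (node 3F (+ 64) (leaf (+ 0 ∷ + 0 ∷ + 1 ∷ + 0 ∷ [])) (node 0F (+ 96) (node 1F (+ 32) (node 2F (+ 224) (leaf (+ 0 ∷ -[1+ 0 ] ∷ + 1 ∷ + 1 ∷ [])) (leaf (+ 0 ∷ + 0 ∷ + 1 ∷ + 0 ∷ []))) (leaf (+ 0 ∷ + 0 ∷ + 1 ∷ + 0 ∷ []))) (node 1F (+ 32) (node 2F (+ 224) (leaf (+ 0 ∷ -[1+ 0 ] ∷ + 1 ∷ + 1 ∷ [])) (leaf (+ 0 ∷ + 0 ∷ + 1 ∷ + 0 ∷ []))) (node 2F (+ 224) (node 3F (+ 96) (leaf (+ 0 ∷ + 0 ∷ + 1 ∷ + 0 ∷ [])) (leaf (+ 0 ∷ + 0 ∷ + 1 ∷ + 1 ∷ []))) (leaf (+ 0 ∷ + 0 ∷ + 1 ∷ + 0 ∷ []))))))) (node 2F (+ 192) (node 3F (+ 64) (node 0F (+ 96)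 (node 1F (+ 96) (node 2F (+ 160) (leaf (+ 0 ∷ + 0 ∷ + 0 ∷ + 0 ∷ [])) (leaf (+ 0 ∷ + 0 ∷ + 1 ∷ + 0 ∷ []))) (node 2F (+ 160) (leaf (+ 0 ∷ + 0 ∷ + 0 ∷ + 0 ∷ [])) (leaf (+ 0 ∷ + 0 ∷ + 1 ∷ + 0 ∷ [])))) (node 1F (+ 96) (node 2F (+ 160) (leaf (+ 0 ∷ + 0 ∷ + 0 ∷ + 0 ∷ [])) (leaf (+ 0 ∷ + 0 ∷ + 1 ∷ + 0 ∷ []))) (node 2F (+ 160) (leaf (+ 0 ∷ + 0 ∷ + 0 ∷ + 0 ∷ [])) (leaf (+ 0 ∷ + 0 ∷ + 1 ∷ + 0 ∷ []))))) (node 0F (+ 96) (node 1F (+ 96) (leaf (+ 0 ∷ + 0 ∷ + 0 ∷ + 0 ∷ [])) (leaf (+ 0 ∷ + 0 ∷ + 1 ∷ + 1 ∷ []))) (node 1F (+ 96) (node 2F (+ 160) (leaf (+ 0 ∷ + 0 ∷ + 0 ∷ + 0 ∷ [])) (node 3F (+ 96) (leaf (+ 0 ∷ + 1 ∷ + 1 ∷ + 0 ∷ [])) (leaf (+ 0 ∷ + 0 ∷ + 1 ∷ + 1 ∷ [])))) (node 2F (+ 160) (leaf (+ 0 ∷ + 0 ∷ + 1 ∷ + 1 ∷ [])) (leaf (+ 0 ∷ + 1 ∷ + 1 ∷ + 0 ∷ [])))))) (node 3F (+ 64) (leaf (+ 0 ∷ + 0 ∷ + 1 ∷ + 0 ∷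 [])) (node 0F (+ 96) (node 1F (+ 96) (leaf (+ 0 ∷ + 0 ∷ + 1 ∷ + 0 ∷ [])) (leaf (+ 0 ∷ + 0 ∷ + 1 ∷ + 0 ∷ []))) (node 1F (+ 96) (node 2F (+ 224) (node 3F (+ 96) (leaf (+ 0 ∷ + 0 ∷ + 1 ∷ + 0 ∷ [])) (leaf (+ 0 ∷ + 0 ∷ + 1 ∷ + 1 ∷ []))) (leaf (+ 0 ∷ + 0 ∷ + 1 ∷ + 0 ∷ []))) (node 2F (+ 224) (leaf (+ 0 ∷ + 1 ∷ + 1 ∷ + 0 ∷ [])) (leaf (+ 0 ∷ + 0 ∷ + 1 ∷ + 0 ∷ []))))))))) (node 0F (+ 64) (node 1F (+ 64) (node 2F (+ 192) (leaf (+ 0 ∷ + 0 ∷ + 1 ∷ + 1 ∷ [])) (leaf (+ 0 ∷ + 0 ∷ + 1 ∷ + 1 ∷ []))) (node 2F (+ 192) (node 3F (+ 192) (leaf (+ 0 ∷ + 0 ∷ + 1 ∷ + 1 ∷ [])) (node 0F (+ 32) (leaf (+ 0 ∷ + 0 ∷ + 1 ∷ + 1 ∷ [])) (leaf (+ 0 ∷ + 0 ∷ + 1 ∷ + 1 ∷ [])))) (leaf (+ 0 ∷ + 0 ∷ + 1 ∷ + 1 ∷ [])))) (node 1F (+ 64) (node 2F (+ 192) (node 3F (+ 192) (leaf (+ 0 ∷ + 0 ∷ + 1 ∷ + 1 ∷ [])) (leaf (+ 0 ∷ + 0 ∷ + 1 ∷ + 1 ∷ []))) (node 3F (+ 192)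 (node 0F (+ 96) (leaf (+ 0 ∷ + 0 ∷ + 1 ∷ + 1 ∷ [])) (node 1F (+ 32) (leaf (+ 0 ∷ + 0 ∷ + 1 ∷ + 1 ∷ [])) (leaf (+ 0 ∷ + 0 ∷ + 1 ∷ + 1 ∷ [])))) (leaf (+ 0 ∷ + 0 ∷ + 1 ∷ + 1 ∷ [])))) (node 2F (+ 192) (node 3F (+ 192) (leaf (+ 0 ∷ + 0 ∷ + 1 ∷ + 1 ∷ [])) (leaf (+ 0 ∷ + 0 ∷ + 1 ∷ + 1 ∷ []))) (node 3F (+ 192) (leaf (+ 0 ∷ + 0 ∷ + 1 ∷ + 1 ∷ [])) (leaf (+ 0 ∷ + 0 ∷ + 1 ∷ + 1 ∷ [])))))))) (node 2F (+ 128) (node 3F (+ 128) (node 0F (+ 64) (node 1F (+ 192) (node 2F (+ 64) (node 3F (+ 64) (node 0F (+ 32) (leaf (+ 0 ∷ + 1 ∷ + 0 ∷ + 0 ∷ [])) (node 1F (+ 160) (leaf (+ 0 ∷ + 0 ∷ + 0 ∷ + 0 ∷ [])) (leaf (+ 0 ∷ + 1 ∷ + 0 ∷ + 0 ∷ [])))) (leaf (+ 0 ∷ + 1 ∷ + 0 ∷ + 0 ∷ []))) (node 3F (+ 64) (node 0F (+ 32) (node 1F (+ 160) (node 2F (+ 96) (leaf (+ 0 ∷ + 1 ∷ + 0 ∷ + 0 ∷ [])) (leaf (+ 1 ∷ + 1 ∷ + 0 ∷ + 0 ∷ []))) (leaf (+ 0 ∷ + 1 ∷ + 0 ∷ + 0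 ∷ []))) (leaf (+ 1 ∷ + 1 ∷ + 0 ∷ + 0 ∷ []))) (node 0F (+ 32) (node 1F (+ 160) (node 2F (+ 96) (leaf (+ 0 ∷ + 1 ∷ + 0 ∷ + 0 ∷ [])) (node 3F (+ 96) (leaf (+ 0 ∷ + 1 ∷ + 0 ∷ + 0 ∷ [])) (leaf (+ 0 ∷ + 1 ∷ + 0 ∷ + 0 ∷ [])))) (leaf (+ 0 ∷ + 1 ∷ + 0 ∷ + 0 ∷ []))) (node 1F (+ 160) (node 2F (+ 96) (leaf (+ 0 ∷ + 0 ∷ + 0 ∷ + 0 ∷ [])) (leaf (+ 1 ∷ + 1 ∷ + 0 ∷ + 0 ∷ []))) (node 2F (+ 96) (leaf (+ 0 ∷ + 1 ∷ + 0 ∷ + 0 ∷ [])) (leaf (+ 0 ∷ + 1 ∷ + 0 ∷ + 0 ∷ []))))))) (node 2F (+ 64) (leaf (+ 0 ∷ + 1 ∷ + 0 ∷ + 0 ∷ [])) (leaf (+ 0 ∷ + 1 ∷ + 0 ∷ + 0 ∷ [])))) (node 1F (+ 192) (node 2F (+ 64) (node 3F (+ 64) (leaf (+ 1 ∷ + 1 ∷ + 0 ∷ + 0 ∷ [])) (node 0F (+ 96) (node 1F (+ 160) (leaf (+ 0 ∷ + 0 ∷ + 0 ∷ + 0 ∷ [])) (leaf (+ 0 ∷ + 1 ∷ + 0 ∷ + 0 ∷ []))) (node 1F (+ 160) (leaf (+ 0 ∷ + 0 ∷ + 0 ∷ + 0 ∷ [])) (node 2F (+ 32) (leaf (+ 1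 ∷ + 1 ∷ + 0 ∷ + 0 ∷ [])) (leaf (+ 1 ∷ + 1 ∷ + 0 ∷ + 0 ∷ [])))))) (node 3F (+ 64) (leaf (+ 1 ∷ + 1 ∷ + 0 ∷ + 0 ∷ [])) (node 0F (+ 96) (node 1F (+ 160) (leaf (+ 1 ∷ + 1 ∷ + 0 ∷ + 0 ∷ [])) (node 2F (+ 96) (leaf (+ 1 ∷ + 1 ∷ + 0 ∷ + 0 ∷ [])) (leaf (+ 1 ∷ + 1 ∷ + 0 ∷ + 0 ∷ [])))) (leaf (+ 1 ∷ + 1 ∷ + 0 ∷ + 0 ∷ []))))) (node 2F (+ 64) (node 3F (+ 64) (node 0F (+ 96) (leaf (+ 0 ∷ + 1 ∷ + 0 ∷ + 0 ∷ [])) (leaf (+ 1 ∷ + 1 ∷ + 0 ∷ + 0 ∷ []))) (node 0F (+ 96) (leaf (+ 0 ∷ + 1 ∷ + 0 ∷ + 0 ∷ [])) (node 1F (+ 224) (node 2F (+ 32) (leaf (+ 0 ∷ + 1 ∷ + 0 ∷ + 0 ∷ [])) (leaf (+ 1 ∷ + 1 ∷ + 0 ∷ + 0 ∷ []))) (node 2F (+ 32) (leaf (+ 0 ∷ + 1 ∷ + 0 ∷ + 0 ∷ [])) (leaf (+ 0 ∷ + 1 ∷ + 0 ∷ + 0 ∷ [])))))) (node 3F (+ 64) (leaf (+ 1 ∷ + 1 ∷ + 0 ∷ + 0 ∷ [])) (node 0F (+ 96) (node 1F (+ 224) (node 2F (+ 96) (leaf (+ 0 ∷ + 1 ∷ +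 0 ∷ + 0 ∷ [])) (leaf (+ 1 ∷ + 1 ∷ + 0 ∷ + 0 ∷ []))) (leaf (+ 0 ∷ + 1 ∷ + 0 ∷ + 0 ∷ []))) (node 1F (+ 224) (leaf (+ 1 ∷ + 1 ∷ + 0 ∷ + 0 ∷ [])) (node 2F (+ 96) (leaf (+ 1 ∷ + 1 ∷ + 0 ∷ + 0 ∷ [])) (leaf (+ 1 ∷ + 1 ∷ + 0 ∷ + 0 ∷ []))))))))) (node 0F (+ 64) (node 1F (+ 192) (node 2F (+ 64) (node 3F (+ 192) (node 0F (+ 32) (node 1F (+ 160) (node 2F (+ 32) (leaf (+ 0 ∷ + 0 ∷ + 0 ∷ + 1 ∷ [])) (node 3F (+ 160) (leaf (+ 0 ∷ + 1 ∷ + 0 ∷ + 0 ∷ [])) (leaf (+ 0 ∷ + 0 ∷ + 0 ∷ + 1 ∷ [])))) (leaf (+ 0 ∷ + 0 ∷ + 0 ∷ + 1 ∷ []))) (node 1F (+ 160) (node 2F (+ 32) (leaf (+ 0 ∷ + 0 ∷ + 0 ∷ + 1 ∷ [])) (node 3F (+ 160) (leaf (+ 0 ∷ + 1 ∷ + 0 ∷ + 0 ∷ [])) (leaf (+ 0 ∷ + 0 ∷ + 0 ∷ + 1 ∷ [])))) (node 2F (+ 32) (leaf (+ 0 ∷ + 0 ∷ + 0 ∷ + 1 ∷ [])) (node 3F (+ 160) (leaf (+ 0 ∷ + 1 ∷ + 0 ∷ + 0 ∷ [])) (leaf (+ 0 ∷ + 0 ∷ + 0 ∷ + 1 ∷ []))))))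 (node 0F (+ 32) (leaf (+ 0 ∷ + 1 ∷ + 0 ∷ + 1 ∷ [])) (node 1F (+ 160) (leaf (+ 0 ∷ + 0 ∷ + 0 ∷ + 1 ∷ [])) (leaf (+ 0 ∷ + 0 ∷ + 0 ∷ + 1 ∷ []))))) (node 3F (+ 192) (node 0F (+ 32) (node 1F (+ 160) (node 2F (+ 96) (leaf (-[1+ 0 ] ∷ + 0 ∷ + 1 ∷ + 1 ∷ [])) (leaf (-[1+ 0 ] ∷ + 0 ∷ + 1 ∷ + 1 ∷ []))) (leaf (-[1+ 0 ] ∷ + 0 ∷ + 1 ∷ + 1 ∷ []))) (node 1F (+ 160) (node 2F (+ 96) (leaf (-[1+ 0 ] ∷ + 0 ∷ + 1 ∷ + 1 ∷ [])) (node 3F (+ 160) (leaf (+ 0 ∷ + 0 ∷ + 0 ∷ + 0 ∷ [])) (leaf (-[1+ 0 ] ∷ + 0 ∷ + 1 ∷ + 1 ∷ [])))) (node 2F (+ 96) (leaf (-[1+ 0 ] ∷ + 0 ∷ + 1 ∷ + 1 ∷ [])) (node 3F (+ 160) (node 0F (+ 48) (leaf (+ 0 ∷ + 1 ∷ + 0 ∷ + 0 ∷ [])) (node 1F (+ 176) (leaf (+ 0 ∷ + 1 ∷ + 0 ∷ + 0 ∷ [])) (leaf (+ 0 ∷ + 1 ∷ + 0 ∷ + 0 ∷ [])))) (leaf (+ 0 ∷ + 1 ∷ + 1 ∷ + 1 ∷ [])))))) (node 0F (+ 32) (node 1F (+ 160) (node 2F (+ 96) (leaf (+ 0 ∷ +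 0 ∷ + 0 ∷ + 1 ∷ [])) (node 3F (+ 224) (leaf (-[1+ 0 ] ∷ + 0 ∷ + 1 ∷ + 1 ∷ [])) (leaf (+ 0 ∷ + 1 ∷ + 0 ∷ + 1 ∷ [])))) (leaf (+ 0 ∷ + 1 ∷ + 0 ∷ + 1 ∷ []))) (node 1F (+ 160) (node 2F (+ 96) (leaf (+ 0 ∷ + 0 ∷ + 0 ∷ + 1 ∷ [])) (node 3F (+ 224) (leaf (-[1+ 0 ] ∷ + 0 ∷ + 1 ∷ + 1 ∷ [])) (node 0F (+ 48) (leaf (+ 0 ∷ + 0 ∷ + 0 ∷ + 1 ∷ [])) (leaf (+ 1 ∷ + 1 ∷ + 0 ∷ + 1 ∷ []))))) (node 2F (+ 96) (leaf (+ 0 ∷ + 1 ∷ + 0 ∷ + 1 ∷ [])) (node 3F (+ 224) (leaf (+ 0 ∷ + 1 ∷ + 1 ∷ + 1 ∷ [])) (leaf (+ 0 ∷ + 1 ∷ + 1 ∷ + 1 ∷ [])))))))) (node 2F (+ 64) (leaf (+ 0 ∷ + 1 ∷ + 0 ∷ + 1 ∷ [])) (node 3F (+ 192) (node 0F (+ 32) (node 1F (+ 224) (node 2F (+ 96) (leaf (+ 0 ∷ + 1 ∷ + 0 ∷ + 0 ∷ [])) (leaf (+ 0 ∷ + 1 ∷ + 0 ∷ + 0 ∷ []))) (leaf (+ 0 ∷ + 1 ∷ + 1 ∷ + 1 ∷ []))) (node 1F (+ 224) (node 2F (+ 96) (node 3F (+ 160) (leaf (+ 0 ∷ + 1 ∷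 + 0 ∷ + 0 ∷ [])) (leaf (+ 0 ∷ + 1 ∷ + 0 ∷ + 1 ∷ []))) (leaf (+ 0 ∷ + 1 ∷ + 1 ∷ + 1 ∷ []))) (node 2F (+ 96) (leaf (+ 0 ∷ + 1 ∷ + 0 ∷ + 0 ∷ [])) (leaf (+ 0 ∷ + 1 ∷ + 1 ∷ + 1 ∷ []))))) (leaf (+ 0 ∷ + 1 ∷ + 0 ∷ + 1 ∷ []))))) (node 1F (+ 192) (node 2F (+ 64) (node 3F (+ 192) (node 0F (+ 96) (node 1F (+ 160) (node 2F (+ 32) (leaf (+ 0 ∷ + 0 ∷ + 0 ∷ + 1 ∷ [])) (node 3F (+ 160) (leaf (+ 0 ∷ + 0 ∷ + 0 ∷ + 0 ∷ [])) (leaf (+ 0 ∷ + 0 ∷ + 0 ∷ + 1 ∷ [])))) (node 2F (+ 32) (leaf (+ 0 ∷ + 0 ∷ + 0 ∷ + 1 ∷ [])) (node 3F (+ 160) (node 0F (+ 80) (leaf (+ 0 ∷ + 1 ∷ + 0 ∷ + 0 ∷ [])) (node 1F (+ 176) (leaf (+ 0 ∷ + 1 ∷ + 0 ∷ + 0 ∷ [])) (leaf (+ 0 ∷ + 1 ∷ + 0 ∷ + 0 ∷ [])))) (leaf (+ 0 ∷ + 0 ∷ + 0 ∷ + 1 ∷ []))))) (node 1F (+ 160) (node 2F (+ 32) (leaf (+ 0 ∷ + 0 ∷ + 0 ∷ + 1 ∷ [])) (node 3F (+ 160) (leaf (+ 0 ∷ + 0 ∷ + 0 ∷ + 0 ∷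 [])) (leaf (+ 0 ∷ + 0 ∷ + 0 ∷ + 1 ∷ [])))) (node 2F (+ 32) (node 3F (+ 160) (node 0F (+ 112) (leaf (+ 0 ∷ + 0 ∷ + 0 ∷ + 1 ∷ [])) (leaf (+ 1 ∷ + 1 ∷ + 0 ∷ + 1 ∷ []))) (leaf (+ 0 ∷ + 0 ∷ + 0 ∷ + 1 ∷ []))) (node 3F (+ 160) (node 0F (+ 112) (node 1F (+ 176) (leaf (+ 0 ∷ + 0 ∷ + 0 ∷ + 0 ∷ [])) (node 2F (+ 48) (leaf (+ 0 ∷ + 1 ∷ + 0 ∷ + 0 ∷ [])) (leaf (+ 1 ∷ + 1 ∷ + 0 ∷ + 0 ∷ [])))) (leaf (+ 1 ∷ + 1 ∷ + 0 ∷ + 0 ∷ []))) (leaf (+ 1 ∷ + 1 ∷ + 0 ∷ + 1 ∷ [])))))) (node 0F (+ 96) (node 1F (+ 160) (leaf (+ 0 ∷ + 0 ∷ + 0 ∷ + 1 ∷ [])) (leaf (+ 1 ∷ + 1 ∷ + 0 ∷ + 1 ∷ []))) (leaf (+ 1 ∷ + 1 ∷ + 0 ∷ + 1 ∷ [])))) (node 3F (+ 192) (node 0F (+ 96) (node 1F (+ 160) (node 2F (+ 96) (node 3F (+ 160) (leaf (+ 0 ∷ + 0 ∷ + 0 ∷ + 0 ∷ [])) (node 0F (+ 80) (node 1F (+ 144) (node 2F (+ 80) (leaf (+ 0 ∷ + 0 ∷ + 0 ∷ + 1 ∷ [])) (leaf (+ 0 ∷ + 0 ∷ + 1 ∷ +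 1 ∷ []))) (node 2F (+ 80) (leaf (+ 0 ∷ + 0 ∷ + 0 ∷ + 1 ∷ [])) (node 3F (+ 176) (leaf (+ 0 ∷ + 0 ∷ + 0 ∷ + 0 ∷ [])) (leaf (+ 0 ∷ + 0 ∷ + 0 ∷ + 1 ∷ []))))) (node 1F (+ 144) (leaf (+ 1 ∷ + 0 ∷ + 0 ∷ + 1 ∷ [])) (node 2F (+ 80) (leaf (+ 0 ∷ + 0 ∷ + 0 ∷ + 1 ∷ [])) (node 3F (+ 176) (leaf (+ 0 ∷ + 0 ∷ + 1 ∷ + 1 ∷ [])) (leaf (+ 1 ∷ + 0 ∷ + 0 ∷ + 1 ∷ []))))))) (node 3F (+ 160) (leaf (+ 0 ∷ + 0 ∷ + 1 ∷ + 1 ∷ [])) (leaf (+ 0 ∷ + 0 ∷ + 1 ∷ + 1 ∷ [])))) (node 2F (+ 96) (node 3F (+ 160) (node 0F (+ 80) (node 1F (+ 176) (leaf (+ 0 ∷ + 1 ∷ + 0 ∷ + 0 ∷ [])) (leaf (+ 0 ∷ + 1 ∷ + 0 ∷ + 0 ∷ []))) (node 1F (+ 176) (leaf (+ 0 ∷ + 0 ∷ + 0 ∷ + 0 ∷ [])) (leaf (+ 1 ∷ + 2 ∷ + 0 ∷ + 0 ∷ [])))) (node 0F (+ 80) (node 1F (+ 176) (node 2F (+ 80) (leaf (+ 0 ∷ + 0 ∷ + 0 ∷ + 1 ∷ [])) (node 3F (+ 176) (leaf (-[1+ 0 ] ∷ + 0 ∷ + 1 ∷ + 1 ∷ [])) (node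 0F (+ 72) (leaf (+ 0 ∷ + 0 ∷ + 0 ∷ + 1 ∷ [])) (leaf (+ 0 ∷ + 0 ∷ + 0 ∷ + 1 ∷ []))))) (node 2F (+ 80) (leaf (+ 0 ∷ + 1 ∷ + 0 ∷ + 1 ∷ [])) (leaf (-[1+ 0 ] ∷ + 0 ∷ + 1 ∷ + 1 ∷ [])))) (node 1F (+ 176) (node 2F (+ 80) (node 3F (+ 176) (node 0F (+ 88) (leaf (+ 0 ∷ + 0 ∷ + 0 ∷ + 1 ∷ [])) (leaf (+ 0 ∷ + 0 ∷ + 0 ∷ + 1 ∷ []))) (leaf (+ 1 ∷ + 1 ∷ + 0 ∷ + 1 ∷ []))) (node 3F (+ 176) (node 0F (+ 88) (node 1F (+ 168) (leaf (+ 0 ∷ + 0 ∷ + 1 ∷ + 1 ∷ [])) (node 2F (+ 88) (leaf (+ 0 ∷ + 1 ∷ + 0 ∷ + 0 ∷ [])) (leaf (+ 0 ∷ + 0 ∷ + 1 ∷ + 1 ∷ [])))) (node 1F (+ 168) (leaf (+ 1 ∷ + 1 ∷ + 0 ∷ + 0 ∷ [])) (leaf (+ 1 ∷ + 1 ∷ + 0 ∷ + 0 ∷ [])))) (node 0F (+ 88) (leaf (+ 1 ∷ + 1 ∷ + 0 ∷ + 1 ∷ [])) (leaf (+ 1 ∷ + 1 ∷ + 0 ∷ + 1 ∷ []))))) (node 2F (+ 80) (node 3F (+ 176) (node 0F (+ 88) (leaf (+ 0 ∷ + 1 ∷ + 0 ∷ + 0 ∷ [])) (leaf (+ 1 ∷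 + 1 ∷ + 0 ∷ + 1 ∷ []))) (leaf (+ 1 ∷ + 1 ∷ + 0 ∷ + 1 ∷ []))) (node 3F (+ 176) (leaf (+ 1 ∷ + 2 ∷ + 0 ∷ + 0 ∷ [])) (leaf (+ 1 ∷ + 1 ∷ + 0 ∷ + 1 ∷ []))))))) (node 3F (+ 160) (node 0F (+ 80) (node 1F (+ 176) (leaf (+ 0 ∷ + 0 ∷ + 1 ∷ + 1 ∷ [])) (node 2F (+ 112) (leaf (+ 0 ∷ + 1 ∷ + 0 ∷ + 0 ∷ [])) (leaf (+ 0 ∷ + 0 ∷ + 1 ∷ + 1 ∷ [])))) (leaf (+ 1 ∷ + 1 ∷ + 0 ∷ + 0 ∷ []))) (node 0F (+ 80) (leaf (-[1+ 0 ] ∷ + 0 ∷ + 1 ∷ + 1 ∷ [])) (leaf (+ 1 ∷ + 1 ∷ + 1 ∷ + 1 ∷ [])))))) (node 1F (+ 160) (node 2F (+ 96) (node 3F (+ 160) (leaf (+ 1 ∷ + 1 ∷ + 0 ∷ + 0 ∷ [])) (leaf (+ 1 ∷ + 0 ∷ + 0 ∷ + 1 ∷ []))) (leaf (+ 0 ∷ + 0 ∷ + 1 ∷ + 1 ∷ []))) (node 2F (+ 96) (node 3F (+ 160) (leaf (+ 1 ∷ + 1 ∷ + 0 ∷ + 0 ∷ [])) (node 0F (+ 112) (node 1F (+ 176) (node 2F (+ 80) (leaf (+ 1 ∷ + 0 ∷ + 0 ∷ + 1 ∷ [])) (node 3F (+ 176) (leaf (+ 1 ∷ + 1 ∷ +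 0 ∷ + 0 ∷ [])) (leaf (+ 1 ∷ + 1 ∷ + 0 ∷ + 1 ∷ [])))) (node 2F (+ 80) (leaf (+ 1 ∷ + 1 ∷ + 0 ∷ + 1 ∷ [])) (node 3F (+ 176) (leaf (+ 1 ∷ + 1 ∷ + 1 ∷ + 1 ∷ [])) (leaf (+ 1 ∷ + 1 ∷ + 0 ∷ + 1 ∷ []))))) (node 1F (+ 176) (leaf (+ 1 ∷ + 0 ∷ + 0 ∷ + 1 ∷ [])) (node 2F (+ 80) (leaf (+ 1 ∷ + 1 ∷ + 0 ∷ + 1 ∷ [])) (leaf (+ 1 ∷ + 1 ∷ + 1 ∷ + 1 ∷ [])))))) (leaf (+ 1 ∷ + 1 ∷ + 1 ∷ + 1 ∷ []))))) (node 0F (+ 96) (node 1F (+ 160) (node 2F (+ 96) (leaf (+ 0 ∷ + 0 ∷ + 0 ∷ + 1 ∷ [])) (node 3F (+ 224) (node 0F (+ 80) (node 1F (+ 144) (leaf (+ 0 ∷ + 0 ∷ + 1 ∷ + 1 ∷ [])) (node 2F (+ 112) (leaf (-[1+ 0 ] ∷ + 0 ∷ + 1 ∷ + 1 ∷ [])) (leaf (+ 0 ∷ + 0 ∷ + 1 ∷ + 1 ∷ [])))) (leaf (+ 1 ∷ + 1 ∷ + 1 ∷ + 1 ∷ []))) (node 0F (+ 80) (leaf (+ 1 ∷ + 1 ∷ + 0 ∷ + 1 ∷ [])) (leaf (+ 1 ∷ + 1 ∷ + 0 ∷ + 1 ∷ []))))) (node 2F (+ 96) (leaf (+ 1 ∷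 + 1 ∷ + 0 ∷ + 1 ∷ [])) (node 3F (+ 224) (node 0F (+ 80) (leaf (+ 0 ∷ + 1 ∷ + 1 ∷ + 1 ∷ [])) (leaf (+ 0 ∷ + 1 ∷ + 1 ∷ + 1 ∷ []))) (leaf (+ 1 ∷ + 1 ∷ + 0 ∷ + 1 ∷ []))))) (node 1F (+ 160) (node 2F (+ 96) (leaf (+ 1 ∷ + 1 ∷ + 0 ∷ + 1 ∷ [])) (leaf (+ 1 ∷ + 1 ∷ + 1 ∷ + 1 ∷ []))) (node 2F (+ 96) (leaf (+ 1 ∷ + 1 ∷ + 0 ∷ + 1 ∷ [])) (node 3F (+ 224) (leaf (+ 1 ∷ + 1 ∷ + 1 ∷ + 1 ∷ [])) (leaf (+ 1 ∷ + 1 ∷ + 0 ∷ + 1 ∷ [])))))))) (node 2F (+ 64) (node 3F (+ 192) (node 0F (+ 96) (node 1F (+ 224) (node 2F (+ 32) (leaf (+ 0 ∷ + 0 ∷ + 0 ∷ + 1 ∷ [])) (node 3F (+ 160) (leaf (+ 0 ∷ + 1 ∷ + 0 ∷ + 0 ∷ [])) (leaf (+ 0 ∷ + 1 ∷ + 0 ∷ + 1 ∷ [])))) (leaf (+ 0 ∷ + 1 ∷ + 0 ∷ + 1 ∷ []))) (node 1F (+ 224) (node 2F (+ 32) (node 3F (+ 160) (node 0F (+ 112) (leaf (+ 0 ∷ + 0 ∷ + 0 ∷ + 1 ∷ [])) (leaf (+ 1 ∷ + 1 ∷ + 0 ∷ + 1 ∷ []))) (leaf (+ 1 ∷ + 1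 ∷ + 0 ∷ + 1 ∷ []))) (node 3F (+ 160) (leaf (+ 1 ∷ + 2 ∷ + 0 ∷ + 0 ∷ [])) (leaf (+ 1 ∷ + 1 ∷ + 0 ∷ + 1 ∷ [])))) (node 2F (+ 32) (leaf (+ 0 ∷ + 1 ∷ + 0 ∷ + 1 ∷ [])) (node 3F (+ 160) (leaf (+ 1 ∷ + 2 ∷ + 0 ∷ + 0 ∷ [])) (leaf (+ 1 ∷ + 1 ∷ + 0 ∷ + 1 ∷ [])))))) (node 0F (+ 96) (leaf (+ 0 ∷ + 1 ∷ + 0 ∷ + 1 ∷ [])) (leaf (+ 1 ∷ + 1 ∷ + 0 ∷ + 1 ∷ [])))) (node 3F (+ 192) (node 0F (+ 96) (node 1F (+ 224) (node 2F (+ 96) (node 3F (+ 160) (leaf (+ 0 ∷ + 1 ∷ + 0 ∷ + 0 ∷ [])) (leaf (+ 1 ∷ + 2 ∷ + 0 ∷ + 0 ∷ []))) (node 3F (+ 160) (node 0F (+ 80) (leaf (+ 0 ∷ + 1 ∷ + 1 ∷ + 1 ∷ [])) (leaf (+ 0 ∷ + 1 ∷ + 1 ∷ + 1 ∷ []))) (leaf (+ 0 ∷ + 1 ∷ + 1 ∷ + 1 ∷ [])))) (leaf (+ 1 ∷ + 2 ∷ + 0 ∷ + 0 ∷ []))) (node 1F (+ 224) (node 2F (+ 96) (node 3F (+ 160) (leaf (+ 1 ∷ + 2 ∷ + 0 ∷ + 0 ∷ [])) (leaf (+ 1 ∷ + 2 ∷ + 0 ∷ + 0 ∷ []))) (leaf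 (+ 1 ∷ + 1 ∷ + 1 ∷ + 1 ∷ []))) (node 2F (+ 96) (leaf (+ 1 ∷ + 2 ∷ + 0 ∷ + 0 ∷ [])) (node 3F (+ 160) (leaf (+ 0 ∷ + 1 ∷ + 1 ∷ + 1 ∷ [])) (leaf (+ 0 ∷ + 1 ∷ + 1 ∷ + 1 ∷ [])))))) (node 0F (+ 96) (node 1F (+ 224) (node 2F (+ 96) (leaf (+ 1 ∷ + 1 ∷ + 0 ∷ + 1 ∷ [])) (leaf (+ 0 ∷ + 1 ∷ + 1 ∷ + 1 ∷ []))) (leaf (+ 1 ∷ + 1 ∷ + 0 ∷ + 1 ∷ []))) (node 1F (+ 224) (node 2F (+ 96) (leaf (+ 1 ∷ + 1 ∷ + 0 ∷ + 1 ∷ [])) (leaf (+ 0 ∷ + 1 ∷ + 1 ∷ + 1 ∷ []))) (node 2F (+ 96) (leaf (+ 1 ∷ + 1 ∷ + 0 ∷ + 1 ∷ [])) (leaf (+ 0 ∷ + 1 ∷ + 1 ∷ + 1 ∷ [])))))))))) (node 3F (+ 128) (node 0F (+ 64) (node 1F (+ 192) (node 2F (+ 192) (node 3F (+ 64) (node 0F (+ 32) (node 1F (+ 160) (node 2F (+ 160) (leaf (+ 1 ∷ + 1 ∷ + 0 ∷ + 0 ∷ [])) (leaf (+ 0 ∷ + 1 ∷ + 1 ∷ + 0 ∷ []))) (node 2F (+ 160) (leaf (+ 0 ∷ + 1 ∷ + 0 ∷ + 0 ∷ [])) (leaf (+ 0 ∷ + 1 ∷ + 1 ∷ + 0 ∷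 [])))) (node 1F (+ 160) (node 2F (+ 160) (leaf (+ 0 ∷ + 1 ∷ + 1 ∷ + 0 ∷ [])) (leaf (+ 0 ∷ + 1 ∷ + 1 ∷ + 0 ∷ []))) (leaf (+ 0 ∷ + 1 ∷ + 1 ∷ + 0 ∷ [])))) (node 0F (+ 32) (node 1F (+ 160) (leaf (+ 1 ∷ + 1 ∷ + 0 ∷ + 0 ∷ [])) (leaf (+ 0 ∷ + 1 ∷ + 1 ∷ + 1 ∷ []))) (node 1F (+ 160) (leaf (+ 1 ∷ + 1 ∷ + 0 ∷ + 0 ∷ [])) (node 2F (+ 160) (leaf (+ 1 ∷ + 1 ∷ + 0 ∷ + 0 ∷ [])) (leaf (+ 0 ∷ + 0 ∷ + 1 ∷ + 1 ∷ [])))))) (node 3F (+ 64) (leaf (+ 0 ∷ + 1 ∷ + 1 ∷ + 0 ∷ [])) (node 0F (+ 32) (node 1F (+ 160) (leaf (+ 0 ∷ + 1 ∷ + 1 ∷ + 0 ∷ [])) (leaf (+ 0 ∷ + 1 ∷ + 1 ∷ + 0 ∷ []))) (node 1F (+ 160) (leaf (+ 0 ∷ + 1 ∷ + 1 ∷ + 0 ∷ [])) (leaf (+ 0 ∷ + 1 ∷ + 1 ∷ + 0 ∷ [])))))) (node 2F (+ 192) (node 3F (+ 64) (node 0F (+ 32) (leaf (+ 0 ∷ + 1 ∷ + 0 ∷ + 0 ∷ [])) (node 1F (+ 224) (leaf (+ 0 ∷ + 1 ∷ + 1 ∷ + 0 ∷ [])) (leaf (+ 0 ∷ + 1 ∷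 + 1 ∷ + 0 ∷ [])))) (node 0F (+ 32) (leaf (+ 0 ∷ + 1 ∷ + 0 ∷ + 0 ∷ [])) (node 1F (+ 224) (leaf (+ 0 ∷ + 1 ∷ + 1 ∷ + 1 ∷ [])) (leaf (+ 0 ∷ + 1 ∷ + 1 ∷ + 1 ∷ []))))) (node 3F (+ 64) (leaf (+ 0 ∷ + 1 ∷ + 1 ∷ + 0 ∷ [])) (node 0F (+ 32) (node 1F (+ 224) (leaf (+ 0 ∷ + 1 ∷ + 1 ∷ + 0 ∷ [])) (leaf (+ 0 ∷ + 1 ∷ + 1 ∷ + 0 ∷ []))) (node 1F (+ 224) (leaf (+ 0 ∷ + 1 ∷ + 1 ∷ + 0 ∷ [])) (leaf (+ 0 ∷ + 1 ∷ + 1 ∷ + 0 ∷ []))))))) (node 1F (+ 192) (node 2F (+ 192) (node 3F (+ 64) (node 0F (+ 96) (node 1F (+ 160) (node 2F (+ 160) (leaf (+ 0 ∷ + 1 ∷ + 1 ∷ + 0 ∷ [])) (leaf (+ 0 ∷ + 1 ∷ + 1 ∷ + 0 ∷ []))) (leaf (+ 0 ∷ + 1 ∷ + 1 ∷ + 0 ∷ []))) (node 1F (+ 160) (node 2F (+ 160) (leaf (+ 0 ∷ + 1 ∷ + 1 ∷ + 0 ∷ [])) (leaf (+ 0 ∷ + 1 ∷ + 1 ∷ + 0 ∷ []))) (leaf (+ 0 ∷ + 1 ∷ + 1 ∷ + 0 ∷ [])))) (node 0F (+ 96) (node 1F (+ 160) (leaf (+ 0 ∷ + 0 ∷ + 1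 ∷ + 1 ∷ [])) (leaf (+ 1 ∷ + 1 ∷ + 0 ∷ + 0 ∷ []))) (node 1F (+ 160) (node 2F (+ 160) (leaf (+ 1 ∷ + 1 ∷ + 0 ∷ + 0 ∷ [])) (node 3F (+ 96) (leaf (+ 1 ∷ + 1 ∷ + 0 ∷ + 0 ∷ [])) (leaf (+ 0 ∷ + 0 ∷ + 1 ∷ + 1 ∷ [])))) (leaf (+ 1 ∷ + 1 ∷ + 0 ∷ + 0 ∷ []))))) (node 3F (+ 64) (node 0F (+ 96) (node 1F (+ 160) (leaf (+ 0 ∷ + 0 ∷ + 1 ∷ + 0 ∷ [])) (leaf (+ 0 ∷ + 1 ∷ + 1 ∷ + 0 ∷ []))) (node 1F (+ 160) (leaf (+ 1 ∷ + 1 ∷ + 1 ∷ + 0 ∷ [])) (leaf (+ 1 ∷ + 1 ∷ + 1 ∷ + 0 ∷ [])))) (node 0F (+ 96) (node 1F (+ 160) (leaf (+ 0 ∷ + 1 ∷ + 1 ∷ + 0 ∷ [])) (leaf (+ 0 ∷ + 1 ∷ + 1 ∷ + 0 ∷ []))) (node 1F (+ 160) (node 2F (+ 224) (leaf (+ 0 ∷ + 1 ∷ + 1 ∷ + 0 ∷ [])) (leaf (+ 0 ∷ + 1 ∷ + 1 ∷ + 0 ∷ []))) (node 2F (+ 224) (leaf (+ 0 ∷ + 1 ∷ + 1 ∷ + 0 ∷ [])) (leaf (+ 0 ∷ + 1 ∷ + 1 ∷ + 0 ∷ []))))))) (node 2F (+ 192) (node 3F (+ 64) (node 0F (+ 96)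 (node 1F (+ 224) (leaf (+ 0 ∷ + 1 ∷ + 1 ∷ + 0 ∷ [])) (leaf (+ 0 ∷ + 1 ∷ + 1 ∷ + 0 ∷ []))) (node 1F (+ 224) (leaf (+ 0 ∷ + 1 ∷ + 1 ∷ + 0 ∷ [])) (leaf (+ 0 ∷ + 1 ∷ + 1 ∷ + 0 ∷ [])))) (node 0F (+ 96) (node 1F (+ 224) (node 2F (+ 160) (leaf (+ 1 ∷ + 1 ∷ + 0 ∷ + 0 ∷ [])) (leaf (+ 0 ∷ + 0 ∷ + 1 ∷ + 1 ∷ []))) (leaf (+ 0 ∷ + 1 ∷ + 0 ∷ + 0 ∷ []))) (node 1F (+ 224) (leaf (+ 0 ∷ + 0 ∷ + 1 ∷ + 1 ∷ [])) (leaf (+ 0 ∷ + 0 ∷ + 1 ∷ + 1 ∷ []))))) (node 3F (+ 64) (leaf (+ 0 ∷ + 1 ∷ + 1 ∷ + 0 ∷ [])) (node 0F (+ 96) (node 1F (+ 224) (leaf (+ 0 ∷ + 1 ∷ + 1 ∷ + 0 ∷ [])) (node 2F (+ 224) (leaf (+ 0 ∷ + 0 ∷ + 1 ∷ + 1 ∷ [])) (leaf (+ 0 ∷ + 1 ∷ + 1 ∷ + 0 ∷ [])))) (node 1F (+ 224) (node 2F (+ 224) (leaf (+ 0 ∷ + 1 ∷ + 1 ∷ + 0 ∷ [])) (leaf (+ 0 ∷ + 1 ∷ + 1 ∷ + 0 ∷ []))) (node 2F (+ 224) (leaf (+ 0 ∷ + 0 ∷ + 1 ∷ + 1 ∷ []))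 (leaf (+ 0 ∷ + 1 ∷ + 1 ∷ + 0 ∷ []))))))))) (node 0F (+ 64) (node 1F (+ 192) (node 2F (+ 192) (node 3F (+ 192) (node 0F (+ 32) (node 1F (+ 160) (node 2F (+ 160) (node 3F (+ 160) (leaf (+ 0 ∷ + 0 ∷ + 1 ∷ + 1 ∷ [])) (leaf (+ 0 ∷ + 1 ∷ + 1 ∷ + 1 ∷ []))) (leaf (+ 0 ∷ + 0 ∷ + 1 ∷ + 1 ∷ []))) (leaf (+ 0 ∷ + 1 ∷ + 1 ∷ + 1 ∷ []))) (node 1F (+ 160) (leaf (+ 0 ∷ + 0 ∷ + 1 ∷ + 1 ∷ [])) (node 2F (+ 160) (leaf (+ 0 ∷ + 1 ∷ + 1 ∷ + 1 ∷ [])) (leaf (+ 0 ∷ + 0 ∷ + 1 ∷ + 1 ∷ []))))) (node 0F (+ 32) (node 1F (+ 160) (node 2F (+ 160) (leaf (+ 0 ∷ + 1 ∷ + 1 ∷ + 1 ∷ [])) (leaf (+ 0 ∷ + 1 ∷ + 1 ∷ + 1 ∷ []))) (leaf (+ 0 ∷ + 1 ∷ + 1 ∷ + 1 ∷ []))) (node 1F (+ 160) (node 2F (+ 160) (node 3F (+ 224) (leaf (+ 0 ∷ + 0 ∷ + 1 ∷ + 1 ∷ [])) (leaf (+ 0 ∷ + 1 ∷ + 1 ∷ + 1 ∷ []))) (leaf (+ 0 ∷ + 0 ∷ + 1 ∷ + 1 ∷ []))) (leaf (+ 0 ∷ + 1 ∷ + 1 ∷ + 1 ∷ []))))) (node 3F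 (+ 192) (leaf (+ 0 ∷ + 0 ∷ + 1 ∷ + 1 ∷ [])) (node 0F (+ 32) (leaf (+ 0 ∷ + 1 ∷ + 1 ∷ + 1 ∷ [])) (node 1F (+ 160) (leaf (+ 0 ∷ + 0 ∷ + 1 ∷ + 1 ∷ [])) (leaf (+ 0 ∷ + 1 ∷ + 1 ∷ + 1 ∷ [])))))) (node 2F (+ 192) (node 3F (+ 192) (leaf (+ 0 ∷ + 1 ∷ + 1 ∷ + 1 ∷ [])) (leaf (+ 0 ∷ + 1 ∷ + 1 ∷ + 1 ∷ []))) (leaf (+ 0 ∷ + 1 ∷ + 1 ∷ + 1 ∷ [])))) (node 1F (+ 192) (node 2F (+ 192) (node 3F (+ 192) (node 0F (+ 96) (node 1F (+ 160) (leaf (+ 0 ∷ + 0 ∷ + 1 ∷ + 1 ∷ [])) (node 2F (+ 160) (node 3F (+ 160) (leaf (+ 0 ∷ + 0 ∷ + 1 ∷ + 1 ∷ [])) (leaf (+ 0 ∷ + 0 ∷ + 1 ∷ + 1 ∷ []))) (leaf (+ 0 ∷ + 0 ∷ + 1 ∷ + 1 ∷ [])))) (leaf (+ 0 ∷ + 0 ∷ + 1 ∷ + 1 ∷ []))) (node 0F (+ 96) (node 1F (+ 160) (node 2F (+ 160) (node 3F (+ 224) (leaf (+ 0 ∷ + 0 ∷ + 1 ∷ + 1 ∷ [])) (leaf (+ 0 ∷ + 1 ∷ + 1 ∷ + 1 ∷ []))) (leaf (+ 0 ∷ + 0 ∷ + 1 ∷ + 1 ∷ []))) (leaf (+ 0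 ∷ + 1 ∷ + 1 ∷ + 1 ∷ []))) (leaf (+ 1 ∷ + 1 ∷ + 1 ∷ + 1 ∷ [])))) (node 3F (+ 192) (leaf (+ 0 ∷ + 0 ∷ + 1 ∷ + 1 ∷ [])) (leaf (+ 0 ∷ + 0 ∷ + 1 ∷ + 1 ∷ [])))) (node 2F (+ 192) (node 3F (+ 192) (node 0F (+ 96) (node 1F (+ 224) (node 2F (+ 160) (leaf (+ 0 ∷ + 1 ∷ + 1 ∷ + 1 ∷ [])) (leaf (+ 0 ∷ + 1 ∷ + 1 ∷ + 1 ∷ []))) (leaf (+ 0 ∷ + 1 ∷ + 1 ∷ + 1 ∷ []))) (node 1F (+ 224) (node 2F (+ 160) (leaf (+ 1 ∷ + 1 ∷ + 1 ∷ + 1 ∷ [])) (leaf (+ 0 ∷ + 0 ∷ + 1 ∷ + 1 ∷ []))) (node 2F (+ 160) (leaf (+ 0 ∷ + 1 ∷ + 1 ∷ + 1 ∷ [])) (leaf (+ 0 ∷ + 1 ∷ + 1 ∷ + 1 ∷ []))))) (leaf (+ 0 ∷ + 1 ∷ + 1 ∷ + 1 ∷ []))) (node 3F (+ 192) (node 0F (+ 96) (node 1F (+ 224) (leaf (+ 0 ∷ + 0 ∷ + 1 ∷ + 1 ∷ [])) (leaf (+ 0 ∷ + 1 ∷ + 1 ∷ + 1 ∷ []))) (node 1F (+ 224) (leaf (+ 0 ∷ + 0 ∷ + 1 ∷ + 1 ∷ [])) (node 2F (+ 224) (leaf (+ 0 ∷ + 1 ∷ + 1 ∷ + 1 ∷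 [])) (leaf (+ 0 ∷ + 1 ∷ + 1 ∷ + 1 ∷ []))))) (node 0F (+ 96) (leaf (+ 0 ∷ + 1 ∷ + 1 ∷ + 1 ∷ [])) (leaf (+ 1 ∷ + 1 ∷ + 1 ∷ + 1 ∷ [])))))))))) (node 1F (+ 128) (node 2F (+ 128) (node 3F (+ 128) (node 0F (+ 192) (node 1F (+ 64) (node 2F (+ 64) (node 3F (+ 64) (node 0F (+ 160) (leaf (+ 0 ∷ + 0 ∷ + 0 ∷ + 0 ∷ [])) (leaf (+ 1 ∷ + 0 ∷ + 0 ∷ + 0 ∷ []))) (node 0F (+ 160) (node 1F (+ 32) (node 2F (+ 32) (leaf (+ 1 ∷ + 0 ∷ + 0 ∷ + 0 ∷ [])) (leaf (+ 1 ∷ + 0 ∷ + 0 ∷ + 0 ∷ []))) (leaf (+ 1 ∷ + 1 ∷ + 0 ∷ + 0 ∷ []))) (node 1F (+ 32) (leaf (+ 1 ∷ + 0 ∷ + 0 ∷ + 0 ∷ [])) (leaf (+ 1 ∷ + 1 ∷ + 0 ∷ + 0 ∷ []))))) (node 3F (+ 64) (leaf (+ 1 ∷ + 0 ∷ + 0 ∷ + 0 ∷ [])) (node 0F (+ 160) (node 1F (+ 32) (node 2F (+ 96) (leaf (+ 1 ∷ + 0 ∷ + 0 ∷ + 0 ∷ [])) (leaf (+ 1 ∷ + 0 ∷ + 0 ∷ + 0 ∷ []))) (node 2F (+ 96) (leaf (+ 1 ∷ + 1 ∷ + 0 ∷ + 0 ∷ [])) (leaf (+ 0 ∷ + 0 ∷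 + 0 ∷ + 0 ∷ [])))) (node 1F (+ 32) (leaf (+ 1 ∷ + 0 ∷ + 0 ∷ + 0 ∷ [])) (node 2F (+ 96) (leaf (+ 1 ∷ + 0 ∷ + 0 ∷ + 0 ∷ [])) (leaf (+ 1 ∷ + 0 ∷ + 0 ∷ + 0 ∷ []))))))) (node 2F (+ 64) (node 3F (+ 64) (leaf (+ 1 ∷ + 1 ∷ + 0 ∷ + 0 ∷ [])) (leaf (+ 1 ∷ + 1 ∷ + 0 ∷ + 0 ∷ []))) (node 3F (+ 64) (node 0F (+ 160) (leaf (+ 0 ∷ + 0 ∷ + 0 ∷ + 0 ∷ [])) (node 1F (+ 96) (leaf (+ 1 ∷ + 0 ∷ + 0 ∷ + 0 ∷ [])) (node 2F (+ 96) (leaf (+ 1 ∷ + 1 ∷ + 0 ∷ + 0 ∷ [])) (node 3F (+ 32) (leaf (+ 1 ∷ + 0 ∷ + 0 ∷ + 0 ∷ [])) (leaf (+ 1 ∷ + 1 ∷ + 0 ∷ + 0 ∷ [])))))) (node 0F (+ 160) (leaf (+ 1 ∷ + 1 ∷ + 0 ∷ + 0 ∷ [])) (node 1F (+ 96) (node 2F (+ 96) (leaf (+ 1 ∷ + 1 ∷ + 0 ∷ + 0 ∷ [])) (node 3F (+ 96) (leaf (+ 1 ∷ + 1 ∷ + 0 ∷ + 0 ∷ [])) (leaf (+ 1 ∷ + 1 ∷ + 0 ∷ + 0 ∷ [])))) (leaf (+ 1 ∷ + 1 ∷ + 0 ∷ + 0 ∷ []))))))) (node 1F (+ 64) (node 2F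 (+ 64) (leaf (+ 1 ∷ + 0 ∷ + 0 ∷ + 0 ∷ [])) (node 3F (+ 64) (leaf (+ 1 ∷ + 0 ∷ + 0 ∷ + 0 ∷ [])) (leaf (+ 1 ∷ + 0 ∷ + 0 ∷ + 0 ∷ [])))) (node 2F (+ 64) (node 3F (+ 64) (node 0F (+ 224) (node 1F (+ 96) (leaf (+ 1 ∷ + 0 ∷ + 0 ∷ + 0 ∷ [])) (leaf (+ 1 ∷ + 1 ∷ + 0 ∷ + 0 ∷ []))) (leaf (+ 1 ∷ + 0 ∷ + 0 ∷ + 0 ∷ []))) (leaf (+ 1 ∷ + 1 ∷ + 0 ∷ + 0 ∷ []))) (node 3F (+ 64) (node 0F (+ 224) (node 1F (+ 96) (leaf (+ 1 ∷ + 0 ∷ + 0 ∷ + 0 ∷ [])) (node 2F (+ 96) (leaf (+ 1 ∷ + 1 ∷ + 0 ∷ + 0 ∷ [])) (node 3F (+ 32) (leaf (+ 1 ∷ + 0 ∷ + 0 ∷ + 0 ∷ [])) (leaf (+ 1 ∷ + 1 ∷ + 0 ∷ + 0 ∷ []))))) (node 1F (+ 96) (leaf (+ 1 ∷ + 0 ∷ + 0 ∷ + 0 ∷ [])) (node 2F (+ 96) (leaf (+ 1 ∷ + 0 ∷ + 0 ∷ + 0 ∷ [])) (leaf (+ 1 ∷ + 0 ∷ + 0 ∷ + 0 ∷ []))))) (node 0F (+ 224) (node 1F (+ 96) (node 2F (+ 96) (leaf (+ 1 ∷ + 1 ∷ + 0 ∷ + 0 ∷ [])) (leaf (+ 1 ∷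 + 0 ∷ + 0 ∷ + 0 ∷ []))) (leaf (+ 1 ∷ + 1 ∷ + 0 ∷ + 0 ∷ []))) (node 1F (+ 96) (leaf (+ 1 ∷ + 0 ∷ + 0 ∷ + 0 ∷ [])) (node 2F (+ 96) (leaf (+ 1 ∷ + 1 ∷ + 0 ∷ + 0 ∷ [])) (node 3F (+ 96) (leaf (+ 1 ∷ + 0 ∷ + 0 ∷ + 0 ∷ [])) (leaf (+ 1 ∷ + 1 ∷ + 0 ∷ + 0 ∷ [])))))))))) (node 0F (+ 192) (node 1F (+ 64) (node 2F (+ 64) (node 3F (+ 192) (node 0F (+ 160) (node 1F (+ 32) (node 2F (+ 32) (leaf (+ 1 ∷ + 0 ∷ + 0 ∷ + 1 ∷ [])) (leaf (+ 1 ∷ + 1 ∷ + 0 ∷ + 0 ∷ []))) (node 2F (+ 32) (leaf (+ 1 ∷ + 0 ∷ + 0 ∷ + 1 ∷ [])) (leaf (+ 1 ∷ + 0 ∷ + 0 ∷ + 1 ∷ [])))) (node 1F (+ 32) (node 2F (+ 32) (leaf (+ 1 ∷ + 0 ∷ + 0 ∷ + 1 ∷ [])) (leaf (+ 1 ∷ + 1 ∷ + 0 ∷ + 0 ∷ []))) (leaf (+ 1 ∷ + 0 ∷ + 0 ∷ + 1 ∷ [])))) (leaf (+ 1 ∷ + 0 ∷ + 0 ∷ + 1 ∷ []))) (node 3F (+ 192) (node 0F (+ 160) (node 1F (+ 32) (leaf (+ 1 ∷ + 1 ∷ + 0 ∷ + 0 ∷ [])) (leaf (+ 1 ∷ + 1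 ∷ + 0 ∷ + 0 ∷ []))) (node 1F (+ 32) (leaf (+ 1 ∷ + 0 ∷ + 1 ∷ + 1 ∷ [])) (node 2F (+ 96) (leaf (+ 1 ∷ + 1 ∷ + 0 ∷ + 0 ∷ [])) (leaf (+ 0 ∷ + 0 ∷ + 1 ∷ + 1 ∷ []))))) (node 0F (+ 160) (node 1F (+ 32) (leaf (+ 1 ∷ + 0 ∷ + 0 ∷ + 1 ∷ [])) (leaf (+ 1 ∷ + 0 ∷ + 0 ∷ + 1 ∷ []))) (node 1F (+ 32) (leaf (+ 1 ∷ + 0 ∷ + 0 ∷ + 1 ∷ [])) (leaf (+ 1 ∷ + 0 ∷ + 0 ∷ + 1 ∷ [])))))) (node 2F (+ 64) (node 3F (+ 192) (node 0F (+ 160) (node 1F (+ 96) (node 2F (+ 32) (leaf (+ 1 ∷ + 0 ∷ + 0 ∷ + 1 ∷ [])) (leaf (+ 1 ∷ + 0 ∷ + 0 ∷ + 1 ∷ []))) (node 2F (+ 32) (leaf (+ 1 ∷ + 0 ∷ + 0 ∷ + 1 ∷ [])) (leaf (+ 1 ∷ + 0 ∷ + 0 ∷ + 1 ∷ [])))) (node 1F (+ 96) (leaf (+ 1 ∷ + 0 ∷ + 0 ∷ + 1 ∷ [])) (leaf (+ 1 ∷ + 0 ∷ + 0 ∷ + 1 ∷ [])))) (node 0F (+ 160) (node 1F (+ 96) (leaf (+ 0 ∷ + 0 ∷ + 0 ∷ + 1 ∷ [])) (leaf (+ 1 ∷ + 1 ∷ + 0 ∷ + 1 ∷ []))) (node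 1F (+ 96) (leaf (+ 1 ∷ + 0 ∷ + 0 ∷ + 1 ∷ [])) (leaf (+ 1 ∷ + 1 ∷ + 0 ∷ + 1 ∷ []))))) (node 3F (+ 192) (node 0F (+ 160) (node 1F (+ 96) (leaf (+ 0 ∷ + 0 ∷ + 1 ∷ + 1 ∷ [])) (node 2F (+ 96) (node 3F (+ 160) (leaf (+ 1 ∷ + 1 ∷ + 0 ∷ + 0 ∷ [])) (leaf (+ 1 ∷ + 1 ∷ + 0 ∷ + 0 ∷ []))) (leaf (+ 0 ∷ + 0 ∷ + 1 ∷ + 1 ∷ [])))) (node 1F (+ 96) (leaf (+ 1 ∷ + 1 ∷ + 0 ∷ + 0 ∷ [])) (leaf (+ 1 ∷ + 1 ∷ + 0 ∷ + 0 ∷ [])))) (node 0F (+ 160) (node 1F (+ 96) (leaf (+ 1 ∷ + 0 ∷ + 0 ∷ + 1 ∷ [])) (node 2F (+ 96) (leaf (+ 1 ∷ + 0 ∷ + 0 ∷ + 1 ∷ [])) (leaf (+ 1 ∷ + 0 ∷ + 0 ∷ + 1 ∷ [])))) (node 1F (+ 96) (leaf (+ 1 ∷ + 0 ∷ + 0 ∷ + 1 ∷ [])) (node 2F (+ 96) (leaf (+ 1 ∷ + 0 ∷ + 0 ∷ + 1 ∷ [])) (leaf (+ 1 ∷ + 0 ∷ + 0 ∷ + 1 ∷ [])))))))) (node 1F (+ 64) (node 2F (+ 64) (node 3F (+ 192) (node 0F (+ 224) (node 1F (+ 32) (leaf (+ 1 ∷ + 0 ∷ + 0 ∷ + 1 ∷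 [])) (leaf (+ 1 ∷ + 0 ∷ + 0 ∷ + 1 ∷ []))) (node 1F (+ 32) (leaf (+ 1 ∷ + 0 ∷ + 0 ∷ + 1 ∷ [])) (leaf (+ 1 ∷ + 0 ∷ + 0 ∷ + 1 ∷ [])))) (leaf (+ 1 ∷ + 0 ∷ + 0 ∷ + 1 ∷ []))) (node 3F (+ 192) (node 0F (+ 224) (node 1F (+ 32) (leaf (+ 1 ∷ + 0 ∷ + 0 ∷ + 0 ∷ [])) (leaf (+ 1 ∷ + 0 ∷ + 1 ∷ + 1 ∷ []))) (leaf (+ 1 ∷ + 0 ∷ + 1 ∷ + 1 ∷ []))) (node 0F (+ 224) (node 1F (+ 32) (leaf (+ 1 ∷ + 0 ∷ + 0 ∷ + 1 ∷ [])) (leaf (+ 1 ∷ + 0 ∷ + 0 ∷ + 1 ∷ []))) (leaf (+ 1 ∷ + 0 ∷ + 1 ∷ + 1 ∷ []))))) (node 2F (+ 64) (node 3F (+ 192) (node 0F (+ 224) (node 1F (+ 96) (leaf (+ 1 ∷ + 0 ∷ + 0 ∷ + 1 ∷ [])) (leaf (+ 1 ∷ + 0 ∷ + 0 ∷ + 1 ∷ []))) (node 1F (+ 96) (leaf (+ 1 ∷ + 0 ∷ + 0 ∷ + 1 ∷ [])) (leaf (+ 1 ∷ + 0 ∷ + 0 ∷ + 1 ∷ [])))) (leaf (+ 1 ∷ + 0 ∷ + 0 ∷ + 1 ∷ []))) (node 3F (+ 192) (node 0F (+ 224) (node 1F (+ 96) (node 2F (+ 96) (leaf (+ 1 ∷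 + 1 ∷ + 0 ∷ + 0 ∷ [])) (leaf (+ 0 ∷ + 0 ∷ + 1 ∷ + 1 ∷ []))) (leaf (+ 0 ∷ + 0 ∷ + 1 ∷ + 1 ∷ []))) (node 1F (+ 96) (leaf (+ 1 ∷ + 0 ∷ + 0 ∷ + 0 ∷ [])) (leaf (+ 0 ∷ + 0 ∷ + 1 ∷ + 1 ∷ [])))) (node 0F (+ 224) (node 1F (+ 96) (leaf (+ 1 ∷ + 0 ∷ + 0 ∷ + 1 ∷ [])) (node 2F (+ 96) (leaf (+ 1 ∷ + 0 ∷ + 0 ∷ + 1 ∷ [])) (leaf (+ 1 ∷ + 0 ∷ + 0 ∷ + 1 ∷ [])))) (node 1F (+ 96) (node 2F (+ 96) (leaf (+ 1 ∷ + 0 ∷ + 0 ∷ + 1 ∷ [])) (leaf (+ 1 ∷ + 0 ∷ + 1 ∷ + 1 ∷ []))) (node 2F (+ 96) (leaf (+ 1 ∷ + 0 ∷ + 0 ∷ + 1 ∷ [])) (leaf (+ 0 ∷ + 0 ∷ + 1 ∷ + 1 ∷ [])))))))))) (node 3F (+ 128) (node 0F (+ 192) (node 1F (+ 64) (node 2F (+ 192) (node 3F (+ 64) (node 0F (+ 160) (node 1F (+ 32) (node 2F (+ 160) (leaf (+ 1 ∷ + 0 ∷ + 0 ∷ + 0 ∷ [])) (leaf (+ 0 ∷ + 0 ∷ + 1 ∷ + 0 ∷ []))) (node 2F (+ 160) (leaf (+ 1 ∷ + 0 ∷ + 0 ∷ + 0 ∷ [])) (leaf (+ 0 ∷ + 0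 ∷ + 1 ∷ + 0 ∷ [])))) (node 1F (+ 32) (leaf (+ 0 ∷ + 0 ∷ + 1 ∷ + 0 ∷ [])) (node 2F (+ 160) (leaf (+ 1 ∷ + 0 ∷ + 0 ∷ + 0 ∷ [])) (leaf (+ 0 ∷ + 0 ∷ + 1 ∷ + 0 ∷ []))))) (node 0F (+ 160) (node 1F (+ 32) (node 2F (+ 160) (node 3F (+ 96) (leaf (+ 1 ∷ + 0 ∷ + 0 ∷ + 0 ∷ [])) (leaf (+ 1 ∷ + 0 ∷ + 0 ∷ + 0 ∷ []))) (leaf (+ 0 ∷ -[1+ 0 ] ∷ + 1 ∷ + 1 ∷ []))) (node 2F (+ 160) (leaf (+ 0 ∷ + 0 ∷ + 0 ∷ + 0 ∷ [])) (node 3F (+ 96) (leaf (+ 0 ∷ -[1+ 0 ] ∷ + 1 ∷ + 1 ∷ [])) (leaf (+ 0 ∷ -[1+ 0 ] ∷ + 1 ∷ + 1 ∷ []))))) (node 1F (+ 32) (leaf (+ 0 ∷ -[1+ 0 ] ∷ + 1 ∷ + 1 ∷ [])) (node 2F (+ 160) (node 3F (+ 96) (leaf (+ 1 ∷ + 0 ∷ + 0 ∷ + 0 ∷ [])) (node 0F (+ 176) (leaf (+ 1 ∷ + 0 ∷ + 0 ∷ + 0 ∷ [])) (leaf (+ 1 ∷ + 0 ∷ + 0 ∷ + 0 ∷ [])))) (node 3F (+ 96) (leaf (+ 0 ∷ -[1+ 0 ] ∷ + 1 ∷ + 1 ∷ [])) (leaf (+ 1 ∷ + 0 ∷ + 1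 ∷ + 1 ∷ []))))))) (node 3F (+ 64) (node 0F (+ 160) (leaf (+ 0 ∷ + 0 ∷ + 1 ∷ + 0 ∷ [])) (leaf (+ 1 ∷ + 0 ∷ + 1 ∷ + 0 ∷ []))) (node 0F (+ 160) (node 1F (+ 32) (node 2F (+ 224) (node 3F (+ 96) (leaf (+ 0 ∷ + 0 ∷ + 1 ∷ + 0 ∷ [])) (leaf (+ 0 ∷ -[1+ 0 ] ∷ + 1 ∷ + 1 ∷ []))) (leaf (+ 1 ∷ + 0 ∷ + 1 ∷ + 0 ∷ []))) (node 2F (+ 224) (node 3F (+ 96) (leaf (+ 0 ∷ + 0 ∷ + 1 ∷ + 0 ∷ [])) (leaf (+ 0 ∷ -[1+ 0 ] ∷ + 1 ∷ + 1 ∷ []))) (node 3F (+ 96) (leaf (+ 0 ∷ + 0 ∷ + 1 ∷ + 0 ∷ [])) (node 0F (+ 144) (leaf (+ 0 ∷ + 0 ∷ + 1 ∷ + 0 ∷ [])) (leaf (+ 1 ∷ + 1 ∷ + 1 ∷ + 0 ∷ [])))))) (node 1F (+ 32) (leaf (+ 1 ∷ + 0 ∷ + 1 ∷ + 0 ∷ [])) (node 2F (+ 224) (node 3F (+ 96) (leaf (+ 1 ∷ + 0 ∷ + 1 ∷ + 0 ∷ [])) (leaf (+ 1 ∷ + 0 ∷ + 1 ∷ + 1 ∷ []))) (leaf (+ 1 ∷ + 1 ∷ + 1 ∷ + 0 ∷ []))))))) (node 2F (+ 192) (node 3F (+ 64) (node 0F (+ 160) (node 1F (+ 96) (node 2F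 (+ 160) (node 3F (+ 32) (leaf (+ 0 ∷ + 0 ∷ + 1 ∷ + 0 ∷ [])) (leaf (+ 0 ∷ + 0 ∷ + 0 ∷ + 0 ∷ []))) (leaf (+ 0 ∷ + 0 ∷ + 1 ∷ + 0 ∷ []))) (node 2F (+ 160) (leaf (+ 0 ∷ + 0 ∷ + 0 ∷ + 0 ∷ [])) (leaf (+ 0 ∷ + 0 ∷ + 1 ∷ + 0 ∷ [])))) (node 1F (+ 96) (node 2F (+ 160) (node 3F (+ 32) (leaf (+ 0 ∷ + 0 ∷ + 1 ∷ + 0 ∷ [])) (node 0F (+ 176) (leaf (+ 1 ∷ + 0 ∷ + 0 ∷ + 0 ∷ [])) (leaf (+ 1 ∷ + 0 ∷ + 0 ∷ + 0 ∷ [])))) (leaf (+ 0 ∷ + 0 ∷ + 1 ∷ + 0 ∷ []))) (node 2F (+ 160) (node 3F (+ 32) (node 0F (+ 176) (leaf (+ 0 ∷ + 0 ∷ + 1 ∷ + 0 ∷ [])) (leaf (+ 0 ∷ + 0 ∷ + 1 ∷ + 0 ∷ []))) (node 0F (+ 176) (leaf (+ 0 ∷ + 0 ∷ + 0 ∷ + 0 ∷ [])) (node 1F (+ 112) (node 2F (+ 144) (leaf (+ 1 ∷ + 1 ∷ + 0 ∷ + 0 ∷ [])) (leaf (+ 2 ∷ + 1 ∷ + 0 ∷ + 0 ∷ []))) (leaf (+ 1 ∷ + 1 ∷ + 0 ∷ + 0 ∷ []))))) (leaf (+ 1 ∷ + 1 ∷ + 1 ∷ + 0 ∷ []))))) (node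 0F (+ 160) (node 1F (+ 96) (node 2F (+ 160) (leaf (+ 0 ∷ + 0 ∷ + 0 ∷ + 0 ∷ [])) (node 3F (+ 96) (node 0F (+ 144) (node 1F (+ 80) (node 2F (+ 176) (leaf (+ 0 ∷ + 0 ∷ + 0 ∷ + 0 ∷ [])) (leaf (+ 0 ∷ + 0 ∷ + 1 ∷ + 0 ∷ []))) (leaf (+ 0 ∷ + 1 ∷ + 1 ∷ + 0 ∷ []))) (node 1F (+ 80) (node 2F (+ 176) (node 3F (+ 80) (leaf (+ 0 ∷ + 0 ∷ + 1 ∷ + 0 ∷ [])) (leaf (+ 0 ∷ + 0 ∷ + 0 ∷ + 0 ∷ []))) (leaf (+ 0 ∷ + 0 ∷ + 1 ∷ + 0 ∷ []))) (node 2F (+ 176) (node 3F (+ 80) (leaf (+ 0 ∷ + 0 ∷ + 1 ∷ + 0 ∷ [])) (leaf (+ 0 ∷ + 0 ∷ + 1 ∷ + 1 ∷ []))) (leaf (+ 0 ∷ + 1 ∷ + 1 ∷ + 0 ∷ []))))) (leaf (+ 0 ∷ + 0 ∷ + 1 ∷ + 1 ∷ [])))) (node 2F (+ 160) (leaf (+ 1 ∷ + 1 ∷ + 0 ∷ + 0 ∷ [])) (node 3F (+ 96) (leaf (+ 0 ∷ + 1 ∷ + 1 ∷ + 0 ∷ [])) (leaf (+ 0 ∷ + 0 ∷ + 1 ∷ + 1 ∷ []))))) (node 1F (+ 96) (node 2F (+ 160) (node 3F (+ 96) (node 0F (+ 176) (leaf (+ 0 ∷ + 0 ∷ + 0 ∷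 + 0 ∷ [])) (leaf (+ 2 ∷ + 1 ∷ + 0 ∷ + 0 ∷ []))) (node 0F (+ 176) (leaf (+ 0 ∷ + 0 ∷ + 1 ∷ + 1 ∷ [])) (node 1F (+ 80) (node 2F (+ 144) (leaf (+ 1 ∷ + 1 ∷ + 0 ∷ + 0 ∷ [])) (leaf (+ 1 ∷ + 0 ∷ + 1 ∷ + 1 ∷ []))) (leaf (+ 1 ∷ + 1 ∷ + 0 ∷ + 0 ∷ []))))) (node 3F (+ 96) (node 0F (+ 176) (node 1F (+ 80) (node 2F (+ 176) (node 3F (+ 80) (leaf (+ 0 ∷ + 0 ∷ + 1 ∷ + 0 ∷ [])) (leaf (+ 0 ∷ -[1+ 0 ] ∷ + 1 ∷ + 1 ∷ []))) (node 3F (+ 80) (leaf (+ 0 ∷ + 0 ∷ + 1 ∷ + 0 ∷ [])) (node 0F (+ 168) (leaf (+ 0 ∷ + 0 ∷ + 1 ∷ + 0 ∷ [])) (leaf (+ 1 ∷ + 0 ∷ + 1 ∷ + 1 ∷ []))))) (node 2F (+ 176) (node 3F (+ 80) (node 0F (+ 168) (leaf (+ 0 ∷ + 0 ∷ + 1 ∷ + 0 ∷ [])) (leaf (+ 0 ∷ + 0 ∷ + 1 ∷ + 0 ∷ []))) (node 0F (+ 168) (node 1F (+ 88) (leaf (+ 0 ∷ + 0 ∷ + 1 ∷ + 1 ∷ [])) (leaf (+ 1 ∷ + 1 ∷ + 0 ∷ + 0 ∷ []))) (node 1F (+ 88) (node 2F (+ 168) (leaf (+ 1 ∷ + 1 ∷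 + 0 ∷ + 0 ∷ [])) (leaf (+ 1 ∷ + 0 ∷ + 1 ∷ + 1 ∷ []))) (leaf (+ 1 ∷ + 1 ∷ + 0 ∷ + 0 ∷ []))))) (node 3F (+ 80) (leaf (+ 1 ∷ + 1 ∷ + 1 ∷ + 0 ∷ [])) (node 0F (+ 168) (leaf (+ 1 ∷ + 1 ∷ + 1 ∷ + 0 ∷ [])) (leaf (+ 1 ∷ + 1 ∷ + 1 ∷ + 0 ∷ [])))))) (node 1F (+ 80) (node 2F (+ 176) (leaf (+ 2 ∷ + 1 ∷ + 0 ∷ + 0 ∷ [])) (leaf (+ 1 ∷ + 0 ∷ + 1 ∷ + 0 ∷ []))) (node 2F (+ 176) (leaf (+ 2 ∷ + 1 ∷ + 0 ∷ + 0 ∷ [])) (leaf (+ 1 ∷ + 1 ∷ + 1 ∷ + 0 ∷ []))))) (node 0F (+ 176) (node 1F (+ 80) (leaf (+ 0 ∷ -[1+ 0 ] ∷ + 1 ∷ + 1 ∷ [])) (leaf (+ 1 ∷ + 1 ∷ + 1 ∷ + 1 ∷ []))) (node 1F (+ 80) (leaf (+ 1 ∷ + 0 ∷ + 1 ∷ + 1 ∷ [])) (leaf (+ 1 ∷ + 0 ∷ + 1 ∷ + 1 ∷ [])))))) (node 2F (+ 160) (node 3F (+ 96) (leaf (+ 1 ∷ + 1 ∷ + 0 ∷ + 0 ∷ [])) (leaf (+ 1 ∷ + 1 ∷ + 0 ∷ + 0 ∷ []))) (node 3F (+ 96) (node 0F (+ 176) (node 1F (+ 112) (node 2F (+ 176)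 (node 3F (+ 80) (leaf (+ 0 ∷ + 1 ∷ + 1 ∷ + 0 ∷ [])) (leaf (+ 1 ∷ + 1 ∷ + 0 ∷ + 0 ∷ []))) (leaf (+ 1 ∷ + 1 ∷ + 1 ∷ + 0 ∷ []))) (leaf (+ 0 ∷ + 1 ∷ + 1 ∷ + 0 ∷ []))) (node 1F (+ 112) (node 2F (+ 176) (node 3F (+ 80) (leaf (+ 1 ∷ + 1 ∷ + 1 ∷ + 0 ∷ [])) (leaf (+ 1 ∷ + 1 ∷ + 1 ∷ + 1 ∷ []))) (leaf (+ 1 ∷ + 1 ∷ + 1 ∷ + 0 ∷ []))) (node 2F (+ 176) (leaf (+ 1 ∷ + 1 ∷ + 0 ∷ + 0 ∷ [])) (leaf (+ 1 ∷ + 1 ∷ + 1 ∷ + 0 ∷ []))))) (leaf (+ 1 ∷ + 1 ∷ + 1 ∷ + 1 ∷ []))))))) (node 3F (+ 64) (node 0F (+ 160) (leaf (+ 0 ∷ + 0 ∷ + 1 ∷ + 0 ∷ [])) (node 1F (+ 96) (leaf (+ 1 ∷ + 1 ∷ + 1 ∷ + 0 ∷ [])) (leaf (+ 1 ∷ + 1 ∷ + 1 ∷ + 0 ∷ [])))) (node 0F (+ 160) (node 1F (+ 96) (node 2F (+ 224) (node 3F (+ 96) (leaf (+ 0 ∷ + 0 ∷ + 1 ∷ + 0 ∷ [])) (node 0F (+ 144) (leaf (+ 0 ∷ + 0 ∷ + 1 ∷ + 1 ∷ [])) (node 1F (+ 80) (node 2F (+ 208) (leaf (+ 0 ∷ +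 0 ∷ + 1 ∷ + 1 ∷ [])) (leaf (+ 1 ∷ + 0 ∷ + 1 ∷ + 1 ∷ []))) (leaf (+ 1 ∷ + 1 ∷ + 1 ∷ + 1 ∷ []))))) (node 3F (+ 96) (leaf (+ 1 ∷ + 1 ∷ + 1 ∷ + 0 ∷ [])) (node 0F (+ 144) (leaf (+ 0 ∷ + 0 ∷ + 1 ∷ + 0 ∷ [])) (leaf (+ 1 ∷ + 1 ∷ + 1 ∷ + 0 ∷ []))))) (node 2F (+ 224) (node 3F (+ 96) (leaf (+ 1 ∷ + 1 ∷ + 1 ∷ + 0 ∷ [])) (leaf (+ 1 ∷ + 1 ∷ + 1 ∷ + 1 ∷ []))) (leaf (+ 1 ∷ + 1 ∷ + 1 ∷ + 0 ∷ [])))) (node 1F (+ 96) (node 2F (+ 224) (node 3F (+ 96) (leaf (+ 1 ∷ + 1 ∷ + 1 ∷ + 0 ∷ [])) (node 0F (+ 176) (node 1F (+ 80) (leaf (+ 1 ∷ + 0 ∷ + 1 ∷ + 1 ∷ [])) (leaf (+ 1 ∷ + 0 ∷ + 1 ∷ + 1 ∷ []))) (leaf (+ 1 ∷ + 0 ∷ + 1 ∷ + 1 ∷ [])))) (leaf (+ 1 ∷ + 1 ∷ + 1 ∷ + 0 ∷ []))) (node 2F (+ 224) (node 3F (+ 96) (leaf (+ 1 ∷ + 1 ∷ + 1 ∷ + 0 ∷ [])) (leaf (+ 1 ∷ + 1 ∷ + 1 ∷ + 1 ∷ []))) (leaf (+ 1 ∷ + 1 ∷ + 1 ∷ + 0 ∷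 [])))))))) (node 1F (+ 64) (node 2F (+ 192) (node 3F (+ 64) (leaf (+ 1 ∷ + 0 ∷ + 1 ∷ + 0 ∷ [])) (node 0F (+ 224) (node 1F (+ 32) (node 2F (+ 160) (leaf (+ 1 ∷ + 0 ∷ + 0 ∷ + 0 ∷ [])) (leaf (+ 1 ∷ + 0 ∷ + 1 ∷ + 1 ∷ []))) (node 2F (+ 160) (leaf (+ 1 ∷ + 0 ∷ + 0 ∷ + 0 ∷ [])) (node 3F (+ 96) (leaf (+ 1 ∷ + 0 ∷ + 1 ∷ + 0 ∷ [])) (leaf (+ 1 ∷ + 0 ∷ + 1 ∷ + 1 ∷ []))))) (node 1F (+ 32) (leaf (+ 1 ∷ + 0 ∷ + 1 ∷ + 1 ∷ [])) (node 2F (+ 160) (leaf (+ 1 ∷ + 0 ∷ + 1 ∷ + 1 ∷ [])) (leaf (+ 1 ∷ + 0 ∷ + 1 ∷ + 1 ∷ [])))))) (leaf (+ 1 ∷ + 0 ∷ + 1 ∷ + 0 ∷ []))) (node 2F (+ 192) (node 3F (+ 64) (node 0F (+ 224) (node 1F (+ 96) (node 2F (+ 160) (node 3F (+ 32) (leaf (+ 1 ∷ + 0 ∷ + 0 ∷ + 0 ∷ [])) (leaf (+ 1 ∷ + 0 ∷ + 0 ∷ + 0 ∷ []))) (leaf (+ 1 ∷ + 0 ∷ + 1 ∷ + 0 ∷ []))) (node 2F (+ 160) (node 3F (+ 32) (node 0F (+ 208) (leaf (+ 0 ∷ + 0 ∷ + 1 ∷ + 0 ∷ [])) (leaf (+ 1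 ∷ + 1 ∷ + 1 ∷ + 0 ∷ []))) (leaf (+ 2 ∷ + 1 ∷ + 0 ∷ + 0 ∷ []))) (leaf (+ 1 ∷ + 1 ∷ + 1 ∷ + 0 ∷ [])))) (node 1F (+ 96) (leaf (+ 1 ∷ + 0 ∷ + 1 ∷ + 0 ∷ [])) (node 2F (+ 160) (node 3F (+ 32) (leaf (+ 1 ∷ + 0 ∷ + 1 ∷ + 0 ∷ [])) (leaf (+ 2 ∷ + 1 ∷ + 0 ∷ + 0 ∷ []))) (leaf (+ 1 ∷ + 1 ∷ + 1 ∷ + 0 ∷ []))))) (node 0F (+ 224) (node 1F (+ 96) (node 2F (+ 160) (node 3F (+ 96) (leaf (+ 1 ∷ + 0 ∷ + 0 ∷ + 0 ∷ [])) (node 0F (+ 208) (node 1F (+ 80) (leaf (+ 1 ∷ + 0 ∷ + 1 ∷ + 1 ∷ [])) (leaf (+ 1 ∷ + 0 ∷ + 1 ∷ + 1 ∷ []))) (leaf (+ 1 ∷ + 0 ∷ + 1 ∷ + 1 ∷ [])))) (leaf (+ 2 ∷ + 1 ∷ + 0 ∷ + 0 ∷ []))) (node 2F (+ 160) (node 3F (+ 96) (leaf (+ 2 ∷ + 1 ∷ + 0 ∷ + 0 ∷ [])) (leaf (+ 1 ∷ + 1 ∷ + 1 ∷ + 1 ∷ []))) (leaf (+ 2 ∷ + 1 ∷ + 0 ∷ + 0 ∷ [])))) (node 1F (+ 96) (leaf (+ 2 ∷ + 1 ∷ + 0 ∷ + 0 ∷ [])) (node 2F (+ 160) (leaf (+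 2 ∷ + 1 ∷ + 0 ∷ + 0 ∷ [])) (leaf (+ 2 ∷ + 1 ∷ + 0 ∷ + 0 ∷ [])))))) (node 3F (+ 64) (node 0F (+ 224) (node 1F (+ 96) (leaf (+ 1 ∷ + 1 ∷ + 1 ∷ + 0 ∷ [])) (leaf (+ 1 ∷ + 1 ∷ + 1 ∷ + 0 ∷ []))) (leaf (+ 1 ∷ + 0 ∷ + 1 ∷ + 0 ∷ []))) (node 0F (+ 224) (node 1F (+ 96) (node 2F (+ 224) (node 3F (+ 96) (leaf (+ 1 ∷ + 1 ∷ + 1 ∷ + 0 ∷ [])) (leaf (+ 1 ∷ + 0 ∷ + 1 ∷ + 1 ∷ []))) (leaf (+ 1 ∷ + 1 ∷ + 1 ∷ + 0 ∷ []))) (node 2F (+ 224) (node 3F (+ 96) (leaf (+ 1 ∷ + 1 ∷ + 1 ∷ + 0 ∷ [])) (leaf (+ 1 ∷ + 0 ∷ + 1 ∷ + 1 ∷ []))) (leaf (+ 1 ∷ + 1 ∷ + 1 ∷ + 0 ∷ [])))) (node 1F (+ 96) (leaf (+ 1 ∷ + 1 ∷ + 1 ∷ + 0 ∷ [])) (node 2F (+ 224) (node 3F (+ 96) (leaf (+ 1 ∷ + 1 ∷ + 1 ∷ + 0 ∷ [])) (leaf (+ 1 ∷ + 0 ∷ + 1 ∷ + 1 ∷ []))) (leaf (+ 1 ∷ + 1 ∷ + 1 ∷ + 0 ∷ []))))))))) (node 0F (+ 192) (node 1F (+ 64) (node 2F (+ 192) (node 3F (+ 192) (node 0F (+ 160)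 (node 1F (+ 32) (node 2F (+ 160) (leaf (+ 0 ∷ + 0 ∷ + 1 ∷ + 1 ∷ [])) (leaf (+ 0 ∷ + 0 ∷ + 1 ∷ + 1 ∷ []))) (leaf (+ 0 ∷ + 0 ∷ + 1 ∷ + 1 ∷ []))) (node 1F (+ 32) (leaf (+ 1 ∷ + 0 ∷ + 1 ∷ + 1 ∷ [])) (node 2F (+ 160) (leaf (+ 0 ∷ + 0 ∷ + 1 ∷ + 1 ∷ [])) (leaf (+ 1 ∷ + 0 ∷ + 1 ∷ + 1 ∷ []))))) (leaf (+ 0 ∷ + 0 ∷ + 1 ∷ + 1 ∷ []))) (node 3F (+ 192) (node 0F (+ 160) (node 1F (+ 32) (node 2F (+ 224) (leaf (+ 1 ∷ + 0 ∷ + 1 ∷ + 1 ∷ [])) (leaf (+ 1 ∷ + 0 ∷ + 1 ∷ + 1 ∷ []))) (node 2F (+ 224) (leaf (+ 0 ∷ + 0 ∷ + 1 ∷ + 1 ∷ [])) (leaf (+ 1 ∷ + 0 ∷ + 1 ∷ + 1 ∷ [])))) (leaf (+ 1 ∷ + 0 ∷ + 1 ∷ + 1 ∷ []))) (node 0F (+ 160) (leaf (+ 0 ∷ + 0 ∷ + 1 ∷ + 1 ∷ [])) (leaf (+ 1 ∷ + 0 ∷ + 1 ∷ + 1 ∷ []))))) (node 2F (+ 192) (node 3F (+ 192) (node 0F (+ 160) (leaf (+ 0 ∷ + 0 ∷ + 1 ∷ + 1 ∷ [])) (node 1F (+ 96) (node 2F (+ 160) (leaf (+ 0 ∷ + 0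 ∷ + 1 ∷ + 1 ∷ [])) (leaf (+ 0 ∷ + 0 ∷ + 1 ∷ + 1 ∷ []))) (leaf (+ 0 ∷ + 0 ∷ + 1 ∷ + 1 ∷ [])))) (leaf (+ 0 ∷ + 0 ∷ + 1 ∷ + 1 ∷ []))) (node 3F (+ 192) (node 0F (+ 160) (node 1F (+ 96) (node 2F (+ 224) (leaf (+ 0 ∷ + 0 ∷ + 1 ∷ + 1 ∷ [])) (leaf (+ 0 ∷ + 0 ∷ + 1 ∷ + 1 ∷ []))) (leaf (+ 1 ∷ + 1 ∷ + 1 ∷ + 1 ∷ []))) (node 1F (+ 96) (leaf (+ 1 ∷ + 0 ∷ + 1 ∷ + 1 ∷ [])) (leaf (+ 1 ∷ + 1 ∷ + 1 ∷ + 1 ∷ [])))) (leaf (+ 0 ∷ + 0 ∷ + 1 ∷ + 1 ∷ []))))) (node 1F (+ 64) (node 2F (+ 192) (leaf (+ 1 ∷ + 0 ∷ + 1 ∷ + 1 ∷ [])) (leaf (+ 1 ∷ + 0 ∷ + 1 ∷ + 1 ∷ []))) (node 2F (+ 192) (node 3F (+ 192) (node 0F (+ 224) (node 1F (+ 96) (node 2F (+ 160) (leaf (+ 1 ∷ + 0 ∷ + 1 ∷ + 1 ∷ [])) (leaf (+ 1 ∷ + 0 ∷ + 1 ∷ + 1 ∷ []))) (node 2F (+ 160) (leaf (+ 0 ∷ + 0 ∷ + 1 ∷ + 1 ∷ [])) (leaf (+ 1 ∷ + 1 ∷ + 1 ∷ + 1 ∷ [])))) (node 1F (+ 96) (leaf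 (+ 1 ∷ + 0 ∷ + 1 ∷ + 1 ∷ [])) (node 2F (+ 160) (node 3F (+ 160) (leaf (+ 1 ∷ + 0 ∷ + 1 ∷ + 1 ∷ [])) (leaf (+ 1 ∷ + 0 ∷ + 1 ∷ + 1 ∷ []))) (leaf (+ 1 ∷ + 0 ∷ + 1 ∷ + 1 ∷ []))))) (node 0F (+ 224) (leaf (+ 0 ∷ + 0 ∷ + 1 ∷ + 1 ∷ [])) (node 1F (+ 96) (leaf (+ 1 ∷ + 0 ∷ + 1 ∷ + 1 ∷ [])) (node 2F (+ 160) (leaf (+ 0 ∷ + 0 ∷ + 1 ∷ + 1 ∷ [])) (leaf (+ 1 ∷ + 0 ∷ + 1 ∷ + 1 ∷ [])))))) (node 3F (+ 192) (leaf (+ 1 ∷ + 0 ∷ + 1 ∷ + 1 ∷ [])) (node 0F (+ 224) (node 1F (+ 96) (leaf (+ 1 ∷ + 0 ∷ + 1 ∷ + 1 ∷ [])) (leaf (+ 1 ∷ + 1 ∷ + 1 ∷ + 1 ∷ []))) (leaf (+ 1 ∷ + 0 ∷ + 1 ∷ + 1 ∷ []))))))))) (node 2F (+ 128) (node 3F (+ 128) (node 0F (+ 192) (node 1F (+ 192) (node 2F (+ 64) (node 3F (+ 64) (leaf (+ 1 ∷ + 1 ∷ + 0 ∷ + 0 ∷ [])) (leaf (+ 1 ∷ + 1 ∷ + 0 ∷ + 0 ∷ []))) (node 3F (+ 64) (leaf (+ 1 ∷ + 1 ∷ + 0 ∷ + 0 ∷ [])) (leaf (+ 1 ∷ + 1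 ∷ + 0 ∷ + 0 ∷ [])))) (node 2F (+ 64) (node 3F (+ 64) (leaf (+ 1 ∷ + 1 ∷ + 0 ∷ + 0 ∷ [])) (node 0F (+ 160) (node 1F (+ 224) (leaf (+ 1 ∷ + 1 ∷ + 0 ∷ + 0 ∷ [])) (leaf (+ 1 ∷ + 1 ∷ + 0 ∷ + 0 ∷ []))) (leaf (+ 1 ∷ + 1 ∷ + 0 ∷ + 0 ∷ [])))) (node 3F (+ 64) (leaf (+ 1 ∷ + 1 ∷ + 0 ∷ + 0 ∷ [])) (leaf (+ 1 ∷ + 1 ∷ + 0 ∷ + 0 ∷ []))))) (node 1F (+ 192) (node 2F (+ 64) (leaf (+ 1 ∷ + 1 ∷ + 0 ∷ + 0 ∷ [])) (node 3F (+ 64) (node 0F (+ 224) (leaf (+ 1 ∷ + 1 ∷ + 0 ∷ + 0 ∷ [])) (leaf (+ 1 ∷ + 1 ∷ + 0 ∷ + 0 ∷ []))) (leaf (+ 1 ∷ + 1 ∷ + 0 ∷ + 0 ∷ [])))) (node 2F (+ 64) (leaf (+ 1 ∷ + 1 ∷ + 0 ∷ + 0 ∷ [])) (leaf (+ 1 ∷ + 1 ∷ + 0 ∷ + 0 ∷ []))))) (node 0F (+ 192) (node 1F (+ 192) (node 2F (+ 64) (node 3F (+ 192) (node 0F (+ 160) (node 1F (+ 160) (node 2F (+ 32) (leaf (+ 1 ∷ + 1 ∷ + 0 ∷ + 1 ∷ [])) (leaf (+ 1 ∷ + 0 ∷ + 0 ∷ + 1 ∷ []))) (node 2F (+ 32)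 (leaf (+ 1 ∷ + 1 ∷ + 0 ∷ + 1 ∷ [])) (node 3F (+ 160) (leaf (+ 1 ∷ + 1 ∷ + 0 ∷ + 0 ∷ [])) (leaf (+ 1 ∷ + 1 ∷ + 0 ∷ + 1 ∷ []))))) (node 1F (+ 160) (leaf (+ 1 ∷ + 1 ∷ + 0 ∷ + 1 ∷ [])) (leaf (+ 1 ∷ + 1 ∷ + 0 ∷ + 1 ∷ [])))) (leaf (+ 1 ∷ + 1 ∷ + 0 ∷ + 1 ∷ []))) (node 3F (+ 192) (node 0F (+ 160) (node 1F (+ 160) (node 2F (+ 96) (leaf (+ 1 ∷ + 0 ∷ + 0 ∷ + 1 ∷ [])) (leaf (+ 1 ∷ + 1 ∷ + 0 ∷ + 0 ∷ []))) (node 2F (+ 96) (node 3F (+ 160) (leaf (+ 1 ∷ + 1 ∷ + 0 ∷ + 0 ∷ [])) (leaf (+ 1 ∷ + 0 ∷ + 0 ∷ + 1 ∷ []))) (leaf (+ 1 ∷ + 1 ∷ + 1 ∷ + 1 ∷ [])))) (node 1F (+ 160) (leaf (+ 1 ∷ + 1 ∷ + 0 ∷ + 0 ∷ [])) (leaf (+ 1 ∷ + 1 ∷ + 1 ∷ + 1 ∷ [])))) (node 0F (+ 160) (node 1F (+ 160) (node 2F (+ 96) (leaf (+ 1 ∷ + 1 ∷ + 0 ∷ + 1 ∷ [])) (leaf (+ 1 ∷ + 1 ∷ + 1 ∷ + 1 ∷ []))) (node 2F (+ 96) (leaf (+ 1 ∷ + 1 ∷ + 0 ∷ + 1 ∷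 [])) (leaf (+ 1 ∷ + 1 ∷ + 1 ∷ + 1 ∷ [])))) (node 1F (+ 160) (node 2F (+ 96) (leaf (+ 1 ∷ + 1 ∷ + 0 ∷ + 1 ∷ [])) (leaf (+ 1 ∷ + 1 ∷ + 1 ∷ + 1 ∷ []))) (node 2F (+ 96) (leaf (+ 1 ∷ + 1 ∷ + 0 ∷ + 1 ∷ [])) (leaf (+ 1 ∷ + 1 ∷ + 1 ∷ + 1 ∷ []))))))) (node 2F (+ 64) (node 3F (+ 192) (node 0F (+ 160) (node 1F (+ 224) (node 2F (+ 32) (leaf (+ 1 ∷ + 1 ∷ + 0 ∷ + 1 ∷ [])) (node 3F (+ 160) (leaf (+ 1 ∷ + 1 ∷ + 0 ∷ + 0 ∷ [])) (leaf (+ 1 ∷ + 1 ∷ + 0 ∷ + 1 ∷ [])))) (node 2F (+ 32) (leaf (+ 1 ∷ + 1 ∷ + 0 ∷ + 1 ∷ [])) (leaf (+ 1 ∷ + 2 ∷ + 0 ∷ + 0 ∷ [])))) (node 1F (+ 224) (leaf (+ 1 ∷ + 1 ∷ + 0 ∷ + 1 ∷ [])) (node 2F (+ 32) (leaf (+ 1 ∷ + 1 ∷ + 0 ∷ + 1 ∷ [])) (leaf (+ 1 ∷ + 2 ∷ + 0 ∷ + 0 ∷ []))))) (leaf (+ 1 ∷ + 1 ∷ + 0 ∷ + 1 ∷ []))) (node 3F (+ 192) (node 0F (+ 160) (node 1F (+ 224) (node 2F (+ 96) (node 3F (+ 160) (leaf (+ 1 ∷ + 1 ∷ + 0 ∷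 + 0 ∷ [])) (node 0F (+ 144) (leaf (+ 1 ∷ + 2 ∷ + 0 ∷ + 0 ∷ [])) (leaf (+ 1 ∷ + 1 ∷ + 0 ∷ + 1 ∷ [])))) (leaf (+ 1 ∷ + 1 ∷ + 1 ∷ + 1 ∷ []))) (node 2F (+ 96) (leaf (+ 1 ∷ + 2 ∷ + 0 ∷ + 0 ∷ [])) (leaf (+ 1 ∷ + 1 ∷ + 1 ∷ + 1 ∷ [])))) (leaf (+ 1 ∷ + 1 ∷ + 1 ∷ + 1 ∷ []))) (node 0F (+ 160) (node 1F (+ 224) (node 2F (+ 96) (leaf (+ 1 ∷ + 1 ∷ + 0 ∷ + 1 ∷ [])) (leaf (+ 1 ∷ + 1 ∷ + 1 ∷ + 1 ∷ []))) (node 2F (+ 96) (leaf (+ 1 ∷ + 1 ∷ + 0 ∷ + 1 ∷ [])) (leaf (+ 0 ∷ + 1 ∷ + 1 ∷ + 1 ∷ [])))) (node 1F (+ 224) (leaf (+ 1 ∷ + 1 ∷ + 0 ∷ + 1 ∷ [])) (leaf (+ 1 ∷ + 1 ∷ + 0 ∷ + 1 ∷ []))))))) (node 1F (+ 192) (node 2F (+ 64) (node 3F (+ 192) (node 0F (+ 224) (leaf (+ 1 ∷ + 1 ∷ + 0 ∷ + 1 ∷ [])) (node 1F (+ 160) (leaf (+ 1 ∷ + 0 ∷ + 0 ∷ + 1 ∷ [])) (leaf (+ 1 ∷ + 1 ∷ + 0 ∷ + 1 ∷ [])))) (leaf (+ 1 ∷ + 1 ∷ + 0 ∷ + 1 ∷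 []))) (node 3F (+ 192) (node 0F (+ 224) (node 1F (+ 160) (leaf (+ 1 ∷ + 1 ∷ + 0 ∷ + 0 ∷ [])) (leaf (+ 1 ∷ + 1 ∷ + 0 ∷ + 0 ∷ []))) (node 1F (+ 160) (leaf (+ 0 ∷ + 0 ∷ + 1 ∷ + 1 ∷ [])) (node 2F (+ 96) (leaf (+ 1 ∷ + 1 ∷ + 0 ∷ + 0 ∷ [])) (leaf (+ 1 ∷ + 1 ∷ + 0 ∷ + 0 ∷ []))))) (node 0F (+ 224) (node 1F (+ 160) (node 2F (+ 96) (leaf (+ 1 ∷ + 1 ∷ + 0 ∷ + 1 ∷ [])) (node 3F (+ 224) (leaf (+ 1 ∷ + 1 ∷ + 1 ∷ + 1 ∷ [])) (leaf (+ 1 ∷ + 1 ∷ + 0 ∷ + 1 ∷ [])))) (leaf (+ 1 ∷ + 1 ∷ + 0 ∷ + 1 ∷ []))) (node 1F (+ 160) (node 2F (+ 96) (leaf (+ 1 ∷ + 0 ∷ + 0 ∷ + 1 ∷ [])) (leaf (+ 1 ∷ + 1 ∷ + 0 ∷ + 1 ∷ []))) (leaf (+ 1 ∷ + 1 ∷ + 0 ∷ + 1 ∷ [])))))) (node 2F (+ 64) (node 3F (+ 192) (node 0F (+ 224) (node 1F (+ 224) (leaf (+ 1 ∷ + 1 ∷ + 0 ∷ + 1 ∷ [])) (leaf (+ 1 ∷ + 1 ∷ + 0 ∷ + 1 ∷ []))) (leaf (+ 1 ∷ + 1 ∷ + 0 ∷ + 1 ∷ []))) (leaf (+ 1 ∷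 + 1 ∷ + 0 ∷ + 1 ∷ []))) (node 3F (+ 192) (leaf (+ 1 ∷ + 1 ∷ + 1 ∷ + 1 ∷ [])) (node 0F (+ 224) (node 1F (+ 224) (leaf (+ 1 ∷ + 1 ∷ + 0 ∷ + 1 ∷ [])) (leaf (+ 1 ∷ + 1 ∷ + 0 ∷ + 1 ∷ []))) (leaf (+ 1 ∷ + 1 ∷ + 0 ∷ + 1 ∷ [])))))))) (node 3F (+ 128) (node 0F (+ 192) (node 1F (+ 192) (node 2F (+ 192) (node 3F (+ 64) (node 0F (+ 160) (node 1F (+ 160) (node 2F (+ 160) (leaf (+ 0 ∷ + 1 ∷ + 1 ∷ + 0 ∷ [])) (leaf (+ 1 ∷ + 1 ∷ + 1 ∷ + 0 ∷ []))) (leaf (+ 1 ∷ + 1 ∷ + 1 ∷ + 0 ∷ []))) (node 1F (+ 160) (node 2F (+ 160) (node 3F (+ 32) (leaf (+ 1 ∷ + 1 ∷ + 1 ∷ + 0 ∷ [])) (leaf (+ 1 ∷ + 1 ∷ + 0 ∷ + 0 ∷ []))) (leaf (+ 1 ∷ + 1 ∷ + 1 ∷ + 0 ∷ []))) (leaf (+ 1 ∷ + 1 ∷ + 1 ∷ + 0 ∷ [])))) (node 0F (+ 160) (node 1F (+ 160) (node 2F (+ 160) (leaf (+ 1 ∷ + 1 ∷ + 0 ∷ + 0 ∷ [])) (leaf (+ 0 ∷ + 1 ∷ + 1 ∷ + 0 ∷ []))) (leaf (+ 1 ∷ + 1 ∷ + 0 ∷ + 0 ∷ []))) (node 1F (+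 160) (node 2F (+ 160) (leaf (+ 1 ∷ + 1 ∷ + 0 ∷ + 0 ∷ [])) (node 3F (+ 96) (leaf (+ 0 ∷ + 1 ∷ + 1 ∷ + 0 ∷ [])) (leaf (+ 1 ∷ + 1 ∷ + 1 ∷ + 1 ∷ [])))) (leaf (+ 1 ∷ + 1 ∷ + 1 ∷ + 1 ∷ []))))) (node 3F (+ 64) (leaf (+ 1 ∷ + 1 ∷ + 1 ∷ + 0 ∷ [])) (node 0F (+ 160) (node 1F (+ 160) (node 2F (+ 224) (leaf (+ 0 ∷ + 1 ∷ + 1 ∷ + 0 ∷ [])) (leaf (+ 1 ∷ + 1 ∷ + 1 ∷ + 0 ∷ []))) (node 2F (+ 224) (leaf (+ 0 ∷ + 1 ∷ + 1 ∷ + 0 ∷ [])) (leaf (+ 1 ∷ + 1 ∷ + 1 ∷ + 0 ∷ [])))) (node 1F (+ 160) (node 2F (+ 224) (node 3F (+ 96) (leaf (+ 1 ∷ + 1 ∷ + 1 ∷ + 0 ∷ [])) (leaf (+ 1 ∷ + 1 ∷ + 1 ∷ + 1 ∷ []))) (leaf (+ 1 ∷ + 1 ∷ + 1 ∷ + 0 ∷ []))) (node 2F (+ 224) (leaf (+ 1 ∷ + 1 ∷ + 1 ∷ + 1 ∷ [])) (leaf (+ 1 ∷ + 1 ∷ + 1 ∷ + 0 ∷ []))))))) (node 2F (+ 192) (node 3F (+ 64) (node 0F (+ 160) (leaf (+ 0 ∷ + 1 ∷ + 1 ∷ + 0 ∷ [])) (leaf (+ 1 ∷ + 1 ∷ +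 1 ∷ + 0 ∷ []))) (node 0F (+ 160) (node 1F (+ 224) (leaf (+ 1 ∷ + 1 ∷ + 0 ∷ + 0 ∷ [])) (leaf (+ 0 ∷ + 0 ∷ + 1 ∷ + 1 ∷ []))) (node 1F (+ 224) (leaf (+ 1 ∷ + 1 ∷ + 0 ∷ + 0 ∷ [])) (node 2F (+ 160) (leaf (+ 1 ∷ + 1 ∷ + 0 ∷ + 0 ∷ [])) (leaf (+ 1 ∷ + 1 ∷ + 0 ∷ + 0 ∷ [])))))) (node 3F (+ 64) (leaf (+ 1 ∷ + 1 ∷ + 1 ∷ + 0 ∷ [])) (node 0F (+ 160) (node 1F (+ 224) (node 2F (+ 224) (leaf (+ 1 ∷ + 1 ∷ + 1 ∷ + 0 ∷ [])) (leaf (+ 1 ∷ + 1 ∷ + 1 ∷ + 0 ∷ []))) (node 2F (+ 224) (leaf (+ 1 ∷ + 1 ∷ + 1 ∷ + 0 ∷ [])) (leaf (+ 1 ∷ + 1 ∷ + 1 ∷ + 0 ∷ [])))) (node 1F (+ 224) (leaf (+ 1 ∷ + 1 ∷ + 1 ∷ + 0 ∷ [])) (leaf (+ 1 ∷ + 1 ∷ + 1 ∷ + 0 ∷ []))))))) (node 1F (+ 192) (node 2F (+ 192) (node 3F (+ 64) (node 0F (+ 224) (node 1F (+ 160) (node 2F (+ 160) (node 3F (+ 32) (leaf (+ 1 ∷ + 1 ∷ + 1 ∷ + 0 ∷ [])) (leaf (+ 1 ∷ + 1 ∷ + 0 ∷ + 0 ∷ []))) (leaf (+ 1 ∷ + 1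 ∷ + 1 ∷ + 0 ∷ []))) (leaf (+ 1 ∷ + 1 ∷ + 1 ∷ + 0 ∷ []))) (node 1F (+ 160) (node 2F (+ 160) (leaf (+ 2 ∷ + 1 ∷ + 0 ∷ + 0 ∷ [])) (leaf (+ 1 ∷ + 1 ∷ + 1 ∷ + 0 ∷ []))) (node 2F (+ 160) (leaf (+ 1 ∷ + 1 ∷ + 0 ∷ + 0 ∷ [])) (leaf (+ 1 ∷ + 1 ∷ + 1 ∷ + 0 ∷ []))))) (node 0F (+ 224) (node 1F (+ 160) (node 2F (+ 160) (leaf (+ 1 ∷ + 1 ∷ + 0 ∷ + 0 ∷ [])) (node 3F (+ 96) (node 0F (+ 208) (leaf (+ 1 ∷ + 1 ∷ + 1 ∷ + 1 ∷ [])) (leaf (+ 1 ∷ + 1 ∷ + 1 ∷ + 0 ∷ []))) (leaf (+ 1 ∷ + 1 ∷ + 1 ∷ + 1 ∷ [])))) (leaf (+ 1 ∷ + 1 ∷ + 1 ∷ + 1 ∷ []))) (node 1F (+ 160) (node 2F (+ 160) (node 3F (+ 96) (leaf (+ 1 ∷ + 1 ∷ + 0 ∷ + 0 ∷ [])) (leaf (+ 1 ∷ + 1 ∷ + 0 ∷ + 0 ∷ []))) (leaf (+ 2 ∷ + 1 ∷ + 0 ∷ + 0 ∷ []))) (leaf (+ 1 ∷ + 1 ∷ + 1 ∷ + 1 ∷ []))))) (node 3F (+ 64) (leaf (+ 1 ∷ + 1 ∷ + 1 ∷ + 0 ∷ [])) (node 0F (+ 224) (node 1F (+ 160) (node 2F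 (+ 224) (node 3F (+ 96) (leaf (+ 1 ∷ + 1 ∷ + 1 ∷ + 0 ∷ [])) (leaf (+ 1 ∷ + 0 ∷ + 1 ∷ + 1 ∷ []))) (leaf (+ 1 ∷ + 1 ∷ + 1 ∷ + 0 ∷ []))) (leaf (+ 1 ∷ + 1 ∷ + 1 ∷ + 0 ∷ []))) (node 1F (+ 160) (node 2F (+ 224) (node 3F (+ 96) (leaf (+ 1 ∷ + 1 ∷ + 1 ∷ + 0 ∷ [])) (leaf (+ 1 ∷ + 0 ∷ + 1 ∷ + 1 ∷ []))) (leaf (+ 1 ∷ + 1 ∷ + 1 ∷ + 0 ∷ []))) (leaf (+ 1 ∷ + 1 ∷ + 1 ∷ + 0 ∷ [])))))) (node 2F (+ 192) (node 3F (+ 64) (node 0F (+ 224) (leaf (+ 1 ∷ + 1 ∷ + 1 ∷ + 0 ∷ [])) (leaf (+ 1 ∷ + 1 ∷ + 1 ∷ + 0 ∷ []))) (leaf (+ 1 ∷ + 1 ∷ + 1 ∷ + 1 ∷ []))) (node 3F (+ 64) (leaf (+ 1 ∷ + 1 ∷ + 1 ∷ + 0 ∷ [])) (node 0F (+ 224) (leaf (+ 1 ∷ + 1 ∷ + 1 ∷ + 0 ∷ [])) (node 1F (+ 224) (leaf (+ 1 ∷ + 1 ∷ + 1 ∷ + 0 ∷ [])) (leaf (+ 1 ∷ + 1 ∷ + 1 ∷ + 0 ∷ [])))))))) (node 0F (+ 192) (node 1F (+ 192) (node 2F (+ 192) (node 3F (+ 192) (leaf (+ 0 ∷ + 0 ∷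 + 1 ∷ + 1 ∷ [])) (leaf (+ 1 ∷ + 1 ∷ + 1 ∷ + 1 ∷ []))) (node 3F (+ 192) (leaf (+ 1 ∷ + 1 ∷ + 1 ∷ + 1 ∷ [])) (leaf (+ 1 ∷ + 1 ∷ + 1 ∷ + 1 ∷ [])))) (node 2F (+ 192) (node 3F (+ 192) (leaf (+ 1 ∷ + 1 ∷ + 1 ∷ + 1 ∷ [])) (leaf (+ 1 ∷ + 1 ∷ + 1 ∷ + 1 ∷ []))) (node 3F (+ 192) (node 0F (+ 160) (node 1F (+ 224) (leaf (+ 1 ∷ + 1 ∷ + 1 ∷ + 1 ∷ [])) (leaf (+ 1 ∷ + 1 ∷ + 1 ∷ + 1 ∷ []))) (leaf (+ 1 ∷ + 1 ∷ + 1 ∷ + 1 ∷ []))) (leaf (+ 1 ∷ + 1 ∷ + 1 ∷ + 1 ∷ []))))) (node 1F (+ 192) (node 2F (+ 192) (node 3F (+ 192) (leaf (+ 1 ∷ + 1 ∷ + 1 ∷ + 1 ∷ [])) (node 0F (+ 224) (leaf (+ 1 ∷ + 1 ∷ + 1 ∷ + 1 ∷ [])) (leaf (+ 1 ∷ + 1 ∷ + 1 ∷ + 1 ∷ [])))) (node 3F (+ 192) (leaf (+ 1 ∷ + 1 ∷ + 1 ∷ + 1 ∷ [])) (leaf (+ 1 ∷ + 1 ∷ + 1 ∷ + 1 ∷ [])))) (leaf (+ 1 ∷ + 1 ∷ + 1 ∷ + 1 ∷ []))))))))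

  opaque
    unfolding boundedAbove cornersBounded
    cubeCertificate-valid : T (valid cubeLower cubeUpper cubeCertificate)
    cubeCertificate-valid = _


module LatticeCoordinates where
  open import Data.Rational.Unnormalised
  open import Data.Rational.Unnormalised.Properties
  open import Data.Rational.Unnormalised.Solver
  open +-*-Solver using (solve; Polynomial; _:+_; _:*_; _:-_; :-_; _:=_; con)
  open import Data.Integer as ℤ using (ℤ; +_)
  open import Data.Nat using (ℕ)
  open import Data.Fin.Patterns using (0F; 1F; 2F; 3F)
  open import Data.Vec as Vec using (Vec; []; _∷_)
  open import Data.Vec.Properties using (lookup-zipWith)
  open import Data.Vec.Relation.Binary.Pointwise.Inductive as Pointwise using (Pointwise; []; _∷_)
  open RationalFacts
  open QuadraticForm
  open Expr
  open Integrality using (x₀; x₁; x₂; x₃)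
  open NormFormulas using (Aₑ; Cₑ)
  open Targets

  infix 4 _≈_
  _≈_ : ∀ {n} → Vec ℚᵘ n → Vec ℚᵘ n → Set
  _≈_ = Pointwise _≃_

  data Linear : Expr → Set where
    var : ∀ i → Linear (var i)
    _⊕_ : ∀ {e e′} → Linear e → Linear e′ → Linear (e ⊕ e′)
    lit⊗ : ∀ z {e} → Linear e → Linear (lit z ⊗ e)
    ⊝_ : ∀ {e} → Linear e → Linear (⊝ e)

  linear-⊖ : ∀ {e} → Linear e → ∀ u v → ⟦ e ⟧ᵘ (u ⊖ v) ≃ ⟦ e ⟧ᵘ u - ⟦ e ⟧ᵘ v
  linear-⊖ (var i) u v = ≃-reflexive (lookup-zipWith _-_ i u v)
  linear-⊖ (_⊕_ {e} {e′} l l′) u v = ≃-trans (+-cong (linear-⊖ l u v) (linear-⊖ l′ u v))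
    (solve 4 (λ x y x′ y′ → (x :- y) :+ (x′ :- y′) := (x :+ x′) :- (y :+ y′)) ≃-refl
      (⟦ e ⟧ᵘ u) (⟦ e ⟧ᵘ v) (⟦ e′ ⟧ᵘ u) (⟦ e′ ⟧ᵘ v))
  linear-⊖ (lit⊗ z {e} l) u v = ≃-trans (*-congˡ {fromℤ z} (linear-⊖ l u v))
    (solve 3 (λ k x y → k :* (x :- y) := k :* x :- k :* y) ≃-refl (fromℤ z) (⟦ e ⟧ᵘ u) (⟦ e ⟧ᵘ v))
  linear-⊖ (⊝_ {e} l) u v = ≃-trans (-‿cong (linear-⊖ l u v))
    (solve 2 (λ x y → :- (x :- y) := :- x :- :- y) ≃-refl (⟦ e ⟧ᵘ u) (⟦ e ⟧ᵘ v))

  module _ {n : ℕ} where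
    polynomial-algebra : ExprAlgebra (Polynomial n)
    polynomial-algebra = record { _+_ = _:+_ ; _*_ = _:*_ ; -_ = :-_ ; constant = λ z → con (fromℤ z) }

    ⟦_⟧ᴾ : Expr → Vec (Polynomial n) 4 → Polynomial n
    ⟦ e ⟧ᴾ = ⟦ e ⟧ polynomial-algebra

  A C : ℚᵘ⁴ → ℚᵘ
  A = ⟦ Aₑ ⟧ᵘ
  C = ⟦ Cₑ ⟧ᵘ

  W : ℚᵘ⁴ → ℚᵘ⁴
  W s = ⟦ x₀ ⟧ᵘ s ∷ ⟦ x₁ ⟧ᵘ s ∷ ⟦ x₂ ⟧ᵘ s ∷ ⟦ x₃ ⟧ᵘ s ∷ []

  Wᴾ : ∀ {n} → Vec (Polynomial n) 4 → Vec (Polynomial n) 4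
  Wᴾ s = ⟦ x₀ ⟧ᴾ s ∷ ⟦ x₁ ⟧ᴾ s ∷ ⟦ x₂ ⟧ᴾ s ∷ ⟦ x₃ ⟧ᴾ s ∷ []

  A∘W-eval : ∀ s → eval A∘W s ≃ A (W s)
  A∘W-eval (s0 ∷ s1 ∷ s2 ∷ s3 ∷ []) = solve 4 (λ s0 s1 s2 s3 →
    evalᴾ (Vec.map con (coefficients A∘W)) (s0 ∷ s1 ∷ s2 ∷ s3 ∷ []) := ⟦ Aₑ ⟧ᴾ (Wᴾ (s0 ∷ s1 ∷ s2 ∷ s3 ∷ [])))
    ≃-refl s0 s1 s2 s3

  C∘W-eval : ∀ s → eval C∘W s ≃ C (W s)
  C∘W-eval (s0 ∷ s1 ∷ s2 ∷ s3 ∷ []) = solve 4 (λ s0 s1 s2 s3 →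
    evalᴾ (Vec.map con (coefficients C∘W)) (s0 ∷ s1 ∷ s2 ∷ s3 ∷ []) := ⟦ Cₑ ⟧ᴾ (Wᴾ (s0 ∷ s1 ∷ s2 ∷ s3 ∷ [])))
    ≃-refl s0 s1 s2 s3

  eval-+ᶠ : ∀ F κ G s → eval (F +ᶠ κ · G) s ≃ eval F s + κ * eval G s
  eval-+ᶠ (form a00 a01 a02 a03 a11 a12 a13 a22 a23 a33) κ (form c00 c01 c02 c03 c11 c12 c13 c22 c23 c33) (s0 ∷ s1 ∷ s2 ∷ s3 ∷ []) =
    solve 25 (λ a00 a01 a02 a03 a11 a12 a13 a22 a23 a33 c00 c01 c02 c03 c11 c12 c13 c22 c23 c33 κ s0 s1 s2 s3 →
      let F = a00 ∷ a01 ∷ a02 ∷ a03 ∷ a11 ∷ a12 ∷ a13 ∷ a22 ∷ a23 ∷ a33 ∷ []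
          G = c00 ∷ c01 ∷ c02 ∷ c03 ∷ c11 ∷ c12 ∷ c13 ∷ c22 ∷ c23 ∷ c33 ∷ []
          s = s0 ∷ s1 ∷ s2 ∷ s3 ∷ []
      in evalᴾ (Vec.zipWith (λ f g → f :+ κ :* g) F G) s := evalᴾ F s :+ κ :* evalᴾ G s)
    ≃-refl a00 a01 a02 a03 a11 a12 a13 a22 a23 a33 c00 c01 c02 c03 c11 c12 c13 c22 c23 c33 κ s0 s1 s2 s3

  ⊖-cong : ∀ {n} {u u′ v v′ : Vec ℚᵘ n} → u ≈ u′ → v ≈ v′ → u ⊖ v ≈ u′ ⊖ v′
  ⊖-cong [] [] = []
  ⊖-cong (x≃x′ ∷ u≈u′) (y≃y′ ∷ v≈v′) = +-cong x≃x′ (-‿cong y≃y′) ∷ ⊖-cong u≈u′ v≈v′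

  ⊖-⊖-fromℤ : ∀ {n} t (m k : Vec ℤ n) →
    (t ⊖ Vec.map fromℤ m) ⊖ Vec.map fromℤ k ≈ t ⊖ Vec.map fromℤ (Vec.zipWith ℤ._+_ m k)
  ⊖-⊖-fromℤ [] [] [] = []
  ⊖-⊖-fromℤ (x ∷ t) (m ∷ ms) (k ∷ ks) =
    ≃-trans (solve 3 (λ x m k → (x :- m) :- k := x :- (m :+ k)) ≃-refl x (fromℤ m) (fromℤ k))
      (+-congʳ x (-‿cong (≃-sym (fromℤ-+ m k))))
    ∷ ⊖-⊖-fromℤ t ms ks

  W-cong : ∀ {u v} → u ≈ v → W u ≈ W v
  W-cong u≈v = ⟦⟧ᵘ-cong x₀ u≈v ∷ ⟦⟧ᵘ-cong x₁ u≈v ∷ ⟦⟧ᵘ-cong x₂ u≈v ∷ ⟦⟧ᵘ-cong x₃ u≈v ∷ []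

  W-⊖ : ∀ u v → W (u ⊖ v) ≈ W u ⊖ W v
  W-⊖ u v = linear-⊖ linear₀ u v ∷ linear-⊖ linear₁ u v ∷ linear-⊖ linear₂ u v ∷ linear-⊖ linear₃ u v ∷ []
    where
    linear₀ : Linear x₀
    linear₀ = lit⊗ (+ 4) (var 0F) ⊕ lit⊗ (+ 2) (⊝ var 1F) ⊕ lit⊗ (+ 2) (var 2F) ⊕ ⊝ var 3F
    linear₁ : Linear x₁
    linear₁ = lit⊗ (+ 2) (var 1F) ⊕ var 3F
    linear₂ : Linear x₂
    linear₂ = lit⊗ (+ 2) (var 2F) ⊕ ⊝ var 3F
    linear₃ : Linear x₃
    linear₃ = var 3F

  lattice : Vec ℤ 4 → ℚᵘ⁴
  lattice Y = Vec.map fromℤ (⟦ x₀ ⟧ℤ Y ∷ ⟦ x₁ ⟧ℤ Y ∷ ⟦ x₂ ⟧ℤ Y ∷ ⟦ x₃ ⟧ℤ Y ∷ [])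

  W-fromℤ : ∀ Y → W (Vec.map fromℤ Y) ≈ lattice Y
  W-fromℤ Y = ≃-sym (fromℤ-⟦⟧ x₀ Y) ∷ ≃-sym (fromℤ-⟦⟧ x₁ Y) ∷ ≃-sym (fromℤ-⟦⟧ x₂ Y) ∷ ≃-sym (fromℤ-⟦⟧ x₃ Y) ∷ []

  infix 8 4·_
  4·_ : ℚᵘ⁴ → ℚᵘ⁴
  4· v = Vec.map (fromℤ (+ 4) *_) v

  toGrid : ℚᵘ⁴ → ℚᵘ⁴
  toGrid (a ∷ b ∷ c ∷ d ∷ []) =
    (a + b - c - d) ∷ fromℤ (+ 2) * (b - d) ∷ fromℤ (+ 2) * (c + d) ∷ fromℤ (+ 4) * d ∷ []

  W∘toGrid : ∀ v → W (toGrid v) ≈ 4· v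
  W∘toGrid (a ∷ b ∷ c ∷ d ∷ []) =
    solve 4 (λ a b c d → ⟦ x₀ ⟧ᴾ (toGridᴾ a b c d) := con (fromℤ (+ 4)) :* a) ≃-refl a b c d ∷
    solve 4 (λ a b c d → ⟦ x₁ ⟧ᴾ (toGridᴾ a b c d) := con (fromℤ (+ 4)) :* b) ≃-refl a b c d ∷
    solve 4 (λ a b c d → ⟦ x₂ ⟧ᴾ (toGridᴾ a b c d) := con (fromℤ (+ 4)) :* c) ≃-refl a b c d ∷
    solve 4 (λ a b c d → ⟦ x₃ ⟧ᴾ (toGridᴾ a b c d) := con (fromℤ (+ 4)) :* d) ≃-refl a b c d ∷ []
    where
    toGridᴾ : ∀ {n} → Polynomial n → Polynomial n → Polynomial n → Polynomial n → Vec (Polynomial n) 4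
    toGridᴾ a b c d = (a :+ b :- c :- d) ∷ con (fromℤ (+ 2)) :* (b :- d) ∷ con (fromℤ (+ 2)) :* (c :+ d) ∷ con (fromℤ (+ 4)) :* d ∷ []

  A-4· : ∀ z → A (4· z) ≃ fromℤ (+ 16) * A z
  A-4· (a ∷ b ∷ c ∷ d ∷ []) = solve 4 (λ a b c d →
    ⟦ Aₑ ⟧ᴾ (Vec.map (con (fromℤ (+ 4)) :*_) (a ∷ b ∷ c ∷ d ∷ [])) := con (fromℤ (+ 16)) :* ⟦ Aₑ ⟧ᴾ (a ∷ b ∷ c ∷ d ∷ []))
    ≃-refl a b c d

  C-4· : ∀ z → C (4· z) ≃ fromℤ (+ 16) * C z
  C-4· (a ∷ b ∷ c ∷ d ∷ []) = solve 4 (λ a b c d →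
    ⟦ Cₑ ⟧ᴾ (Vec.map (con (fromℤ (+ 4)) :*_) (a ∷ b ∷ c ∷ d ∷ [])) := con (fromℤ (+ 16)) :* ⟦ Cₑ ⟧ᴾ (a ∷ b ∷ c ∷ d ∷ []))
    ≃-refl a b c d


module Reduction where
  open import Data.Rational.Unnormalised
  open import Data.Rational.Unnormalised.Properties
  open import Data.Rational.Unnormalised.Solver
  open +-*-Solver using (solve; _:+_; _:*_; _:=_; con)
  open import Data.Integer as ℤ using (ℤ; +_)
  open import Data.Vec as Vec using (Vec; []; _∷_)
  import Data.Vec.Relation.Binary.Pointwise.Inductive as Pointwise
  open import Data.Product using (Σ; _×_; _,_)
  open import Data.Fin.Patterns using (0F; 1F; 2F; 3F)
  open import Relation.Binary.PropositionalEquality using (refl)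
  open RationalFacts
  open QuadraticForm
  open Expr
  open NormFormulas using (Aₑ; Cₑ)
  open Targets
  open LatticeCoordinates
  open Certificate
  open BoxCover
  open Certified WithinTargets targetTest targetTest-sound

  -- φ⁴/3 = 7/6 + √5/2, evaluated at a rational approximation κ of √5
  ψBound : ℚᵘ → ℚᵘ
  ψBound κ = + 7 / 6 + κ * (+ 1 / 2)

  record SmallRemainder (z : ℚᵘ⁴) : Set where
    field
      A+κ₁C≤ : A z + κ₁ * C z ≤ ψBound κ₁
      A-κ₁C≤ : A z + (- κ₁) * C z ≤ ψBound κ₁
      A+κ₃C≤ : A z + κ₃ * C z ≤ ψBound κ₃
      A-κ₃C≤ : A z + (- κ₃) * C z ≤ ψBound κ₃
      product≤ : (A z + κ₁ * C z) * (A z + (- κ₁) * C z) ≤ + 5 / 9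

  eval-A∘W+κC∘W : ∀ κ s z → W s ≈ 4· z → eval (A∘W +ᶠ κ · C∘W) s ≃ fromℤ (+ 16) * (A z + κ * C z)
  eval-A∘W+κC∘W κ s z Ws≈4z = begin-equality
    eval (A∘W +ᶠ κ · C∘W) s                          ≃⟨ eval-+ᶠ A∘W κ C∘W s ⟩
    eval A∘W s + κ * eval C∘W s                      ≃⟨ +-cong (A∘W-eval s) (*-congˡ {κ} (C∘W-eval s)) ⟩
    A (W s) + κ * C (W s)                            ≃⟨ +-cong (⟦⟧ᵘ-cong Aₑ Ws≈4z) (*-congˡ {κ} (⟦⟧ᵘ-cong Cₑ Ws≈4z)) ⟩
    A (4· z) + κ * C (4· z)                          ≃⟨ +-cong (A-4· z) (*-congˡ {κ} (C-4· z)) ⟩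
    fromℤ (+ 16) * A z + κ * (fromℤ (+ 16) * C z)    ≃⟨ solve 3 (λ a c k → con (fromℤ (+ 16)) :* a :+ k :* (con (fromℤ (+ 16)) :* c)
                                                           := con (fromℤ (+ 16)) :* (a :+ k :* c)) ≃-refl (A z) (C z) κ ⟩
    fromℤ (+ 16) * (A z + κ * C z)                   ∎
    where open ≤-Reasoning

  within⇒small : ∀ s z → W s ≈ 4· z → WithinTargets s → SmallRemainder z
  within⇒small s z Ws≈4z within = record
    { A+κ₁C≤ = bound κ₁ β₁ κ₁ F₁≤β₁ (*≡* refl)
    ; A-κ₁C≤ = bound (- κ₁) β₁ κ₁ F₂≤β₁ (*≡* refl)
    ; A+κ₃C≤ = bound κ₃ β₃ κ₃ F₃≤β₃ (*≡* refl)
    ; A-κ₃C≤ = bound (- κ₃) β₃ κ₃ F₄≤β₃ (*≡* refl)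
    ; product≤ = *-cancelˡ-≤-pos (fromℤ (+ 256)) (≤-respʳ-≃ (*≡* refl) (≤-respˡ-≃ product≃ F₁F₂≤normBound)) }
    where
    open WithinTargets within
    P₁ P₂ : ℚᵘ
    P₁ = A z + κ₁ * C z
    P₂ = A z + (- κ₁) * C z
    product≃ : eval F₁ s * eval F₂ s ≃ fromℤ (+ 256) * (P₁ * P₂)
    product≃ = ≃-trans (*-cong (eval-A∘W+κC∘W κ₁ s z Ws≈4z) (eval-A∘W+κC∘W (- κ₁) s z Ws≈4z))
      (solve 2 (λ x y → (con (fromℤ (+ 16)) :* x) :* (con (fromℤ (+ 16)) :* y) := con (fromℤ (+ 256)) :* (x :* y)) ≃-refl P₁ P₂)
    bound : ∀ κ β κ′ → eval (A∘W +ᶠ κ · C∘W) s ≤ β → β ≃ fromℤ (+ 16) * ψBound κ′ → A z + κ * C z ≤ ψBound κ′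
    bound κ β κ′ F≤β β≃ = *-cancelˡ-≤-pos (fromℤ (+ 16)) (≤-respʳ-≃ β≃ (≤-respˡ-≃ (eval-A∘W+κC∘W κ s z Ws≈4z) F≤β))

  fract : ℚᵘ⁴ → ℚᵘ⁴
  fract t = t ⊖ Vec.map fromℤ (Vec.map floor t)

  inGrid : ∀ x → gridPoint (+ 0) ≤ x - fromℤ (floor x) × x - fromℤ (floor x) ≤ gridPoint (+ 256)
  inGrid x = ≤-respˡ-≃ (*≡* refl) (0≤p-⌊p⌋ x) , ≤-respʳ-≃ (*≡* refl) (p-⌊p⌋≤1 x)

  fract-inUnitCube : ∀ t → InBox cubeLower cubeUpper (fract t)
  fract-inUnitCube (t0 ∷ t1 ∷ t2 ∷ t3 ∷ []) 0F = inGrid t0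
  fract-inUnitCube (t0 ∷ t1 ∷ t2 ∷ t3 ∷ []) 1F = inGrid t1
  fract-inUnitCube (t0 ∷ t1 ∷ t2 ∷ t3 ∷ []) 2F = inGrid t2
  fract-inUnitCube (t0 ∷ t1 ∷ t2 ∷ t3 ∷ []) 3F = inGrid t3

  reduce : ∀ v → Σ (Vec ℤ 4) (λ Y → ∀ z → 4· v ⊖ lattice Y ≈ 4· z → SmallRemainder z)
  reduce v with cover cubeCertificate cubeLower cubeUpper cubeCertificate-valid (fract (toGrid v)) (fract-inUnitCube (toGrid v))
  ... | N , within = Y , λ z close → within⇒small s z (W-reduced z close) within
    where
    t = toGrid v
    ⌊t⌋ = Vec.map floor t
    Y = Vec.zipWith ℤ._+_ ⌊t⌋ N
    s = fract t ⊖ Vec.map fromℤ N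
    open import Relation.Binary.Reasoning.Setoid (Pointwise.setoid ≃-setoid 4)
    W-reduced : ∀ z → 4· v ⊖ lattice Y ≈ 4· z → W s ≈ 4· z
    W-reduced z close = begin
      W s                                ≈⟨ W-cong (⊖-⊖-fromℤ t ⌊t⌋ N) ⟩
      W (t ⊖ Vec.map fromℤ Y)            ≈⟨ W-⊖ t (Vec.map fromℤ Y) ⟩
      W t ⊖ W (Vec.map fromℤ Y)          ≈⟨ ⊖-cong (W∘toGrid v) (W-fromℤ Y) ⟩
      4· v ⊖ lattice Y                   ≈⟨ close ⟩
      4· z                               ∎


module Bounds where
  open import Data.Rational.Unnormalised as ℚᵘ using (ℚᵘ; _≃_; *≡*; 0ℚᵘ)
  open import Data.Rational.Unnormalised.Properties
  open import Data.Rational.Unnormalised.Solver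
  open +-*-Solver using (solve; _:+_; _:*_; _:-_; :-_; _:=_; con)
  open import Data.Rational as ℚ using (ℚ; toℚᵘ)
  import Data.Rational.Properties as ℚ
  open import Data.Integer using (+_)
  open import Data.Vec as Vec using (Vec)
  open import Data.Vec.Relation.Binary.Pointwise.Inductive using ([]; _∷_)
  open import Data.Product using (_,_)
  open import Data.Sum using (inj₁; inj₂)
  open import Data.Bool using (true; false)
  open import Relation.Binary.PropositionalEquality using (refl; cong)
  open import Defs
  open RationalFacts
  open Sqrt5
  open Expr
  open Integrality using (x₀; x₁; x₂; x₃; ¼; latticePoint)
  open NormFormulas
  open Targets using (κ₁; κ₃)
  open LatticeCoordinates using (_≈_; 4·_; A; C; lattice)
  open QuadraticForm using (_⊖_)
  open Reduction using (ψBound; SmallRemainder)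

  zᵘ : K → Vec ℚᵘ 4
  zᵘ z = Vec.map toℚᵘ (coordinates z)

  toℚᵘ-c1-zσz : ∀ z → toℚᵘ (c1 (z *K σ z)) ≃ A (zᵘ z)
  toℚᵘ-c1-zσz z = ≃-trans (≃-reflexive (cong toℚᵘ (c1-zσz z))) (toℚᵘ-⟦⟧ Aₑ (coordinates z))

  toℚᵘ-ct-zσz : ∀ z → toℚᵘ (ct (z *K σ z)) ≃ C (zᵘ z)
  toℚᵘ-ct-zσz z = ≃-trans (≃-reflexive (cong toℚᵘ (ct-zσz z))) (toℚᵘ-⟦⟧ Cₑ (coordinates z))

  toℚᵘ-normK : ∀ z → toℚᵘ (normK z) ≃ ⟦ Nₑ ⟧ᵘ (zᵘ z)
  toℚᵘ-normK z = ≃-trans (≃-reflexive (cong toℚᵘ (normK≡A²-5C² z))) (toℚᵘ-⟦⟧ Nₑ (coordinates z))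

  toℚᵘ-neg : ∀ p {P} → toℚᵘ p ≃ P → toℚᵘ (ℚ.- p) ≃ ℚᵘ.- P
  toℚᵘ-neg p p≃P = ≃-trans (ℚ.toℚᵘ-homo‿- p) (-‿cong p≃P)

  toℚᵘ-sub : ∀ p r {P R} → toℚᵘ p ≃ P → toℚᵘ r ≃ R → toℚᵘ (p ℚ.- r) ≃ P ℚᵘ.- R
  toℚᵘ-sub p r p≃P r≃R = ≃-trans (ℚ.toℚᵘ-homo-+ p (ℚ.- r)) (+-cong p≃P (toℚᵘ-neg r r≃R))

  toℚᵘ-sq : ∀ {p P} → toℚᵘ p ≃ P → toℚᵘ (p ℚ.* p) ≃ P ℚᵘ.* P
  toℚᵘ-sq {p} p≃P = ≃-trans (ℚ.toℚᵘ-homo-* p p) (*-cong p≃P p≃P)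

  toℚᵘ-5sq : ∀ {r R} → toℚᵘ r ≃ R → toℚᵘ (q (+ 5) ℚ.* (r ℚ.* r)) ≃ + 5 ℚᵘ./ 1 ℚᵘ.* (R ℚᵘ.* R)
  toℚᵘ-5sq {r} r≃R = ≃-trans (ℚ.toℚᵘ-homo-* (q (+ 5)) (r ℚ.* r)) (*-cong (toℚᵘ-q (+ 5)) (toℚᵘ-sq r≃R))

  NonNeg√5⇒NonNeg : ∀ {p r P R} → toℚᵘ p ≃ P → toℚᵘ r ≃ R → NonNeg√5 P R → NonNeg (p +√5· r)
  NonNeg√5⇒NonNeg p≃P r≃R (inj₁ (0≤P , 0≤R)) = inj₁ (fromℚᵘ-≤ p≃P 0≤P , fromℚᵘ-≤ r≃R 0≤R)
    where
    fromℚᵘ-≤ : ∀ {s S} → toℚᵘ s ≃ S → 0ℚᵘ ℚᵘ.≤ S → ℚ.0ℚ ℚ.≤ s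
    fromℚᵘ-≤ s≃S 0≤S = ℚ.toℚᵘ-cancel-≤ (≤-respʳ-≃ (≃-sym s≃S) 0≤S)
  NonNeg√5⇒NonNeg p≃P r≃R (inj₂ (inj₁ (0≤P , 5R²≤P²))) = inj₂ (inj₁
    (ℚ.toℚᵘ-cancel-≤ (≤-respʳ-≃ (≃-sym p≃P) 0≤P) ,
     ℚ.toℚᵘ-cancel-≤ (≤-respʳ-≃ (≃-sym (toℚᵘ-sq p≃P)) (≤-respˡ-≃ (≃-sym (toℚᵘ-5sq r≃R)) 5R²≤P²))))
  NonNeg√5⇒NonNeg p≃P r≃R (inj₂ (inj₂ (0≤R , P²≤5R²))) = inj₂ (inj₂
    (ℚ.toℚᵘ-cancel-≤ (≤-respʳ-≃ (≃-sym r≃R) 0≤R) ,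
     ℚ.toℚᵘ-cancel-≤ (≤-respˡ-≃ (≃-sym (toℚᵘ-sq p≃P)) (≤-respʳ-≃ (≃-sym (toℚᵘ-5sq r≃R)) P²≤5R²))))

  slack : ∀ a c κ → a ℚᵘ.+ κ ℚᵘ.* c ℚᵘ.≤ ψBound κ →
    0ℚᵘ ℚᵘ.≤ (+ 7 ℚᵘ./ 6 ℚᵘ.- a) ℚᵘ.+ κ ℚᵘ.* (+ 1 ℚᵘ./ 2 ℚᵘ.- c)
  slack a c κ a+κc≤ = ≤-respʳ-≃ (solve 5 (λ s h a c k → (s :+ k :* h) :- (a :+ k :* c) := (s :- a) :+ k :* (h :- c))
    ≃-refl (+ 7 ℚᵘ./ 6) (+ 1 ℚᵘ./ 2) a c κ) (p≤q⇒0≤q-p a+κc≤)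

  -κ·c≃κ·-c : ∀ a c κ → a ℚᵘ.+ (ℚᵘ.- κ) ℚᵘ.* c ≃ a ℚᵘ.+ κ ℚᵘ.* (ℚᵘ.- c)
  -κ·c≃κ·-c = solve 3 (λ a c k → a :+ (:- k) :* c := a :+ k :* (:- c)) ≃-refl

  κ₁²≤5 : κ₁ ℚᵘ.* κ₁ ℚᵘ.≤ + 5 ℚᵘ./ 1
  κ₁²≤5 = ≤ᵇ⇒≤ _

  5≤κ₃² : + 5 ℚᵘ./ 1 ℚᵘ.≤ κ₃ ℚᵘ.* κ₃
  5≤κ₃² = ≤ᵇ⇒≤ _

  0≤κ₃ : 0ℚᵘ ℚᵘ.≤ κ₃
  0≤κ₃ = ≤ᵇ⇒≤ _

  -- φ⁴/3 computes to 7/6 +√5· 1/2, so the goal is NonNeg ((7/6 - A) +√5· (1/2 ∓ C)).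
  sqAbs≤φ⁴/3 : ∀ z → SmallRemainder (zᵘ z) → ∀ ψ → sqAbs ψ z ≤R φ⁴/3
  sqAbs≤φ⁴/3 z small (_ , true) =
    NonNeg√5⇒NonNeg (toℚᵘ-sub (+ 7 ℚ./ 6) (c1 (z *K σ z)) ≃-refl (toℚᵘ-c1-zσz z))
      (toℚᵘ-sub (+ 1 ℚ./ 2) (ct (z *K σ z)) ≃-refl (toℚᵘ-ct-zσz z))
      (bracket⇒NonNeg√5 κ₁²≤5 5≤κ₃² 0≤κ₃ (slack a c κ₁ A+κ₁C≤) (slack a c κ₃ A+κ₃C≤))
    where
    open SmallRemainder small
    a = A (zᵘ z)
    c = C (zᵘ z)
  sqAbs≤φ⁴/3 z small (_ , false) =
    NonNeg√5⇒NonNeg (toℚᵘ-sub (+ 7 ℚ./ 6) (c1 (z *K σ z)) ≃-refl (toℚᵘ-c1-zσz z))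
      (toℚᵘ-sub (+ 1 ℚ./ 2) (ℚ.- ct (z *K σ z)) ≃-refl (toℚᵘ-neg (ct (z *K σ z)) (toℚᵘ-ct-zσz z)))
      (bracket⇒NonNeg√5 κ₁²≤5 5≤κ₃² 0≤κ₃
        (slack a (ℚᵘ.- c) κ₁ (≤-respˡ-≃ (-κ·c≃κ·-c a c κ₁) A-κ₁C≤))
        (slack a (ℚᵘ.- c) κ₃ (≤-respˡ-≃ (-κ·c≃κ·-c a c κ₃) A-κ₃C≤)))
    where
    open SmallRemainder small
    a = A (zᵘ z)
    c = C (zᵘ z)

  normK≤5/9 : ∀ z → SmallRemainder (zᵘ z) → normK z ℚ.≤ + 5 ℚ./ 9
  normK≤5/9 z small = ℚ.toℚᵘ-cancel-≤ (≤-respˡ-≃ (≃-sym (toℚᵘ-normK z)) (≤-trans A²-5C²≤product product≤))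
    where
    open SmallRemainder small
    a = A (zᵘ z)
    c = C (zᵘ z)
    A²-5C²≤product : a ℚᵘ.* a ℚᵘ.- + 5 ℚᵘ./ 1 ℚᵘ.* (c ℚᵘ.* c) ℚᵘ.≤ (a ℚᵘ.+ κ₁ ℚᵘ.* c) ℚᵘ.* (a ℚᵘ.+ (ℚᵘ.- κ₁) ℚᵘ.* c)
    A²-5C²≤product = ≤-trans
      (+-monoʳ-≤ (a ℚᵘ.* a) (neg-mono-≤ (*-monoˡ-≤-nonNeg (c ℚᵘ.* c) {{ℚᵘ.nonNegative (0≤p*p c)}} κ₁²≤5)))
      (≤-reflexive (solve 3 (λ a c k → a :* a :- (k :* k) :* (c :* c) := (a :+ k :* c) :* (a :+ (:- k) :* c)) ≃-refl a c κ₁))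

  4·remainder : ∀ p k → + 4 ℚᵘ./ 1 ℚᵘ.* toℚᵘ p ℚᵘ.- fromℤ k ≃ + 4 ℚᵘ./ 1 ℚᵘ.* toℚᵘ (p ℚ.- q k ℚ.* ¼)
  4·remainder p k = ≃-sym (begin-equality
    + 4 ℚᵘ./ 1 ℚᵘ.* toℚᵘ (p ℚ.- q k ℚ.* ¼)
      ≃⟨ *-congˡ {+ 4 ℚᵘ./ 1} (toℚᵘ-sub p (q k ℚ.* ¼) ≃-refl (≃-trans (ℚ.toℚᵘ-homo-* (q k) ¼) (*-congʳ (toℚᵘ-q k)))) ⟩
    + 4 ℚᵘ./ 1 ℚᵘ.* (toℚᵘ p ℚᵘ.- fromℤ k ℚᵘ.* toℚᵘ ¼)
      ≃⟨ solve 3 (λ p k u → con (+ 4 ℚᵘ./ 1) :* (p :- k :* u) := con (+ 4 ℚᵘ./ 1) :* p :- k :* (con (+ 4 ℚᵘ./ 1) :* u))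
           ≃-refl (toℚᵘ p) (fromℤ k) (toℚᵘ ¼) ⟩
    + 4 ℚᵘ./ 1 ℚᵘ.* toℚᵘ p ℚᵘ.- fromℤ k ℚᵘ.* (+ 4 ℚᵘ./ 1 ℚᵘ.* toℚᵘ ¼)
      ≃⟨ +-congʳ (+ 4 ℚᵘ./ 1 ℚᵘ.* toℚᵘ p) (-‿cong (≃-trans (*-congˡ {fromℤ k} (*≡* refl)) (*-identityʳ (fromℤ k)))) ⟩
    + 4 ℚᵘ./ 1 ℚᵘ.* toℚᵘ p ℚᵘ.- fromℤ k ∎)
    where open ≤-Reasoning

  remainder-coordinates : ∀ x Y → 4· zᵘ x ⊖ lattice Y ≈ 4· zᵘ (x -K latticePoint Y)
  remainder-coordinates x Y = 4·remainder (c1 x) (⟦ x₀ ⟧ℤ Y) ∷ 4·remainder (cs x) (⟦ x₁ ⟧ℤ Y)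
    ∷ 4·remainder (ct x) (⟦ x₂ ⟧ℤ Y) ∷ 4·remainder (cst x) (⟦ x₃ ⟧ℤ Y) ∷ []


open import Defs
open import Data.Product using (_×_; Σ)
open import Relation.Binary.PropositionalEquality using (_≢_)
open import Data.Rational using (_≤_; _/_)
open import Data.Integer using (+_)
open import Data.Product using (_,_; proj₁; proj₂)
open Integrality using (latticePoint; latticePoint-isAlgInt)
open Reduction using (reduce; SmallRemainder)
open Bounds

-- The bounds hold for every embedding.
lemma8p4 : (ψ₁ ψ₂ : Emb) → ψ₁ ≢ ψ₂ → ψ₂ ≢ conjEmb ψ₁ → (x : K) →
  Σ K (λ y → IsAlgInt y × normK (x -K y) ≤ (+ 5 / 9)
    × sqAbs ψ₁ (x -K y) ≤R φ⁴/3 × sqAbs ψ₂ (x -K y) ≤R φ⁴/3)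
lemma8p4 ψ₁ ψ₂ _ _ x = latticePoint Y , latticePoint-isAlgInt Y ,
  normK≤5/9 z small , sqAbs≤φ⁴/3 z small ψ₁ , sqAbs≤φ⁴/3 z small ψ₂
  where
  Y = proj₁ (reduce (zᵘ x))
  z = x -K latticePoint Y
  small : SmallRemainder (zᵘ z)
  small = proj₂ (reduce (zᵘ x)) (zᵘ z) (remainder-coordinates x Y)
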